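{- For an $R$-labeled poset $P$ of rank $n$, we have \[ \iota\big({\text{ex}}\Psi(P;y,\mathbf{a},\mathbf{b})\big)=\sum_{\mathcal{C}\text{ chain in }P\setminus\{\hat 0,\hat 1\}}\mathrm{Poin}_{\{\hat 0\}\cup\mathcal{C}}(P;y)\cdot{\sf wt}^-_{\mathcal{C}}(\mathbf{a},\mathbf{b})\ \in\mathbb{N}[y]\langle\mathbf{a},\mathbf{b}\rangle, \] where ${\sf wt}^-_{\mathcal{C}}(\mathbf{a},\mathbf{b})=w_1\cdots w_{n-1}$ with $w_i=\mathbf{b}$ if $i\in{\sf Rank}(\mathcal{C})$ and $w_i=\mathbf{a}-\mathbf{b}$ otherwise.
   Context: A graded poset $P$ of rank $n$ is a finite poset with unique minimum $\hat 0$ (rank $0$) and unique maximum $\hat 1$ (rank $n$) such that ${\sf rank}(X)$ equals the length of every maximal chain from $\hat 0$ to $X$. A chain is a (possibly empty) totally ordered subset; for a chain $\mathcal{C}=\{\mathcal{C}_1<\dots<\mathcal{C}_k\}$ put ${\sf Rank}(\mathcal{C})=\{{\sf rank}(\mathcal{C}_i)\}$. For a graded poset $Q$ with minimum $\hat 0_Q$ and Möbius function $\mu$, $\mathrm{Poin}(Q;y)=\sum_{X\in Q}|\mu(\hat 0_Q,X)|\,y^{{\sf rank}_Q(X)}$. The chain Poincaré polynomial is $\mathrm{Poin}_{\mathcal{C}}(P;y)=\prod_{i=1}^k\mathrm{Poin}([\mathcal{C}_i,\mathcal{C}_{i+1}];y)$ with $\mathcal{C}_{k+1}=\hat 1$ (empty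 product $=1$). The extended $\mathbf{a}\mathbf{b}$-index is ${\text{ex}}\Psi(P;y,\mathbf{a},\mathbf{b})=\sum_{\mathcal{C}}\mathrm{Poin}_{\mathcal{C}}(P;y)\,{\sf wt}_{\mathcal{C}}(\mathbf{a},\mathbf{b})\in\mathbb{Z}[y]\langle\mathbf{a},\mathbf{b}\rangle$ over all chains $\mathcal{C}$ in $P\setminus\{\hat 1\}$, with noncommuting $\mathbf{a},\mathbf{b}$ and ${\sf wt}_{\mathcal{C}}=w_0\cdots w_{n-1}$, $w_i=\mathbf{b}$ if $i\in{\sf Rank}(\mathcal{C})$, $w_i=\mathbf{a}-\mathbf{b}$ otherwise. The map $\iota$ is the $\mathbb{Z}[y]$-linear map deleting the first letter of every monomial in $\mathbf{a},\mathbf{b}$. An $R$-labeling of $P$ is a map from cover relations to positive integers such that every interval $[X,Y]$ has a unique maximal chain with weakly increasing labels; $P$ is $R$-labeled if it is finite, graded and admits one. -}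

module Defs where

open import Data.Nat as ℕ using (ℕ; zero; suc; _∸_; _≡ᵇ_)
open import Data.Integer as ℤ using (ℤ; +_; -_; ∣_∣; 0ℤ; 1ℤ)
open import Data.Fin using (Fin)
open import Data.Fin.Properties using () renaming (_≟_ to _≟F_)
open import Data.Bool using (Bool; true; false; _∧_; _∨_; not; if_then_else_)
open import Data.List using (List; []; _∷_; _++_; map; foldr; allFin; upTo; concatMap; length)
open import Data.Bool.ListAction using (all; any)
open import Data.List.Relation.Unary.Linked using (Linked)
open import Data.Product using (Σ; _×_; _,_; ∃-syntax)
open import Data.Sum using (_⊎_)
open import Relation.Nullary using (¬_)
open import Relation.Nullary.Decidable using (⌊_⌋)
open import Relation.Binary using (Decidable; IsPartialOrder)
open import Relation.Binary.PropositionalEquality using (_≡_; _≢_)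

-- ℤ[y] : polynomials in y, as coefficient functions (coefficient of y^k)

Poly : Set
Poly = ℕ → ℤ

sumℤ : List ℤ → ℤ
sumℤ = foldr ℤ._+_ 0ℤ

0ₚ 1ₚ : Poly
0ₚ _ = 0ℤ
1ₚ zero = 1ℤ
1ₚ (suc _) = 0ℤ

_+ₚ_ : Poly → Poly → Poly
(p +ₚ q) k = p k ℤ.+ q k

_*ₚ_ : Poly → Poly → Poly
(p *ₚ q) k = sumℤ (map (λ i → p i ℤ.* q (k ∸ i)) (upTo (suc k)))

-- ℤ[y]⟨a,b⟩ : noncommutative polynomials in a, b over ℤ[y],
-- as coefficient functions on words (monomials)

data Letter : Set where
  𝐚 𝐛 : Letter

Word : Set
Word = List Letter

_==L_ : Letter → Letter → Bool
𝐚 ==L 𝐚 = true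
𝐛 ==L 𝐛 = true
_ ==L _ = false

_==W_ : Word → Word → Bool
[] ==W [] = true
(x ∷ u) ==W (y ∷ v) = (x ==L y) ∧ (u ==W v)
_ ==W _ = false

NC : Set
NC = Word → Poly

mono : Word → NC
mono w v = if w ==W v then 1ₚ else 0ₚ

0ᴺ 1ᴺ 𝐀 𝐁 : NC
0ᴺ _ = 0ₚ
1ᴺ = mono []
𝐀 = mono (𝐚 ∷ [])
𝐁 = mono (𝐛 ∷ [])

_+ᴺ_ : NC → NC → NC
(f +ᴺ g) w = f w +ₚ g w

-ᴺ_ : NC → NC
(-ᴺ f) w k = - f w k

_-ᴺ_ : NC → NC → NC
f -ᴺ g = f +ᴺ (-ᴺ g)

_·ᴺ_ : Poly → NC → NC
(c ·ᴺ f) w = c *ₚ f w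

sumᴺ : List NC → NC
sumᴺ = foldr _+ᴺ_ 0ᴺ

splits : Word → List (Word × Word)
splits [] = ([] , []) ∷ []
splits (x ∷ w) = ([] , x ∷ w) ∷ map (λ { (u , v) → (x ∷ u , v) }) (splits w)

_*ᴺ_ : NC → NC → NC
(f *ᴺ g) w = sumᴺ (map (λ { (u , v) → λ _ → f u *ₚ g v }) (splits w)) w

prodᴺ : List NC → NC
prodᴺ = foldr _*ᴺ_ 1ᴺ

-- ι : ℤ[y]-linear map deleting the first letter of every monomial
-- (the empty monomial has no first letter and is left unchanged).
ι : NC → NC
ι f v = (f (𝐚 ∷ v) +ₚ f (𝐛 ∷ v)) +ₚ (if [] ==W v then f [] else 0ₚ)

module Order {m : ℕ} (_≤_ : Fin m → Fin m → Set) where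

  Cover : Fin m → Fin m → Set
  Cover X Y = X ≤ Y × X ≢ Y × (∀ Z → X ≤ Z → Z ≤ Y → Z ≡ X ⊎ Z ≡ Y)

  -- SatFrom X zs Y : X ⋖ z₁ ⋖ z₂ ⋖ ⋯ ⋖ z_k = Y  where zs = z₁ ∷ ⋯ ∷ z_k
  -- (a maximal chain of the interval [X,Y], listed after X); its length is k.
  SatFrom : Fin m → List (Fin m) → Fin m → Set
  SatFrom X [] Y = X ≡ Y
  SatFrom X (Z ∷ zs) Y = Cover X Z × SatFrom Z zs Y

record GradedPoset (m n : ℕ) : Set₁ where
  field
    _≤_ : Fin m → Fin m → Set
    _≤?_ : Decidable _≤_
    isPartialOrder : IsPartialOrder _≡_ _≤_
    𝟘 𝟙 : Fin m
    𝟘-min : ∀ X → 𝟘 ≤ X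
    𝟙-max : ∀ X → X ≤ 𝟙
    rank : Fin m → ℕ
    rank-spec : ∀ X zs → Order.SatFrom _≤_ 𝟘 zs X → length zs ≡ rank X
    rank-𝟙 : rank 𝟙 ≡ n

module _ {m n : ℕ} (P : GradedPoset m n) where
  open GradedPoset P
  open Order _≤_

  labels : (Fin m → Fin m → ℕ) → Fin m → List (Fin m) → List ℕ
  labels λ' X [] = []
  labels λ' X (Z ∷ zs) = λ' X Z ∷ labels λ' Z zs

  record RLabeling : Set where
    field
      lab : Fin m → Fin m → ℕ          -- only values on cover relations matter
      lab-pos : ∀ X Y → Cover X Y → 1 ℕ.≤ lab X Y
      unique-incr : ∀ X Y → X ≤ Y →
        Σ (List (Fin m)) λ zs →
          (SatFrom X zs Y × Linked ℕ._≤_ (labels lab X zs)) ×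
          (∀ zs′ → SatFrom X zs′ Y → Linked ℕ._≤_ (labels lab X zs′) → zs′ ≡ zs)

module Index {m n : ℕ} (P : GradedPoset m n) where
  open GradedPoset P

  _≤ᵇ_ : Fin m → Fin m → Bool
  X ≤ᵇ Y = ⌊ X ≤? Y ⌋

  _≡ᶠ_ : Fin m → Fin m → Bool
  X ≡ᶠ Y = ⌊ X ≟F Y ⌋

  _<ᵇ_ : Fin m → Fin m → Bool
  X <ᵇ Y = (X ≤ᵇ Y) ∧ not (X ≡ᶠ Y)

  -- μ(X,X) = 1, μ(X,Y) = - Σ_{X ≤ Z < Y} μ(X,Z) for X < Y, 0 otherwise.
  -- Recursion with fuel; fuel m suffices since chains have < m steps.
  mobiusF : ℕ → Fin m → Fin m → ℤ
  mobiusF zero X Y = 0ℤ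
  mobiusF (suc f) X Y =
    if X ≡ᶠ Y then 1ℤ
    else if X ≤ᵇ Y
      then - sumℤ (map (λ Z → if (X ≤ᵇ Z) ∧ (Z <ᵇ Y) then mobiusF f X Z else 0ℤ) (allFin m))
      else 0ℤ

  μ : Fin m → Fin m → ℤ
  μ = mobiusF m

  PoinI : Fin m → Fin m → Poly
  PoinI X Y k = sumℤ (map (λ Z →
    if (X ≤ᵇ Z) ∧ (Z ≤ᵇ Y) ∧ ((rank Z ∸ rank X) ≡ᵇ k) then + ∣ μ X Z ∣ else 0ℤ)
    (allFin m))

  -- chains are represented by their strictly increasing element lists
  -- C₁ < C₂ < ⋯ < C_k
  strictIncr : List (Fin m) → Bool
  strictIncr [] = true
  strictIncr (X ∷ []) = true
  strictIncr (X ∷ Y ∷ zs) = (X <ᵇ Y) ∧ strictIncr (Y ∷ zs)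

  listsOfLen : ℕ → List (List (Fin m))
  listsOfLen zero = [] ∷ []
  listsOfLen (suc k) = concatMap (λ X → map (X ∷_) (listsOfLen k)) (allFin m)

  -- candidate lists: all lists of length ≤ m (a chain has at most m elements)
  allLists : List (List (Fin m))
  allLists = concatMap listsOfLen (upTo (suc m))

  nextOr𝟙 : List (Fin m) → Fin m
  nextOr𝟙 [] = 𝟙
  nextOr𝟙 (Y ∷ _) = Y

  PoinC : List (Fin m) → Poly
  PoinC [] = 1ₚ
  PoinC (X ∷ zs) = PoinI X (nextOr𝟙 zs) *ₚ PoinC zs

  inRank : ℕ → List (Fin m) → Bool
  inRank i C = any (λ X → rank X ≡ᵇ i) C

  letterFactor : List (Fin m) → ℕ → NC
  letterFactor C i = if inRank i C then 𝐁 else (𝐀 -ᴺ 𝐁)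

  wt : List (Fin m) → NC
  wt C = prodᴺ (map (letterFactor C) (upTo n))

  wt⁻ : List (Fin m) → NC
  wt⁻ C = prodᴺ (map (λ i → letterFactor C (suc i)) (upTo (n ∸ 1)))

  avoids : Fin m → List (Fin m) → Bool
  avoids X C = all (λ Z → not (Z ≡ᶠ X)) C

  exΨ : NC
  exΨ = sumᴺ (map (λ C → if strictIncr C ∧ avoids 𝟙 C then PoinC C ·ᴺ wt C else 0ᴺ) allLists)

  rhs : NC
  rhs = sumᴺ (map (λ C →
    if strictIncr C ∧ avoids 𝟘 C ∧ avoids 𝟙 C then PoinC (𝟘 ∷ C) ·ᴺ wt⁻ C else 0ᴺ) allLists)

-- The first factor of wt_C is w_0 = b when 𝟘 ∈ C and a − b otherwise; ι adds the coefficients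
-- of the two possible first letters, which is 1 for b and 0 for a − b.  So ι(exΨ) keeps exactly
-- the chains through 𝟘, with their first letter removed, and that is the right-hand side (when
-- n = 0 both sides are 1).
--
-- For nonnegativity, the R-labeling makes ζ(X, Y) the number of increasing saturated chains
-- from X to Y and |μ(X, Z)| the number of strictly decreasing ones.  With these counts, the
-- coefficient of a word in the sum over chains above X satisfies a recursion along covers: a
-- walk first descends (decreasing labels, each step a factor y) and then ascends (increasing
-- labels), emitting a − b at each rank it climbs and b where it restarts at the next element of
-- the chain.  Pairing each a − b with the restart at the same element leaves only coefficients
-- of b and of b + (a − b) = a, which are 0 or 1, so every coefficient is a sum of nonnegative
-- terms.

module Submission where

open import Data.Nat as ℕ using (ℕ; zero; suc; _∸_; _≡ᵇ_; z≤n; s≤s)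
import Data.Nat.Properties as ℕP
open import Data.Integer as ℤ using (ℤ; -_; 0ℤ; 1ℤ; -1ℤ; _+_; _*_; ∣_∣; +≤+)
import Data.Integer.Properties as ℤP
open import Data.Integer.Solver using (module +-*-Solver)
open import Data.Fin as Fin using (Fin)
import Data.Fin.Properties as FinP
open import Data.List using (List; []; _∷_; _++_; map; allFin; upTo; applyUpTo; concatMap; length; tabulate)
import Data.List.Properties as ListP
open import Data.List.Relation.Unary.All using (All; []; _∷_) renaming (map to All-map)
open import Data.List.Relation.Unary.Linked using (Linked; []; [-]; _∷_; tail)
open import Data.Bool using (Bool; true; false; _∧_; _∨_; not; T; if_then_else_)
import Data.Bool.Properties as BoolP
open import Data.Unit using (tt)
open import Data.Product using (Σ; _×_; _,_; proj₁; proj₂)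
open import Data.Sum using (_⊎_; inj₁; inj₂)
open import Data.Empty using (⊥-elim)
open import Function using (_∘_; Equivalence)
open import Relation.Nullary using (¬_; Dec; yes; no)
open import Relation.Nullary.Decidable using (⌊_⌋; toWitness)
open import Relation.Binary.PropositionalEquality hiding (isPartialOrder)
open import Relation.Binary using (IsPartialOrder)
open import Defs

open +-*-Solver using (solve; _:+_; _:*_; :-_; _:=_; con)

∸-suc : ∀ a b → b ℕ.< a → a ∸ b ≡ suc (a ∸ suc b)
∸-suc (suc a) zero    _         = refl
∸-suc (suc a) (suc b) (s≤s b<a) = ∸-suc a b b<a

∑ : {A : Set} → List A → (A → ℤ) → ℤ
∑ xs f = sumℤ (map f xs)

∑-cong : {A : Set} (xs : List A) {f g : A → ℤ} → (∀ x → f x ≡ g x) → ∑ xs f ≡ ∑ xs g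
∑-cong []       f≗g = refl
∑-cong (x ∷ xs) f≗g = cong₂ _+_ (f≗g x) (∑-cong xs f≗g)

∑-zero : {A : Set} (xs : List A) → ∑ xs (λ _ → 0ℤ) ≡ 0ℤ
∑-zero []       = refl
∑-zero (x ∷ xs) = trans (ℤP.+-identityˡ _) (∑-zero xs)

∑-distrib-+ : {A : Set} (xs : List A) (f g : A → ℤ) →
  ∑ xs (λ x → f x + g x) ≡ ∑ xs f + ∑ xs g
∑-distrib-+ []       f g = refl
∑-distrib-+ (x ∷ xs) f g rewrite ∑-distrib-+ xs f g =
  solve 4 (λ a b c d → (a :+ b) :+ (c :+ d) := (a :+ c) :+ (b :+ d)) refl
    (f x) (g x) (∑ xs f) (∑ xs g)

∑-*ˡ : {A : Set} (xs : List A) (a : ℤ) (f : A → ℤ) → ∑ xs (λ x → a * f x) ≡ a * ∑ xs f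
∑-*ˡ []       a f = sym (ℤP.*-zeroʳ a)
∑-*ˡ (x ∷ xs) a f rewrite ∑-*ˡ xs a f = sym (ℤP.*-distribˡ-+ a (f x) (∑ xs f))

∑-*ʳ : {A : Set} (xs : List A) (a : ℤ) (f : A → ℤ) → ∑ xs (λ x → f x * a) ≡ ∑ xs f * a
∑-*ʳ xs a f =
  trans (∑-cong xs (λ x → ℤP.*-comm (f x) a)) (trans (∑-*ˡ xs a f) (ℤP.*-comm a _))

∑-comm : {A B : Set} (xs : List A) (ys : List B) (f : A → B → ℤ) →
  ∑ xs (λ x → ∑ ys (f x)) ≡ ∑ ys (λ y → ∑ xs (λ x → f x y))
∑-comm []       ys f = sym (∑-zero ys)
∑-comm (x ∷ xs) ys f rewrite ∑-comm xs ys f =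
  sym (∑-distrib-+ ys (f x) (λ y → ∑ xs (λ x → f x y)))

∑-++ : {A : Set} (xs ys : List A) (f : A → ℤ) → ∑ (xs ++ ys) f ≡ ∑ xs f + ∑ ys f
∑-++ []       ys f = sym (ℤP.+-identityˡ _)
∑-++ (x ∷ xs) ys f rewrite ∑-++ xs ys f = sym (ℤP.+-assoc (f x) _ _)

∑-map : {A B : Set} (g : A → B) (xs : List A) (f : B → ℤ) → ∑ (map g xs) f ≡ ∑ xs (f ∘ g)
∑-map g []       f = refl
∑-map g (x ∷ xs) f = cong (f (g x) +_) (∑-map g xs f)

∑-concatMap : {A B : Set} (g : A → List B) (xs : List A) (f : B → ℤ) →
  ∑ (concatMap g xs) f ≡ ∑ xs (λ x → ∑ (g x) f)
∑-concatMap g []       f = refl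
∑-concatMap g (x ∷ xs) f =
  trans (∑-++ (g x) (concatMap g xs) f) (cong (∑ (g x) f +_) (∑-concatMap g xs f))

∑-∑-* : {A B : Set} (xs : List A) (ys : List B) (c : A → ℤ) (H : A → B → ℤ) (G : B → ℤ) →
  ∑ ys (λ y → ∑ xs (λ x → c x * H x y) * G y) ≡ ∑ xs (λ x → c x * ∑ ys (λ y → H x y * G y))
∑-∑-* xs ys c H G = begin
    ∑ ys (λ y → ∑ xs (λ x → c x * H x y) * G y)
  ≡⟨ ∑-cong ys (λ y → trans (sym (∑-*ʳ xs (G y) (λ x → c x * H x y)))
                            (∑-cong xs (λ x → ℤP.*-assoc (c x) (H x y) (G y)))) ⟩
    ∑ ys (λ y → ∑ xs (λ x → c x * (H x y * G y)))
  ≡⟨ ∑-comm ys xs (λ y x → c x * (H x y * G y)) ⟩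
    ∑ xs (λ x → ∑ ys (λ y → c x * (H x y * G y)))
  ≡⟨ ∑-cong xs (λ x → ∑-*ˡ ys (c x) (λ y → H x y * G y)) ⟩
    ∑ xs (λ x → c x * ∑ ys (λ y → H x y * G y))
  ∎
  where open ≡-Reasoning

∑-upTo-suc : ∀ k (g : ℕ → ℤ) → ∑ (upTo (suc k)) g ≡ ∑ (upTo k) g + g k
∑-upTo-suc k g = begin
    ∑ (upTo (suc k)) g
  ≡⟨ cong (λ l → ∑ l g) (sym (ListP.applyUpTo-∷ʳ (λ x → x) k)) ⟩
    ∑ (upTo k ++ k ∷ []) g
  ≡⟨ ∑-++ (upTo k) (k ∷ []) g ⟩
    ∑ (upTo k) g + (g k + 0ℤ)
  ≡⟨ cong (∑ (upTo k) g +_) (ℤP.+-identityʳ (g k)) ⟩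
    ∑ (upTo k) g + g k
  ∎
  where open ≡-Reasoning

∑-applyUpTo-suc : ∀ N (g : ℕ → ℤ) → ∑ (applyUpTo suc N) g ≡ ∑ (upTo N) (g ∘ suc)
∑-applyUpTo-suc N g =
  trans (cong (λ l → ∑ l g) (sym (ListP.map-applyUpTo (λ x → x) suc N))) (∑-map suc (upTo N) g)

∑-applyUpTo-vanish : ∀ (f : ℕ → ℕ) N (g : ℕ → ℤ) → (∀ j → j ℕ.< N → g (f j) ≡ 0ℤ) →
  ∑ (applyUpTo f N) g ≡ 0ℤ
∑-applyUpTo-vanish f zero    g vanish = refl
∑-applyUpTo-vanish f (suc N) g vanish =
  trans (cong₂ _+_ (vanish 0 (s≤s z≤n))
                   (∑-applyUpTo-vanish (f ∘ suc) N g (λ j j<N → vanish (suc j) (s≤s j<N))))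
        (ℤP.+-identityˡ 0ℤ)

0≤-+ : ∀ {x y} → 0ℤ ℤ.≤ x → 0ℤ ℤ.≤ y → 0ℤ ℤ.≤ x + y
0≤-+ = ℤP.+-mono-≤

0≤-* : ∀ {x y} → 0ℤ ℤ.≤ x → 0ℤ ℤ.≤ y → 0ℤ ℤ.≤ x * y
0≤-* {ℤ.+ a} {ℤ.+ b} _ _ = subst (0ℤ ℤ.≤_) (ℤP.pos-* a b) (+≤+ z≤n)

0≤if : ∀ b {x y} → 0ℤ ℤ.≤ x → 0ℤ ℤ.≤ y → 0ℤ ℤ.≤ (if b then x else y)
0≤if true  0≤x _   = 0≤x
0≤if false _   0≤y = 0≤y

0≤-∑ : {A : Set} (xs : List A) (f : A → ℤ) → (∀ x → 0ℤ ℤ.≤ f x) → 0ℤ ℤ.≤ ∑ xs f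
0≤-∑ []       f 0≤f = ℤP.≤-refl
0≤-∑ (x ∷ xs) f 0≤f = 0≤-+ (0≤f x) (0≤-∑ xs f 0≤f)

-1^_ : ℕ → ℤ
-1^ zero  = 1ℤ
-1^ suc r = - (-1^ r)

-1^-square : ∀ r → -1^ r * -1^ r ≡ 1ℤ
-1^-square zero    = refl
-1^-square (suc r) = trans (solve 1 (λ s → (:- s) :* (:- s) := s :* s) refl (-1^ r)) (-1^-square r)

∣-1^*∣ : ∀ r x → ∣ -1^ r * x ∣ ≡ ∣ x ∣
∣-1^*∣ zero    x = cong ∣_∣ (ℤP.*-identityˡ x)
∣-1^*∣ (suc r) x = trans (cong ∣_∣ (sym (ℤP.neg-distribˡ-* (-1^ r) x)))
                         (trans (ℤP.∣-i∣≡∣i∣ (-1^ r * x)) (∣-1^*∣ r x))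

⟦_⟧ : Bool → ℤ
⟦ true ⟧  = 1ℤ
⟦ false ⟧ = 0ℤ

0≤⟦⟧ : ∀ b → 0ℤ ℤ.≤ ⟦ b ⟧
0≤⟦⟧ true  = +≤+ z≤n
0≤⟦⟧ false = +≤+ z≤n

⟦∧⟧ : ∀ a b → ⟦ a ∧ b ⟧ ≡ ⟦ a ⟧ * ⟦ b ⟧
⟦∧⟧ true  b = sym (ℤP.*-identityˡ _)
⟦∧⟧ false b = refl

⟦⟧-split : ∀ c b → ⟦ c ⟧ ≡ ⟦ c ∧ b ⟧ + ⟦ c ∧ not b ⟧
⟦⟧-split true  true  = refl
⟦⟧-split true  false = refl
⟦⟧-split false b     = refl

⟦⟧-complement : ∀ b x → x ≡ ⟦ b ⟧ * x + ⟦ not b ⟧ * x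
⟦⟧-complement true  x = sym (trans (ℤP.+-identityʳ (1ℤ * x)) (ℤP.*-identityˡ x))
⟦⟧-complement false x = sym (trans (ℤP.+-identityˡ (1ℤ * x)) (ℤP.*-identityˡ x))

⟦∧∧⟧ : ∀ a s b i → ⟦ (a ∧ s) ∧ (b ∧ i) ⟧ ≡ ⟦ a ∧ b ⟧ * ⟦ s ∧ i ⟧
⟦∧∧⟧ false s     b     i = refl
⟦∧∧⟧ true  false b     i = sym (ℤP.*-zeroʳ ⟦ b ⟧)
⟦∧∧⟧ true  true  false i = refl
⟦∧∧⟧ true  true  true  i = sym (ℤP.*-identityˡ ⟦ i ⟧)

⟦⟧-*-cong : ∀ c {x y} → (T c → x ≡ y) → ⟦ c ⟧ * x ≡ ⟦ c ⟧ * y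
⟦⟧-*-cong true  x≡y = cong (1ℤ *_) (x≡y tt)
⟦⟧-*-cong false _   = refl

⟦⟧-*-vanish : ∀ c {x} → (T c → x ≡ 0ℤ) → ⟦ c ⟧ * x ≡ 0ℤ
⟦⟧-*-vanish c x≡0 = trans (⟦⟧-*-cong c x≡0) (ℤP.*-zeroʳ ⟦ c ⟧)

T-ext : ∀ {a b : Bool} → (T a → T b) → (T b → T a) → a ≡ b
T-ext {true}  {true}  _ _ = refl
T-ext {true}  {false} f _ = ⊥-elim (f tt)
T-ext {false} {true}  _ g = ⊥-elim (g tt)
T-ext {false} {false} _ _ = refl

T-∧-intro : ∀ {a b} → T a → T b → T (a ∧ b)
T-∧-intro ta tb = Equivalence.from BoolP.T-∧ (ta , tb)

T-∧-fst : ∀ {a b} → T (a ∧ b) → T a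
T-∧-fst = proj₁ ∘ Equivalence.to BoolP.T-∧

T-∧-snd : ∀ {a b} → T (a ∧ b) → T b
T-∧-snd = proj₂ ∘ Equivalence.to BoolP.T-∧

true⇒T : ∀ {b} → b ≡ true → T b
true⇒T refl = tt

T⇒true : ∀ {b} → T b → b ≡ true
T⇒true = Equivalence.to BoolP.T-≡

¬T⇒false : ∀ {b} → ¬ T b → b ≡ false
¬T⇒false {true}  ¬t = ⊥-elim (¬t tt)
¬T⇒false {false} _  = refl

T-not⇒¬T : ∀ {b} → T (not b) → ¬ T b
T-not⇒¬T {false} _ ()

⌊⌋-true : {A : Set} (a? : Dec A) → A → ⌊ a? ⌋ ≡ true
⌊⌋-true (yes _)  _ = refl
⌊⌋-true (no ¬a) a = ⊥-elim (¬a a)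

⌊⌋-false : {A : Set} (a? : Dec A) → ¬ A → ⌊ a? ⌋ ≡ false
⌊⌋-false (yes a) ¬a = ⊥-elim (¬a a)
⌊⌋-false (no _)  _  = refl

∑-allFin-point : ∀ {k} (W₀ : Fin k) (f : Fin k → ℤ) → (∀ W → W ≢ W₀ → f W ≡ 0ℤ) →
  ∑ (allFin k) f ≡ f W₀
∑-allFin-point {suc k} W₀ f vanish = begin
    f Fin.zero + ∑ (tabulate Fin.suc) f
  ≡⟨ cong (f Fin.zero +_) (trans (cong (λ l → ∑ l f) (sym (ListP.map-tabulate (λ x → x) Fin.suc)))
                                 (∑-map Fin.suc (allFin k) f)) ⟩
    f Fin.zero + ∑ (allFin k) (f ∘ Fin.suc)
  ≡⟨ split W₀ vanish ⟩
    f W₀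
  ∎
  where
  open ≡-Reasoning
  split : ∀ W₀ → (∀ W → W ≢ W₀ → f W ≡ 0ℤ) → f Fin.zero + ∑ (allFin k) (f ∘ Fin.suc) ≡ f W₀
  split Fin.zero    vanish = trans (cong (f Fin.zero +_)
    (trans (∑-cong (allFin k) (λ W → vanish (Fin.suc W) λ ())) (∑-zero (allFin k)))) (ℤP.+-identityʳ _)
  split (Fin.suc W₀) vanish = trans (cong (_+ ∑ (allFin k) (f ∘ Fin.suc)) (vanish Fin.zero λ ()))
    (trans (ℤP.+-identityˡ _) (∑-allFin-point W₀ (f ∘ Fin.suc) (λ W W≢ → vanish (Fin.suc W) (W≢ ∘ FinP.suc-injective))))

∑-delta : ∀ {k} (X : Fin k) (f : Fin k → ℤ) → ∑ (allFin k) (λ Z → ⟦ ⌊ Z FinP.≟ X ⌋ ⟧ * f Z) ≡ f X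
∑-delta X f = trans (∑-allFin-point X _ (λ Z Z≢X → cong (λ b → ⟦ b ⟧ * f Z) (⌊⌋-false (Z FinP.≟ X) Z≢X)))
                    (trans (cong (λ b → ⟦ b ⟧ * f X) (⌊⌋-true (X FinP.≟ X) refl)) (ℤP.*-identityˡ (f X)))

∑-deltaˡ : ∀ {k} (X : Fin k) (f : Fin k → ℤ) → ∑ (allFin k) (λ Z → ⟦ ⌊ X FinP.≟ Z ⌋ ⟧ * f Z) ≡ f X
∑-deltaˡ X f = trans (∑-allFin-point X _ (λ Z Z≢X → cong (λ b → ⟦ b ⟧ * f Z) (⌊⌋-false (X FinP.≟ Z) (Z≢X ∘ sym))))
                     (trans (cong (λ b → ⟦ b ⟧ * f X) (⌊⌋-true (X FinP.≟ X) refl)) (ℤP.*-identityˡ (f X)))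

∑-split-at : ∀ {k} (X : Fin k) (f : Fin k → ℤ) → ∑ (allFin k) f ≡ f X + ∑ (allFin k) (λ Y → ⟦ not ⌊ Y FinP.≟ X ⌋ ⟧ * f Y)
∑-split-at {k} X f = begin
    ∑ (allFin k) f
  ≡⟨ ∑-cong (allFin k) (λ Y → ⟦⟧-complement ⌊ Y FinP.≟ X ⌋ (f Y)) ⟩
    ∑ (allFin k) (λ Y → ⟦ ⌊ Y FinP.≟ X ⌋ ⟧ * f Y + ⟦ not ⌊ Y FinP.≟ X ⌋ ⟧ * f Y)
  ≡⟨ ∑-distrib-+ (allFin k) _ _ ⟩
    ∑ (allFin k) (λ Y → ⟦ ⌊ Y FinP.≟ X ⌋ ⟧ * f Y) + ∑ (allFin k) (λ Y → ⟦ not ⌊ Y FinP.≟ X ⌋ ⟧ * f Y)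
  ≡⟨ cong (_+ ∑ (allFin k) (λ Y → ⟦ not ⌊ Y FinP.≟ X ⌋ ⟧ * f Y)) (∑-delta X f) ⟩
    f X + ∑ (allFin k) (λ Y → ⟦ not ⌊ Y FinP.≟ X ⌋ ⟧ * f Y)
  ∎
  where open ≡-Reasoning

∑-δ+∑ : ∀ {k} (A : Fin k) (c : Fin k → ℤ) (H : Fin k → Fin k → ℤ) (G : Fin k → ℤ) →
  ∑ (allFin k) (λ Y → (⟦ ⌊ A FinP.≟ Y ⌋ ⟧ + ∑ (allFin k) (λ V → c V * H V Y)) * G Y)
  ≡ G A + ∑ (allFin k) (λ V → c V * ∑ (allFin k) (λ Y → H V Y * G Y))
∑-δ+∑ {k} A c H G = begin
    ∑ (allFin k) (λ Y → (⟦ ⌊ A FinP.≟ Y ⌋ ⟧ + ∑ (allFin k) (λ V → c V * H V Y)) * G Y)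
  ≡⟨ ∑-cong (allFin k) (λ Y → ℤP.*-distribʳ-+ (G Y) ⟦ ⌊ A FinP.≟ Y ⌋ ⟧ _) ⟩
    ∑ (allFin k) (λ Y → ⟦ ⌊ A FinP.≟ Y ⌋ ⟧ * G Y + ∑ (allFin k) (λ V → c V * H V Y) * G Y)
  ≡⟨ ∑-distrib-+ (allFin k) _ _ ⟩
    ∑ (allFin k) (λ Y → ⟦ ⌊ A FinP.≟ Y ⌋ ⟧ * G Y) + ∑ (allFin k) (λ Y → ∑ (allFin k) (λ V → c V * H V Y) * G Y)
  ≡⟨ cong₂ _+_ (∑-deltaˡ A G) (∑-∑-* (allFin k) (allFin k) c H G) ⟩
    G A + ∑ (allFin k) (λ V → c V * ∑ (allFin k) (λ Y → H V Y * G Y))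
  ∎
  where open ≡-Reasoning

module _ {m : ℕ} where
  open Index using (listsOfLen)

  listsOfLen-suc : ∀ {n} (P : GradedPoset m n) j (f : List (Fin m) → ℤ) →
    ∑ (listsOfLen P (suc j)) f ≡ ∑ (allFin m) (λ W → ∑ (listsOfLen P j) (f ∘ (W ∷_)))
  listsOfLen-suc P j f =
    trans (∑-concatMap (λ X → map (X ∷_) (listsOfLen P j)) (allFin m) f)
          (∑-cong (allFin m) (λ W → ∑-map (W ∷_) (listsOfLen P j) f))

  ∑-listsOfLen-point : ∀ {n} (P : GradedPoset m n) j zs₀ → length zs₀ ≡ j → (f : List (Fin m) → ℤ) →
    (∀ zs → zs ≢ zs₀ → f zs ≡ 0ℤ) → ∑ (listsOfLen P j) f ≡ f zs₀
  ∑-listsOfLen-point P zero    []         refl f vanish = ℤP.+-identityʳ (f [])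
  ∑-listsOfLen-point P (suc j) (W₀ ∷ zs₀) len  f vanish = begin
      ∑ (listsOfLen P (suc j)) f
    ≡⟨ listsOfLen-suc P j f ⟩
      ∑ (allFin m) (λ W → ∑ (listsOfLen P j) (f ∘ (W ∷_)))
    ≡⟨ ∑-allFin-point W₀ _ (λ W W≢W₀ → trans (∑-cong (listsOfLen P j) (λ zs → vanish (W ∷ zs) (W≢W₀ ∘ ListP.∷-injectiveˡ)))
                                             (∑-zero (listsOfLen P j))) ⟩
      ∑ (listsOfLen P j) (f ∘ (W₀ ∷_))
    ≡⟨ ∑-listsOfLen-point P j zs₀ (ℕP.suc-injective len) (f ∘ (W₀ ∷_))
        (λ zs zs≢ → vanish (W₀ ∷ zs) (zs≢ ∘ ListP.∷-injectiveʳ)) ⟩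
      f (W₀ ∷ zs₀)
    ∎
    where open ≡-Reasoning

constₚ : ℤ → Poly
constₚ c zero    = c
constₚ c (suc _) = 0ℤ

constₚ-0 : ∀ j → constₚ 0ℤ j ≡ 0ℤ
constₚ-0 zero    = refl
constₚ-0 (suc j) = refl

constₚ-* : ∀ a c j → constₚ (a * c) j ≡ a * constₚ c j
constₚ-* a c zero    = refl
constₚ-* a c (suc j) = sym (ℤP.*-zeroʳ a)

*ₚ-constˡ : ∀ (p q : Poly) c k → (∀ i → p i ≡ constₚ c i) → (p *ₚ q) k ≡ c * q k
*ₚ-constˡ p q c k p≗c = begin
    p 0 * q k + ∑ (applyUpTo suc k) (λ i → p i * q (k ∸ i))
  ≡⟨ cong₂ _+_ (cong (_* q k) (p≗c 0))
       (∑-applyUpTo-vanish suc k (λ i → p i * q (k ∸ i)) (λ j _ → cong (_* q (k ∸ suc j)) (p≗c (suc j)))) ⟩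
    c * q k + 0ℤ
  ≡⟨ ℤP.+-identityʳ (c * q k) ⟩
    c * q k
  ∎
  where open ≡-Reasoning

*ₚ-constʳ : ∀ (p q : Poly) c k → (∀ i → q i ≡ constₚ c i) → (p *ₚ q) k ≡ p k * c
*ₚ-constʳ p q c k q≗c = begin
    ∑ (upTo (suc k)) (λ i → p i * q (k ∸ i))
  ≡⟨ ∑-upTo-suc k (λ i → p i * q (k ∸ i)) ⟩
    ∑ (upTo k) (λ i → p i * q (k ∸ i)) + p k * q (k ∸ k)
  ≡⟨ cong₂ _+_ (∑-applyUpTo-vanish (λ i → i) k (λ i → p i * q (k ∸ i)) below)
               (cong (p k *_) (trans (q≗c (k ∸ k)) (cong (constₚ c) (ℕP.n∸n≡0 k)))) ⟩
    0ℤ + p k * c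
  ≡⟨ ℤP.+-identityˡ (p k * c) ⟩
    p k * c
  ∎
  where
  open ≡-Reasoning
  below : ∀ j → j ℕ.< k → p j * q (k ∸ j) ≡ 0ℤ
  below j j<k = trans (cong (p j *_) (trans (q≗c (k ∸ j)) (cong (constₚ c) (∸-suc k j j<k))))
                      (ℤP.*-zeroʳ (p j))

y^_·_ : ℕ → Poly → Poly
(y^ zero  · p) k       = p k
(y^ suc e · p) zero    = 0ℤ
(y^ suc e · p) (suc k) = (y^ e · p) k

y^-cong : ∀ e {p q : Poly} → (∀ k → p k ≡ q k) → ∀ k → (y^ e · p) k ≡ (y^ e · q) k
y^-cong zero    p≗q k       = p≗q k
y^-cong (suc e) p≗q zero    = refl
y^-cong (suc e) p≗q (suc k) = y^-cong e p≗q k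

y^-suc : ∀ e (p : Poly) k → (y^ suc e · p) k ≡ (y^ 1 · (y^ e · p)) k
y^-suc e p zero    = refl
y^-suc e p (suc k) = refl

y^-zero : ∀ e k → (y^ e · (λ _ → 0ℤ)) k ≡ 0ℤ
y^-zero zero    k       = refl
y^-zero (suc e) zero    = refl
y^-zero (suc e) (suc k) = y^-zero e k

y^-*ˡ : ∀ e (c : ℤ) (p : Poly) k → c * (y^ e · p) k ≡ (y^ e · (λ i → c * p i)) k
y^-*ˡ zero    c p k       = refl
y^-*ˡ (suc e) c p zero    = ℤP.*-zeroʳ c
y^-*ˡ (suc e) c p (suc k) = y^-*ˡ e c p k

y^-*ʳ : ∀ e (c : ℤ) (p : Poly) k → (y^ e · p) k * c ≡ (y^ e · (λ i → p i * c)) k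
y^-*ʳ zero    c p k       = refl
y^-*ʳ (suc e) c p zero    = refl
y^-*ʳ (suc e) c p (suc k) = y^-*ʳ e c p k

y^-1ₚ : ∀ e k → (y^ e · 1ₚ) k ≡ ⟦ e ≡ᵇ k ⟧
y^-1ₚ zero    zero    = refl
y^-1ₚ zero    (suc k) = refl
y^-1ₚ (suc e) zero    = refl
y^-1ₚ (suc e) (suc k) = y^-1ₚ e k

y^-∑ : {A : Set} (xs : List A) (c : A → ℤ) (p : A → Poly) (k : ℕ) →
  (y^ 1 · (λ i → ∑ xs (λ x → c x * p x i))) k ≡ ∑ xs (λ x → c x * (y^ 1 · p x) k)
y^-∑ xs c p zero    = sym (trans (∑-cong xs (λ x → ℤP.*-zeroʳ (c x))) (∑-zero xs))
y^-∑ xs c p (suc k) = refl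

*ₚ-monomial : ∀ e k (q : Poly) → ∑ (upTo (suc k)) (λ i → ⟦ e ≡ᵇ i ⟧ * q (k ∸ i)) ≡ (y^ e · q) k
*ₚ-monomial zero    k       q =
  trans (cong₂ _+_ (ℤP.*-identityˡ (q k))
                   (∑-applyUpTo-vanish suc k (λ i → ⟦ 0 ≡ᵇ i ⟧ * q (k ∸ i)) (λ _ _ → refl)))
        (ℤP.+-identityʳ (q k))
*ₚ-monomial (suc e) zero    q = refl
*ₚ-monomial (suc e) (suc k) q =
  trans (ℤP.+-identityˡ _)
        (trans (∑-applyUpTo-suc (suc k) (λ i → ⟦ suc e ≡ᵇ i ⟧ * q (suc k ∸ i))) (*ₚ-monomial e k q))

coef-a-b coef-b : Letter → ℤ
coef-a-b 𝐚 = 1ℤ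
coef-a-b 𝐛 = -1ℤ
coef-b 𝐚 = 0ℤ
coef-b 𝐛 = 1ℤ

0≤coef-b : ∀ h → 0ℤ ℤ.≤ coef-b h
0≤coef-b 𝐚 = +≤+ z≤n
0≤coef-b 𝐛 = +≤+ z≤n

0≤coef-b+coef-a-b : ∀ h b → 0ℤ ℤ.≤ coef-b h + coef-a-b h * ⟦ b ⟧
0≤coef-b+coef-a-b 𝐚 true  = +≤+ z≤n
0≤coef-b+coef-a-b 𝐚 false = +≤+ z≤n
0≤coef-b+coef-a-b 𝐛 true  = +≤+ z≤n
0≤coef-b+coef-a-b 𝐛 false = +≤+ z≤n

-- (⟨a-b⟩^ j · g) v is the coefficient of v in (a − b)^j G, where g v is the coefficient of v in G

⟨a-b⟩^_·_ : ℕ → (Word → ℤ) → Word → ℤ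
(⟨a-b⟩^ zero  · g) v       = g v
(⟨a-b⟩^ suc j · g) []      = 0ℤ
(⟨a-b⟩^ suc j · g) (h ∷ v) = coef-a-b h * (⟨a-b⟩^ j · g) v

⟨a-b⟩^-cong : ∀ j {g g′ : Word → ℤ} → (∀ v → g v ≡ g′ v) → ∀ v → (⟨a-b⟩^ j · g) v ≡ (⟨a-b⟩^ j · g′) v
⟨a-b⟩^-cong zero    g≗g′ v       = g≗g′ v
⟨a-b⟩^-cong (suc j) g≗g′ []      = refl
⟨a-b⟩^-cong (suc j) g≗g′ (h ∷ v) = cong (coef-a-b h *_) (⟨a-b⟩^-cong j g≗g′ v)

⟨a-b⟩^-*ˡ : ∀ j (c : ℤ) (g : Word → ℤ) v → c * (⟨a-b⟩^ j · g) v ≡ (⟨a-b⟩^ j · (λ u → c * g u)) v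
⟨a-b⟩^-*ˡ zero    c g v       = refl
⟨a-b⟩^-*ˡ (suc j) c g []      = ℤP.*-zeroʳ c
⟨a-b⟩^-*ˡ (suc j) c g (h ∷ v) =
  trans (solve 3 (λ c e x → c :* (e :* x) := e :* (c :* x)) refl c (coef-a-b h) ((⟨a-b⟩^ j · g) v))
        (cong (coef-a-b h *_) (⟨a-b⟩^-*ˡ j c g v))

⟨a-b⟩^-y^ : ∀ j e (H : Word → Poly) v k →
  (⟨a-b⟩^ j · (λ u → (y^ e · H u) k)) v ≡ (y^ e · (λ i → (⟨a-b⟩^ j · (λ u → H u i)) v)) k
⟨a-b⟩^-y^ zero    e H v       k = refl
⟨a-b⟩^-y^ (suc j) e H []      k = sym (y^-zero e k)
⟨a-b⟩^-y^ (suc j) e H (h ∷ v) k =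
  trans (cong (coef-a-b h *_) (⟨a-b⟩^-y^ j e H v k))
        (y^-*ˡ e (coef-a-b h) (λ i → (⟨a-b⟩^ j · (λ u → H u i)) v) k)

ifᴺ-then-0ᴺ : ∀ b (f : NC) w k → (if b then f else 0ᴺ) w k ≡ ⟦ b ⟧ * f w k
ifᴺ-then-0ᴺ true  f w k = sym (ℤP.*-identityˡ (f w k))
ifᴺ-then-0ᴺ false f w k = refl

oneLetter : (Letter → ℤ) → Word → ℤ
oneLetter c []          = 0ℤ
oneLetter c (h ∷ [])    = c h
oneLetter c (_ ∷ _ ∷ _) = 0ℤ

headCoef : (Letter → ℤ) → (Word → ℤ) → Word → ℤ
headCoef c g []      = 0ℤ
headCoef c g (h ∷ w) = c h * g w

sumᴺ-map : {A : Set} (F : A → NC) (xs : List A) (v : Word) (k : ℕ) → sumᴺ (map F xs) v k ≡ ∑ xs (λ x → F x v k)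
sumᴺ-map F []       v k = refl
sumᴺ-map F (x ∷ xs) v k = cong (F x v k +_) (sumᴺ-map F xs v k)

*ᴺ-oneLetter : (F G : NC) (c : Letter → ℤ) → (∀ u j → F u j ≡ constₚ (oneLetter c u) j) →
  ∀ w j → (F *ᴺ G) w j ≡ headCoef c (λ u → G u j) w
*ᴺ-oneLetter F G c F≗c []      j = trans (ℤP.+-identityʳ _) (*ₚ-constˡ (F []) (G []) 0ℤ j (F≗c []))
*ᴺ-oneLetter F G c F≗c (h ∷ w) j = begin
    (F [] *ₚ G (h ∷ w)) j + sumᴺ (map split-term (map (prepend h) (splits w))) (h ∷ w) j
  ≡⟨ cong₂ _+_ (*ₚ-constˡ (F []) (G (h ∷ w)) 0ℤ j (F≗c []))
       (trans (sumᴺ-map split-term (map (prepend h) (splits w)) (h ∷ w) j)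
              (∑-map (prepend h) (splits w) (λ p → split-term p (h ∷ w) j))) ⟩
    0ℤ + ∑ (splits w) (λ p → (F (h ∷ proj₁ p) *ₚ G (proj₂ p)) j)
  ≡⟨ trans (ℤP.+-identityˡ _) (first-letter w) ⟩
    c h * G w j
  ∎
  where
  open ≡-Reasoning
  split-term : Word × Word → NC
  split-term p _ = F (proj₁ p) *ₚ G (proj₂ p)
  prepend : Letter → Word × Word → Word × Word
  prepend x p = x ∷ proj₁ p , proj₂ p
  first-letter : ∀ w → ∑ (splits w) (λ p → (F (h ∷ proj₁ p) *ₚ G (proj₂ p)) j) ≡ c h * G w j
  first-letter []       = trans (ℤP.+-identityʳ _) (*ₚ-constˡ (F (h ∷ [])) (G []) (c h) j (F≗c (h ∷ [])))
  first-letter (x ∷ w′) = begin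
      (F (h ∷ []) *ₚ G (x ∷ w′)) j + ∑ (map (prepend x) (splits w′)) (λ p → (F (h ∷ proj₁ p) *ₚ G (proj₂ p)) j)
    ≡⟨ cong₂ _+_ (*ₚ-constˡ (F (h ∷ [])) (G (x ∷ w′)) (c h) j (F≗c (h ∷ [])))
         (trans (∑-map (prepend x) (splits w′) (λ p → (F (h ∷ proj₁ p) *ₚ G (proj₂ p)) j))
                (trans (∑-cong (splits w′) (λ p → *ₚ-constˡ (F (h ∷ x ∷ proj₁ p)) (G (proj₂ p)) 0ℤ j
                                                              (F≗c (h ∷ x ∷ proj₁ p))))
                       (∑-zero (splits w′)))) ⟩
      c h * G (x ∷ w′) j + 0ℤ
    ≡⟨ ℤP.+-identityʳ _ ⟩
      c h * G (x ∷ w′) j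
    ∎

letterCoef : Bool → Letter → ℤ
letterCoef true  = coef-b
letterCoef false = coef-a-b

letterCoef-sum : ∀ b → letterCoef b 𝐚 + letterCoef b 𝐛 ≡ ⟦ b ⟧
letterCoef-sum true  = refl
letterCoef-sum false = refl

letterFactor-coef : ∀ b u j → (if b then 𝐁 else 𝐀 -ᴺ 𝐁) u j ≡ constₚ (oneLetter (letterCoef b) u) j
letterFactor-coef true  []              j       = sym (constₚ-0 j)
letterFactor-coef false []              j       = sym (constₚ-0 j)
letterFactor-coef true  (𝐚 ∷ [])        zero    = refl
letterFactor-coef true  (𝐚 ∷ [])        (suc j) = refl
letterFactor-coef true  (𝐛 ∷ [])        zero    = refl
letterFactor-coef true  (𝐛 ∷ [])        (suc j) = refl
letterFactor-coef false (𝐚 ∷ [])        zero    = refl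
letterFactor-coef false (𝐚 ∷ [])        (suc j) = refl
letterFactor-coef false (𝐛 ∷ [])        zero    = refl
letterFactor-coef false (𝐛 ∷ [])        (suc j) = refl
letterFactor-coef true  (𝐚 ∷ _ ∷ _)     j       = sym (constₚ-0 j)
letterFactor-coef true  (𝐛 ∷ _ ∷ _)     j       = sym (constₚ-0 j)
letterFactor-coef false (𝐚 ∷ _ ∷ _)     j       = sym (constₚ-0 j)
letterFactor-coef false (𝐛 ∷ _ ∷ _)     j       = sym (constₚ-0 j)

module WeightCoefficients {m n : ℕ} (P : GradedPoset m n) where
  open GradedPoset P
  open Index P

  -- wtCoef s C v is the coefficient of v in w_s ⋯ w_{n-1}
  wtCoef : ℕ → List (Fin m) → Word → ℤ
  wtCoef s C []      = ⟦ n ℕ.≤ᵇ s ⟧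
  wtCoef s C (h ∷ v) = ⟦ s ℕ.<ᵇ n ⟧ * (letterCoef (inRank s C) h * wtCoef (suc s) C v)

  prodᴺ-letterFactors : ∀ N (g : ℕ → ℕ) s C w j → (∀ i → g i ≡ s ℕ.+ i) → N ≡ n ∸ s →
    prodᴺ (applyUpTo (letterFactor C ∘ g) N) w j ≡ constₚ (wtCoef s C w) j
  prodᴺ-letterFactors zero g s C [] j g≗ N≡ rewrite T⇒true (ℕP.≤⇒≤ᵇ (ℕP.m∸n≡0⇒m≤n {n} {s} (sym N≡)))
    with j
  ... | zero  = refl
  ... | suc _ = refl
  prodᴺ-letterFactors zero g s C (h ∷ w) j g≗ N≡
    rewrite ¬T⇒false (λ t → ℕP.<⇒≱ (ℕP.<ᵇ⇒< s n t) (ℕP.m∸n≡0⇒m≤n (sym N≡))) = sym (constₚ-0 j)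
  prodᴺ-letterFactors (suc N) g s C w j g≗ N≡ =
    trans (*ᴺ-oneLetter (letterFactor C (g 0)) (prodᴺ (applyUpTo (letterFactor C ∘ g ∘ suc) N))
             (letterCoef (inRank (g 0) C)) (letterFactor-coef (inRank (g 0) C)) w j)
          (step w)
    where
    s<n : s ℕ.< n
    s<n = ℕP.m∸n≢0⇒n<m (λ e → ℕP.0≢1+n (sym (trans N≡ e)))
    step : ∀ w → headCoef (letterCoef (inRank (g 0) C)) (λ u → prodᴺ (applyUpTo (letterFactor C ∘ g ∘ suc) N) u j) w
               ≡ constₚ (wtCoef s C w) j
    step [] rewrite ¬T⇒false (λ t → ℕP.<⇒≱ s<n (ℕP.≤ᵇ⇒≤ n s t)) = sym (constₚ-0 j)
    step (h ∷ w) rewrite T⇒true (ℕP.<⇒<ᵇ s<n) = begin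
        letterCoef (inRank (g 0) C) h * prodᴺ (applyUpTo (letterFactor C ∘ g ∘ suc) N) w j
      ≡⟨ cong₂ (λ a b → letterCoef (inRank a C) h * b) (trans (g≗ 0) (ℕP.+-identityʳ s))
           (prodᴺ-letterFactors N (g ∘ suc) (suc s) C w j (λ i → trans (g≗ (suc i)) (ℕP.+-suc s i))
              (ℕP.suc-injective (trans N≡ (∸-suc n s s<n)))) ⟩
        letterCoef (inRank s C) h * constₚ (wtCoef (suc s) C w) j
      ≡⟨ sym (constₚ-* (letterCoef (inRank s C) h) (wtCoef (suc s) C w) j) ⟩
        constₚ (letterCoef (inRank s C) h * wtCoef (suc s) C w) j
      ≡⟨ cong (λ t → constₚ t j) (sym (ℤP.*-identityˡ _)) ⟩
        constₚ (1ℤ * (letterCoef (inRank s C) h * wtCoef (suc s) C w)) j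
      ∎
      where open ≡-Reasoning

  wt-coef : ∀ C w j → wt C w j ≡ constₚ (wtCoef 0 C w) j
  wt-coef C w j =
    trans (cong (λ l → prodᴺ l w j) (ListP.map-applyUpTo (λ x → x) (letterFactor C) n))
          (prodᴺ-letterFactors n (λ i → i) 0 C w j (λ i → refl) refl)

  wt⁻-coef : ∀ C w j → wt⁻ C w j ≡ constₚ (wtCoef 1 C w) j
  wt⁻-coef C w j =
    trans (cong (λ l → prodᴺ l w j) (ListP.map-applyUpTo (λ x → x) (λ i → letterFactor C (suc i)) (n ∸ 1)))
          (prodᴺ-letterFactors (n ∸ 1) suc 1 C w j (λ i → refl) refl)

module _ {m n : ℕ} (P : GradedPoset m n) (R : RLabeling P) where
  open GradedPoset P
  open Order _≤_
  open RLabeling R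
  open Index P
  open WeightCoefficients P
  module PO = IsPartialOrder isPartialOrder

  ∑ᴾ : (Fin m → ℤ) → ℤ
  ∑ᴾ = ∑ (allFin m)

  infix 2 ∑ᴾ
  syntax ∑ᴾ (λ X → e) = ∑[ X ] e

  ≤-refl : ∀ {X} → X ≤ X
  ≤-refl = PO.reflexive refl

  SatFrom-++ : ∀ {X Y Z} xs ys → SatFrom X xs Y → SatFrom Y ys Z → SatFrom X (xs ++ ys) Z
  SatFrom-++ []       ys refl      s′ = s′
  SatFrom-++ (W ∷ xs) ys (c , s) s′ = c , SatFrom-++ xs ys s s′

  SatFrom⇒≤ : ∀ {X Y} zs → SatFrom X zs Y → X ≤ Y
  SatFrom⇒≤ []       refl    = ≤-refl
  SatFrom⇒≤ (W ∷ zs) (c , s) = PO.trans (proj₁ c) (SatFrom⇒≤ zs s)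

  saturated : ∀ X Y → X ≤ Y → Σ (List (Fin m)) λ zs → SatFrom X zs Y
  saturated X Y X≤Y = let (zs , (sat , _) , _) = unique-incr X Y X≤Y in zs , sat

  rank-𝟘 : rank 𝟘 ≡ 0
  rank-𝟘 = sym (rank-spec 𝟘 [] refl)

  rank-SatFrom : ∀ {X Y} zs → SatFrom X zs Y → rank Y ≡ rank X ℕ.+ length zs
  rank-SatFrom {X} {Y} zs s = begin
      rank Y
    ≡⟨ sym (rank-spec Y (zs₀ ++ zs) (SatFrom-++ zs₀ zs s₀ s)) ⟩
      length (zs₀ ++ zs)
    ≡⟨ ListP.length-++ zs₀ ⟩
      length zs₀ ℕ.+ length zs
    ≡⟨ cong (ℕ._+ length zs) (rank-spec X zs₀ s₀) ⟩
      rank X ℕ.+ length zs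
    ∎
    where
    open ≡-Reasoning
    zs₀ = proj₁ (saturated 𝟘 X (𝟘-min X))
    s₀ = proj₂ (saturated 𝟘 X (𝟘-min X))

  rank-mono : ∀ {X Y} → X ≤ Y → rank X ℕ.≤ rank Y
  rank-mono {X} {Y} X≤Y with saturated X Y X≤Y
  ... | zs , s = subst (rank X ℕ.≤_) (sym (rank-SatFrom zs s)) (ℕP.m≤m+n _ _)

  rank-injective : ∀ {X Y} → X ≤ Y → rank X ≡ rank Y → X ≡ Y
  rank-injective {X} {Y} X≤Y r≡ with saturated X Y X≤Y
  ... | []     , s = s
  ... | W ∷ zs , s = ⊥-elim (ℕP.<-irrefl (trans r≡ (rank-SatFrom (W ∷ zs) s)) (ℕP.m<m+n (rank X) (s≤s z≤n)))

  rank-strict : ∀ {X Y} → X ≤ Y → X ≢ Y → rank X ℕ.< rank Y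
  rank-strict X≤Y X≢Y with ℕP.m≤n⇒m<n∨m≡n (rank-mono X≤Y)
  ... | inj₁ r< = r<
  ... | inj₂ r≡ = ⊥-elim (X≢Y (rank-injective X≤Y r≡))

  rank≤n : ∀ X → rank X ℕ.≤ n
  rank≤n X = subst (rank X ℕ.≤_) rank-𝟙 (rank-mono (𝟙-max X))

  rank≡0 : ∀ {X} → rank X ≡ 0 → X ≡ 𝟘
  rank≡0 {X} r≡0 = sym (rank-injective (𝟘-min X) (trans rank-𝟘 (sym r≡0)))

  Cover⇒rank : ∀ {X Y} → Cover X Y → rank Y ≡ suc (rank X)
  Cover⇒rank {X} c = trans (rank-SatFrom (_ ∷ []) (c , refl)) (ℕP.+-comm (rank X) 1)

  rank⇒Cover : ∀ {X Y} → X ≤ Y → rank Y ≡ suc (rank X) → Cover X Y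
  rank⇒Cover {X} {Y} X≤Y r≡ = X≤Y , (λ X≡Y → ℕP.<-irrefl (trans (cong rank X≡Y) r≡) (ℕP.n<1+n (rank X))) , between
    where
    between : ∀ Z → X ≤ Z → Z ≤ Y → Z ≡ X ⊎ Z ≡ Y
    between Z X≤Z Z≤Y with ℕP.m≤n⇒m<n∨m≡n (rank-mono X≤Z) | ℕP.m≤n⇒m<n∨m≡n (rank-mono Z≤Y)
    ... | inj₂ r≡ | _       = inj₁ (sym (rank-injective X≤Z r≡))
    ... | inj₁ _  | inj₂ r≡ = inj₂ (rank-injective Z≤Y r≡)
    ... | inj₁ r< | inj₁ r> = ⊥-elim (ℕP.<-irrefl refl (ℕP.≤-trans r> (subst (ℕ._≤ rank Z) (sym r≡) r<)))

  rank-along : ∀ {X Y} zs → SatFrom X zs Y → ∀ r → r ℕ.≤ length zs → Σ (Fin m) λ Z → rank Z ≡ rank X ℕ.+ r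
  rank-along {X} zs       s       zero    _         = X , sym (ℕP.+-identityʳ _)
  rank-along (W ∷ zs) (c , s) (suc r) (s≤s r≤) with rank-along zs s r r≤
  ... | Z , r≡ = Z , trans r≡ (trans (cong (ℕ._+ r) (Cover⇒rank c)) (sym (ℕP.+-suc _ r)))

  -- a saturated chain from 𝟘 to 𝟙 has n + 1 elements of distinct ranks
  n<m : n ℕ.< m
  n<m with n ℕP.<? m
  ... | yes n<m = n<m
  ... | no  n≮m = ⊥-elim (ℕP.<⇒≢ i<j (trans (sym (at-rank i)) (trans (cong rank fi≡fj) (at-rank j))))
    where
    chain = saturated 𝟘 𝟙 (𝟘-min 𝟙)
    len : length (proj₁ chain) ≡ n
    len = trans (rank-spec 𝟙 (proj₁ chain) (proj₂ chain)) rank-𝟙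
    bound : (i : Fin (suc n)) → Fin.toℕ i ℕ.≤ length (proj₁ chain)
    bound i = subst (Fin.toℕ i ℕ.≤_) (sym len) (ℕP.≤-pred (FinP.toℕ<n i))
    f : Fin (suc n) → Fin m
    f i = proj₁ (rank-along (proj₁ chain) (proj₂ chain) (Fin.toℕ i) (bound i))
    at-rank : ∀ i → rank (f i) ≡ Fin.toℕ i
    at-rank i = trans (proj₂ (rank-along (proj₁ chain) (proj₂ chain) (Fin.toℕ i) (bound i)))
                      (cong (ℕ._+ Fin.toℕ i) rank-𝟘)
    pigeon = FinP.pigeonhole (ℕP.≰⇒> n≮m) f
    i = proj₁ pigeon
    j = proj₁ (proj₂ pigeon)
    i<j = proj₁ (proj₂ (proj₂ pigeon))
    fi≡fj = proj₂ (proj₂ (proj₂ pigeon))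

  ≡ᶠ-refl : ∀ X → (X ≡ᶠ X) ≡ true
  ≡ᶠ-refl X = ⌊⌋-true (X FinP.≟ X) refl

  ≡ᶠ-false : ∀ {X Y} → X ≢ Y → (X ≡ᶠ Y) ≡ false
  ≡ᶠ-false {X} {Y} = ⌊⌋-false (X FinP.≟ Y)

  T-≡ᶠ : ∀ {X Y} → T (X ≡ᶠ Y) → X ≡ Y
  T-≡ᶠ = toWitness

  ≤ᵇ-true : ∀ {X Y} → X ≤ Y → (X ≤ᵇ Y) ≡ true
  ≤ᵇ-true {X} {Y} = ⌊⌋-true (X ≤? Y)

  ≤ᵇ-false : ∀ {X Y} → ¬ X ≤ Y → (X ≤ᵇ Y) ≡ false
  ≤ᵇ-false {X} {Y} = ⌊⌋-false (X ≤? Y)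

  T-≤ᵇ : ∀ {X Y} → T (X ≤ᵇ Y) → X ≤ Y
  T-≤ᵇ = toWitness

  T-<ᵇ : ∀ {X Y} → T (X <ᵇ Y) → X ≤ Y × X ≢ Y
  T-<ᵇ {X} {Y} t with X FinP.≟ Y
  ... | no X≢Y = T-≤ᵇ (T-∧-fst t) , X≢Y
  ... | yes _  = ⊥-elim (T-∧-snd {X ≤ᵇ Y} t)

  <ᵇ-true : ∀ {X Y} → X ≤ Y → X ≢ Y → (X <ᵇ Y) ≡ true
  <ᵇ-true X≤Y X≢Y rewrite ≤ᵇ-true X≤Y | ≡ᶠ-false X≢Y = refl

  <ᵇ-rank : ∀ {X Y} → T (X <ᵇ Y) → rank X ℕ.< rank Y
  <ᵇ-rank t = let (X≤Y , X≢Y) = T-<ᵇ t in rank-strict X≤Y X≢Y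

  ≤ᵇ-split : ∀ Z Y → ⟦ Z ≤ᵇ Y ⟧ ≡ ⟦ Z <ᵇ Y ⟧ + ⟦ Z ≡ᶠ Y ⟧
  ≤ᵇ-split Z Y with Z FinP.≟ Y
  ... | yes refl rewrite ≤ᵇ-true (≤-refl {Z}) = refl
  ... | no _     = sym (trans (ℤP.+-identityʳ _) (cong ⟦_⟧ (BoolP.∧-identityʳ (Z ≤ᵇ Y))))

  -- covers are decided through ranks, see rank⇒Cover
  _⋖ᵇ_ : Fin m → Fin m → Bool
  X ⋖ᵇ Y = (X ≤ᵇ Y) ∧ (rank Y ≡ᵇ suc (rank X))

  ⋖ᵇ⇒≤ : ∀ {X Y} → T (X ⋖ᵇ Y) → X ≤ Y
  ⋖ᵇ⇒≤ = T-≤ᵇ ∘ T-∧-fst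

  ⋖ᵇ⇒rank : ∀ {X Y} → T (X ⋖ᵇ Y) → rank Y ≡ suc (rank X)
  ⋖ᵇ⇒rank {X} {Y} t = ℕP.≡ᵇ⇒≡ _ _ (T-∧-snd {X ≤ᵇ Y} t)

  ⋖ᵇ⇒Cover : ∀ {X Y} → T (X ⋖ᵇ Y) → Cover X Y
  ⋖ᵇ⇒Cover t = rank⇒Cover (⋖ᵇ⇒≤ t) (⋖ᵇ⇒rank t)

  Cover⇒⋖ᵇ : ∀ {X Y} → Cover X Y → T (X ⋖ᵇ Y)
  Cover⇒⋖ᵇ c = T-∧-intro (true⇒T (≤ᵇ-true (proj₁ c))) (ℕP.≡⇒≡ᵇ _ _ (Cover⇒rank c))

  ⋖ᵇ⇒≢ : ∀ {X Y} → T (X ⋖ᵇ Y) → X ≢ Y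
  ⋖ᵇ⇒≢ t X≡Y = ℕP.<-irrefl (trans (cong rank X≡Y) (⋖ᵇ⇒rank t)) (ℕP.n<1+n _)

  ⋖ᵇ-from-𝟙 : ∀ Y → (𝟙 ⋖ᵇ Y) ≡ false
  ⋖ᵇ-from-𝟙 Y = ¬T⇒false (λ t → ℕP.<-irrefl refl
    (ℕP.≤-trans (ℕP.≤-reflexive (trans (cong suc (sym rank-𝟙)) (sym (⋖ᵇ⇒rank t)))) (rank≤n Y)))

  ⋖ᵇ-rank∸ : ∀ {W V Y} → T (W ⋖ᵇ V) → V ≤ Y → rank Y ∸ rank W ≡ suc (rank Y ∸ rank V)
  ⋖ᵇ-rank∸ {W} {V} {Y} t V≤Y = begin
      rank Y ∸ rank W
    ≡⟨ ∸-suc (rank Y) (rank W) (subst (ℕ._≤ rank Y) (⋖ᵇ⇒rank t) (rank-mono V≤Y)) ⟩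
      suc (rank Y ∸ suc (rank W))
    ≡⟨ cong (λ r → suc (rank Y ∸ r)) (sym (⋖ᵇ⇒rank t)) ⟩
      suc (rank Y ∸ rank V)
    ∎
    where open ≡-Reasoning

  upward-induction : (Q : Fin m → Set) → (∀ W → (∀ Y → W ≤ Y → W ≢ Y → Q Y) → Q W) → ∀ W → Q W
  upward-induction Q step W = go (suc (n ∸ rank W)) W (ℕP.n<1+n _)
    where
    go : ∀ f W → n ∸ rank W ℕ.< f → Q W
    go (suc f) W fuel = step W (λ Y W≤Y W≢Y →
      go f Y (ℕP.≤-trans (ℕP.∸-monoʳ-< (rank-strict W≤Y W≢Y) (rank≤n Y)) (ℕP.≤-pred fuel)))

  ⋖ᵇ-corank : ∀ {W V} → T (W ⋖ᵇ V) → n ∸ rank W ≡ suc (n ∸ rank V)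
  ⋖ᵇ-corank {W} {V} t = subst (λ r → r ∸ rank W ≡ suc (r ∸ rank V)) rank-𝟙 (⋖ᵇ-rank∸ t (𝟙-max V))

  -1^-⋖ᵇ : ∀ {W V} → T (W ⋖ᵇ V) → -1^ rank V ≡ - (-1^ rank W)
  -1^-⋖ᵇ t = cong -1^_ (⋖ᵇ⇒rank t)

  incrStep decrStep : Fin m → ℕ → Fin m → Bool
  incrStep W l V = (W ⋖ᵇ V) ∧ not (lab W V ℕ.<ᵇ l)
  decrStep W l V = (W ⋖ᵇ V) ∧ (lab W V ℕ.<ᵇ l)

  -- Saturated chains with weakly increasing labels

  isSat : Fin m → List (Fin m) → Fin m → Bool
  isSat X []       Y = X ≡ᶠ Y
  isSat X (W ∷ ws) Y = (X ⋖ᵇ W) ∧ isSat W ws Y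

  isIncrFrom : ℕ → Fin m → List (Fin m) → Bool
  isIncrFrom q X []       = true
  isIncrFrom q X (W ∷ ws) = not (lab X W ℕ.<ᵇ q) ∧ isIncrFrom (lab X W) W ws

  isSat⇒SatFrom : ∀ X zs Y → T (isSat X zs Y) → SatFrom X zs Y
  isSat⇒SatFrom X []       Y t = T-≡ᶠ t
  isSat⇒SatFrom X (W ∷ ws) Y t = ⋖ᵇ⇒Cover (T-∧-fst t) , isSat⇒SatFrom W ws Y (T-∧-snd {X ⋖ᵇ W} t)

  SatFrom⇒isSat : ∀ X zs Y → SatFrom X zs Y → T (isSat X zs Y)
  SatFrom⇒isSat X []       Y refl    = true⇒T (≡ᶠ-refl X)
  SatFrom⇒isSat X (W ∷ ws) Y (c , s) = T-∧-intro (Cover⇒⋖ᵇ c) (SatFrom⇒isSat W ws Y s)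

  isIncrFrom⇒Linked : ∀ q X zs → T (isIncrFrom q X zs) → Linked ℕ._≤_ (q ∷ labels P lab X zs)
  isIncrFrom⇒Linked q X []       t = [-]
  isIncrFrom⇒Linked q X (W ∷ ws) t =
    ℕP.≮⇒≥ (λ lab<q → T-not⇒¬T (T-∧-fst t) (ℕP.<⇒<ᵇ lab<q)) ∷ isIncrFrom⇒Linked (lab X W) W ws (T-∧-snd t)

  Linked⇒isIncrFrom : ∀ q X zs → Linked ℕ._≤_ (q ∷ labels P lab X zs) → T (isIncrFrom q X zs)
  Linked⇒isIncrFrom q X []       _         = tt
  Linked⇒isIncrFrom q X (W ∷ ws) (q≤ ∷ ℓ) =
    T-∧-intro (true⇒T (cong not (¬T⇒false (λ t → ℕP.<⇒≱ (ℕP.<ᵇ⇒< _ q t) q≤))))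
              (Linked⇒isIncrFrom (lab X W) W ws ℓ)

  incrChains : Fin m → Fin m → ℕ → ℤ
  incrChains X Y q = ∑ (listsOfLen (rank Y ∸ rank X)) (λ zs → ⟦ isSat X zs Y ∧ isIncrFrom q X zs ⟧)

  incrChains-≰ : ∀ {X Y} q → ¬ X ≤ Y → incrChains X Y q ≡ 0ℤ
  incrChains-≰ {X} {Y} q X≰Y =
    trans (∑-cong (listsOfLen (rank Y ∸ rank X))
             (λ zs → cong ⟦_⟧ (¬T⇒false (λ t → X≰Y (SatFrom⇒≤ zs (isSat⇒SatFrom X zs Y (T-∧-fst t)))))))
          (∑-zero (listsOfLen (rank Y ∸ rank X)))

  incrChains-unique : ∀ X Y → incrChains X Y 0 ≡ ⟦ X ≤ᵇ Y ⟧
  incrChains-unique X Y with X ≤? Y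
  ... | no X≰Y = incrChains-≰ 0 X≰Y
  ... | yes X≤Y with unique-incr X Y X≤Y
  ...   | zs₀ , (sat₀ , incr₀) , unique =
    trans (∑-listsOfLen-point P _ zs₀ length₀ _ others)
          (cong ⟦_⟧ (T⇒true (T-∧-intro (SatFrom⇒isSat X zs₀ Y sat₀) (Linked⇒isIncrFrom 0 X zs₀ (from-0 incr₀)))))
    where
    length₀ : length zs₀ ≡ rank Y ∸ rank X
    length₀ = trans (sym (ℕP.m+n∸m≡n (rank X) _)) (cong (_∸ rank X) (sym (rank-SatFrom zs₀ sat₀)))
    from-0 : ∀ {xs} → Linked ℕ._≤_ xs → Linked ℕ._≤_ (0 ∷ xs)
    from-0 []       = [-]
    from-0 [-]      = z≤n ∷ [-]
    from-0 (r ∷ ℓ) = z≤n ∷ r ∷ ℓ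
    others : ∀ zs → zs ≢ zs₀ → ⟦ isSat X zs Y ∧ isIncrFrom 0 X zs ⟧ ≡ 0ℤ
    others zs zs≢ = cong ⟦_⟧ (¬T⇒false (λ t → zs≢ (unique zs (isSat⇒SatFrom X zs Y (T-∧-fst t))
                                                         (tail (isIncrFrom⇒Linked 0 X zs (T-∧-snd t))))))

  incrChains-rec : ∀ X Y q → incrChains X Y q ≡
    ⟦ X ≡ᶠ Y ⟧ + (∑[ W ] ⟦ incrStep X q W ⟧ * incrChains W Y (lab X W))
  incrChains-rec X Y q with rank Y ∸ rank X in r≡
  ... | zero = cong₂ _+_ (cong ⟦_⟧ (BoolP.∧-identityʳ (X ≡ᶠ Y)))
                         (sym (trans (∑-cong (allFin m) (λ W → ⟦⟧-*-vanish (incrStep X q W)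
                                                           (λ t → incrChains-≰ (lab X W) (beyond W (T-∧-fst t)))))
                                     (∑-zero (allFin m))))
    where
    beyond : ∀ W → T (X ⋖ᵇ W) → ¬ W ≤ Y
    beyond W t W≤Y = ℕP.<-irrefl refl (ℕP.≤-trans (s≤s (ℕP.m∸n≡0⇒m≤n r≡))
                                       (ℕP.≤-trans (ℕP.≤-reflexive (sym (⋖ᵇ⇒rank t))) (rank-mono W≤Y)))
  ... | suc j = begin
      ∑ (listsOfLen (suc j)) (λ zs → ⟦ isSat X zs Y ∧ isIncrFrom q X zs ⟧)
    ≡⟨ listsOfLen-suc P j _ ⟩
      (∑[ W ] ∑ (listsOfLen j) (λ zs → ⟦ isSat X (W ∷ zs) Y ∧ isIncrFrom q X (W ∷ zs) ⟧))
    ≡⟨ ∑-cong (allFin m) first-step ⟩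
      (∑[ W ] ⟦ incrStep X q W ⟧ * incrChains W Y (lab X W))
    ≡⟨ sym (trans (cong (λ b → ⟦ b ⟧ + steps) (≡ᶠ-false X≢Y)) (ℤP.+-identityˡ steps)) ⟩
      ⟦ X ≡ᶠ Y ⟧ + steps
    ∎
    where
    open ≡-Reasoning
    steps = (∑[ W ] ⟦ incrStep X q W ⟧ * incrChains W Y (lab X W))
    X≢Y : X ≢ Y
    X≢Y refl = ℕP.0≢1+n (trans (sym (ℕP.n∸n≡0 (rank X))) r≡)
    first-step : ∀ W → ∑ (listsOfLen j) (λ zs → ⟦ isSat X (W ∷ zs) Y ∧ isIncrFrom q X (W ∷ zs) ⟧)
                     ≡ ⟦ incrStep X q W ⟧ * incrChains W Y (lab X W)
    first-step W = begin
        ∑ (listsOfLen j) (λ zs → ⟦ isSat X (W ∷ zs) Y ∧ isIncrFrom q X (W ∷ zs) ⟧)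
      ≡⟨ ∑-cong (listsOfLen j) (λ zs → ⟦∧∧⟧ (X ⋖ᵇ W) (isSat W zs Y) _ (isIncrFrom (lab X W) W zs)) ⟩
        ∑ (listsOfLen j) (λ zs → ⟦ incrStep X q W ⟧ * ⟦ isSat W zs Y ∧ isIncrFrom (lab X W) W zs ⟧)
      ≡⟨ ∑-*ˡ (listsOfLen j) ⟦ incrStep X q W ⟧ (λ zs → ⟦ isSat W zs Y ∧ isIncrFrom (lab X W) W zs ⟧) ⟩
        ⟦ incrStep X q W ⟧ * ∑ (listsOfLen j) (λ zs → ⟦ isSat W zs Y ∧ isIncrFrom (lab X W) W zs ⟧)
      ≡⟨ ⟦⟧-*-cong (incrStep X q W) (λ t → cong (λ i → ∑ (listsOfLen i) (λ zs → ⟦ isSat W zs Y ∧ isIncrFrom (lab X W) W zs ⟧))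
                                                                (sym (rank∸ (T-∧-fst t)))) ⟩
        ⟦ incrStep X q W ⟧ * incrChains W Y (lab X W)
      ∎
      where
      rank∸ : T (X ⋖ᵇ W) → rank Y ∸ rank W ≡ j
      rank∸ t = trans (cong (rank Y ∸_) (⋖ᵇ⇒rank t))
                      (trans (sym (ℕP.pred[m∸n]≡m∸[1+n] (rank Y) (rank X))) (cong ℕ.pred r≡))

  -- Strictly decreasing chains and the Möbius function

  -- saturated chains from W to Z with strictly decreasing labels, all below l
  decrChainsBelowF : ℕ → Fin m → Fin m → ℕ → ℤ
  decrChainsBelowF zero    W Z l = ⟦ W ≡ᶠ Z ⟧
  decrChainsBelowF (suc f) W Z l =
    ⟦ W ≡ᶠ Z ⟧ + (∑[ V ] ⟦ decrStep W l V ⟧ * decrChainsBelowF f V Z (lab W V))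

  decrChainsBelow : Fin m → Fin m → ℕ → ℤ
  decrChainsBelow W = decrChainsBelowF (n ∸ rank W) W

  decrChains : Fin m → Fin m → ℤ
  decrChains X Z = ⟦ X ≡ᶠ Z ⟧ + (∑[ W ] ⟦ X ⋖ᵇ W ⟧ * decrChainsBelow W Z (lab X W))

  decrChainsBelow-unfold : ∀ W Z l → decrChainsBelow W Z l ≡
    ⟦ W ≡ᶠ Z ⟧ + (∑[ V ] ⟦ decrStep W l V ⟧ * decrChainsBelow V Z (lab W V))
  decrChainsBelow-unfold W Z l with n ∸ rank W in corank≡
  ... | zero = sym (trans (cong (⟦ W ≡ᶠ Z ⟧ +_)
          (trans (∑-cong (allFin m) (λ V → ⟦⟧-*-vanish (decrStep W l V)
                    (λ t → ⊥-elim (ℕP.0≢1+n (trans (sym corank≡) (⋖ᵇ-corank (T-∧-fst t)))))))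
                 (∑-zero (allFin m))))
          (ℤP.+-identityʳ _))
  ... | suc f = cong (⟦ W ≡ᶠ Z ⟧ +_) (∑-cong (allFin m) (λ V → ⟦⟧-*-cong (decrStep W l V)
          (λ t → cong (λ g → decrChainsBelowF g V Z (lab W V))
                      (ℕP.suc-injective (trans (sym corank≡) (⋖ᵇ-corank (T-∧-fst t)))))))

  decrChainsBelowF-≰ : ∀ f {W Z} l → ¬ W ≤ Z → decrChainsBelowF f W Z l ≡ 0ℤ
  decrChainsBelowF-≰ zero {W} {Z} l W≰Z = cong ⟦_⟧ (≡ᶠ-false {W} {Z} λ { refl → W≰Z ≤-refl })
  decrChainsBelowF-≰ (suc f) {W} {Z} l W≰Z =
    trans (cong₂ _+_ (cong ⟦_⟧ (≡ᶠ-false {W} {Z} λ { refl → W≰Z ≤-refl }))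
                     (∑-cong (allFin m) (λ V → ⟦⟧-*-vanish (decrStep W l V)
                       (λ t → decrChainsBelowF-≰ f (lab W V) (λ V≤Z → W≰Z (PO.trans (⋖ᵇ⇒≤ (T-∧-fst t)) V≤Z))))))
          (trans (ℤP.+-identityˡ _) (∑-zero (allFin m)))

  0≤decrChainsBelowF : ∀ f W Z l → 0ℤ ℤ.≤ decrChainsBelowF f W Z l
  0≤decrChainsBelowF zero    W Z l = 0≤⟦⟧ (W ≡ᶠ Z)
  0≤decrChainsBelowF (suc f) W Z l = 0≤-+ (0≤⟦⟧ (W ≡ᶠ Z)) (0≤-∑ (allFin m) _ (λ V →
    0≤-* (0≤⟦⟧ (decrStep W l V)) (0≤decrChainsBelowF f V Z (lab W V))))

  0≤decrChains : ∀ X Z → 0ℤ ℤ.≤ decrChains X Z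
  0≤decrChains X Z = 0≤-+ (0≤⟦⟧ (X ≡ᶠ Z)) (0≤-∑ (allFin m) _ (λ W →
    0≤-* (0≤⟦⟧ (X ⋖ᵇ W)) (0≤decrChainsBelowF (n ∸ rank W) W Z (lab X W))))

  decrChains-≰ : ∀ {X Z} → ¬ X ≤ Z → decrChains X Z ≡ 0ℤ
  decrChains-≰ {X} {Z} X≰Z =
    trans (cong₂ _+_ (cong ⟦_⟧ (≡ᶠ-false {X} {Z} λ { refl → X≰Z ≤-refl }))
                     (∑-cong (allFin m) (λ W → ⟦⟧-*-vanish (X ⋖ᵇ W)
                       (λ t → decrChainsBelowF-≰ (n ∸ rank W) (lab X W) (λ W≤Z → X≰Z (PO.trans (⋖ᵇ⇒≤ t) W≤Z))))))
          (trans (ℤP.+-identityˡ _) (∑-zero (allFin m)))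

  decrChains-refl : ∀ X → decrChains X X ≡ 1ℤ
  decrChains-refl X =
    cong₂ _+_ (cong ⟦_⟧ (≡ᶠ-refl X))
              (trans (∑-cong (allFin m) (λ W → ⟦⟧-*-vanish (X ⋖ᵇ W)
                       (λ t → decrChainsBelowF-≰ (n ∸ rank W) (lab X W) (λ W≤X → ⋖ᵇ⇒≢ t (PO.antisym (⋖ᵇ⇒≤ t) W≤X)))))
                     (∑-zero (allFin m)))

  alternating-decr-incr : ∀ W l Y →
    (∑[ Z ] decrChainsBelow W Z l * (-1^ rank Z * incrChains Z Y 0)) ≡ -1^ rank W * incrChains W Y l
  alternating-decr-incr = upward-induction _ step
    where
    step : ∀ W → (∀ V → W ≤ V → W ≢ V → ∀ l Y →
                   (∑[ Z ] decrChainsBelow V Z l * (-1^ rank Z * incrChains Z Y 0)) ≡ -1^ rank V * incrChains V Y l) →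
           ∀ l Y → (∑[ Z ] decrChainsBelow W Z l * (-1^ rank Z * incrChains Z Y 0)) ≡ -1^ rank W * incrChains W Y l
    step W IH l Y = begin
        (∑[ Z ] decrChainsBelow W Z l * G Z)
      ≡⟨ ∑-cong (allFin m) (λ Z → cong (_* G Z) (decrChainsBelow-unfold W Z l)) ⟩
        (∑[ Z ] (⟦ W ≡ᶠ Z ⟧ + (∑[ V ] c V * decrChainsBelow V Z (lab W V))) * G Z)
      ≡⟨ ∑-δ+∑ W c (λ V Z → decrChainsBelow V Z (lab W V)) G ⟩
        G W + (∑[ V ] c V * (∑[ Z ] decrChainsBelow V Z (lab W V) * G Z))
      ≡⟨ cong (G W +_) (trans (∑-cong (allFin m) by-IH) (∑-*ˡ (allFin m) (- s) (λ V → c V * incrChains V Y (lab W V)))) ⟩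
        s * incrChains W Y 0 + - s * below
      ≡⟨ cong (λ t → s * t + - s * below) (trans (incrChains-rec W Y 0) (cong (⟦ W ≡ᶠ Y ⟧ +_) split)) ⟩
        s * (⟦ W ≡ᶠ Y ⟧ + (below + above)) + - s * below
      ≡⟨ solve 4 (λ s e a b → s :* (e :+ (a :+ b)) :+ (:- s) :* a := s :* (e :+ b)) refl s ⟦ W ≡ᶠ Y ⟧ below above ⟩
        s * (⟦ W ≡ᶠ Y ⟧ + above)
      ≡⟨ cong (s *_) (sym (incrChains-rec W Y l)) ⟩
        s * incrChains W Y l
      ∎
      where
      open ≡-Reasoning
      s = -1^ rank W
      G : Fin m → ℤ
      G Z = -1^ rank Z * incrChains Z Y 0
      c : Fin m → ℤ
      c V = ⟦ decrStep W l V ⟧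
      below above : ℤ
      below = (∑[ V ] c V * incrChains V Y (lab W V))
      above = (∑[ V ] ⟦ incrStep W l V ⟧ * incrChains V Y (lab W V))
      by-IH : ∀ V → c V * (∑[ Z ] decrChainsBelow V Z (lab W V) * G Z) ≡ - s * (c V * incrChains V Y (lab W V))
      by-IH V = trans (⟦⟧-*-cong (decrStep W l V) (λ t →
                  trans (IH V (⋖ᵇ⇒≤ (T-∧-fst t)) (⋖ᵇ⇒≢ (T-∧-fst t)) (lab W V) Y)
                        (cong (_* incrChains V Y (lab W V)) (-1^-⋖ᵇ (T-∧-fst t)))))
                (solve 3 (λ c s x → c :* ((:- s) :* x) := (:- s) :* (c :* x)) refl (c V) s (incrChains V Y (lab W V)))
      split : (∑[ V ] ⟦ incrStep W 0 V ⟧ * incrChains V Y (lab W V)) ≡ below + above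
      split = trans (∑-cong (allFin m) (λ V →
                       trans (cong (_* incrChains V Y (lab W V))
                                   (trans (cong ⟦_⟧ (BoolP.∧-identityʳ (W ⋖ᵇ V))) (⟦⟧-split (W ⋖ᵇ V) (lab W V ℕ.<ᵇ l))))
                             (ℤP.*-distribʳ-+ (incrChains V Y (lab W V)) (c V) _)))
                    (∑-distrib-+ (allFin m) _ _)

  decrChains-inverse : ∀ X Y →
    (∑[ Z ] decrChains X Z * (-1^ rank Z * incrChains Z Y 0)) ≡ -1^ rank X * ⟦ X ≡ᶠ Y ⟧
  decrChains-inverse X Y = begin
      (∑[ Z ] decrChains X Z * G Z)
    ≡⟨ ∑-δ+∑ X (λ W → ⟦ X ⋖ᵇ W ⟧) (λ W Z → decrChainsBelow W Z (lab X W)) G ⟩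
      G X + (∑[ W ] ⟦ X ⋖ᵇ W ⟧ * (∑[ Z ] decrChainsBelow W Z (lab X W) * G Z))
    ≡⟨ cong (G X +_) (trans (∑-cong (allFin m) by-alternating)
          (∑-*ˡ (allFin m) (- s) (λ W → ⟦ X ⋖ᵇ W ⟧ * incrChains W Y (lab X W)))) ⟩
      s * incrChains X Y 0 + - s * steps
    ≡⟨ cong (λ t → s * t + - s * steps) (trans (incrChains-rec X Y 0) (cong (⟦ X ≡ᶠ Y ⟧ +_)
         (∑-cong (allFin m) (λ W → cong (λ b → ⟦ b ⟧ * incrChains W Y (lab X W)) (BoolP.∧-identityʳ (X ⋖ᵇ W)))))) ⟩
      s * (⟦ X ≡ᶠ Y ⟧ + steps) + - s * steps
    ≡⟨ solve 3 (λ s e a → s :* (e :+ a) :+ (:- s) :* a := s :* e) refl s ⟦ X ≡ᶠ Y ⟧ steps ⟩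
      s * ⟦ X ≡ᶠ Y ⟧
    ∎
    where
    open ≡-Reasoning
    s = -1^ rank X
    G : Fin m → ℤ
    G Z = -1^ rank Z * incrChains Z Y 0
    steps = (∑[ W ] ⟦ X ⋖ᵇ W ⟧ * incrChains W Y (lab X W))
    by-alternating : ∀ W → ⟦ X ⋖ᵇ W ⟧ * (∑[ Z ] decrChainsBelow W Z (lab X W) * G Z)
                           ≡ - s * (⟦ X ⋖ᵇ W ⟧ * incrChains W Y (lab X W))
    by-alternating W = trans (⟦⟧-*-cong (X ⋖ᵇ W) (λ t →
                         trans (alternating-decr-incr W (lab X W) Y) (cong (_* incrChains W Y (lab X W)) (-1^-⋖ᵇ t))))
                       (solve 3 (λ c s x → c :* ((:- s) :* x) := (:- s) :* (c :* x)) refl ⟦ X ⋖ᵇ W ⟧ s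
                             (incrChains W Y (lab X W)))

  ∑-below-decrChains : ∀ {X Y} → X ≢ Y →
    (∑[ Z ] ⟦ Z <ᵇ Y ⟧ * (-1^ rank Z * decrChains X Z)) ≡ - (-1^ rank Y * decrChains X Y)
  ∑-below-decrChains {X} {Y} X≢Y = begin
      strictly
    ≡⟨ solve 2 (λ a b → a := (a :+ b) :+ (:- b)) refl strictly at-Y ⟩
      (strictly + at-Y) + - at-Y
    ≡⟨ cong₂ (λ t u → t + - u) weakly≡0 (∑-delta Y (λ Z → -1^ rank Z * decrChains X Z)) ⟩
      0ℤ + - (-1^ rank Y * decrChains X Y)
    ≡⟨ ℤP.+-identityˡ _ ⟩
      - (-1^ rank Y * decrChains X Y)
    ∎
    where
    open ≡-Reasoning
    strictly = (∑[ Z ] ⟦ Z <ᵇ Y ⟧ * (-1^ rank Z * decrChains X Z))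
    at-Y = (∑[ Z ] ⟦ Z ≡ᶠ Y ⟧ * (-1^ rank Z * decrChains X Z))
    weakly≡0 : strictly + at-Y ≡ 0ℤ
    weakly≡0 = begin
        strictly + at-Y
      ≡⟨ sym (∑-distrib-+ (allFin m) _ _) ⟩
        (∑[ Z ] ⟦ Z <ᵇ Y ⟧ * (-1^ rank Z * decrChains X Z) + ⟦ Z ≡ᶠ Y ⟧ * (-1^ rank Z * decrChains X Z))
      ≡⟨ ∑-cong (allFin m) (λ Z → begin
           ⟦ Z <ᵇ Y ⟧ * (-1^ rank Z * decrChains X Z) + ⟦ Z ≡ᶠ Y ⟧ * (-1^ rank Z * decrChains X Z)
         ≡⟨ sym (ℤP.*-distribʳ-+ (-1^ rank Z * decrChains X Z) ⟦ Z <ᵇ Y ⟧ ⟦ Z ≡ᶠ Y ⟧) ⟩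
           (⟦ Z <ᵇ Y ⟧ + ⟦ Z ≡ᶠ Y ⟧) * (-1^ rank Z * decrChains X Z)
         ≡⟨ cong (_* (-1^ rank Z * decrChains X Z)) (trans (sym (≤ᵇ-split Z Y)) (sym (incrChains-unique Z Y))) ⟩
           incrChains Z Y 0 * (-1^ rank Z * decrChains X Z)
         ≡⟨ solve 3 (λ i s d → i :* (s :* d) := d :* (s :* i)) refl (incrChains Z Y 0) (-1^ rank Z) (decrChains X Z) ⟩
           decrChains X Z * (-1^ rank Z * incrChains Z Y 0)
         ∎) ⟩
        (∑[ Z ] decrChains X Z * (-1^ rank Z * incrChains Z Y 0))
      ≡⟨ decrChains-inverse X Y ⟩
        -1^ rank X * ⟦ X ≡ᶠ Y ⟧
      ≡⟨ trans (cong (λ b → -1^ rank X * ⟦ b ⟧) (≡ᶠ-false X≢Y)) (ℤP.*-zeroʳ (-1^ rank X)) ⟩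
        0ℤ
      ∎

  mobius-decrChains : ∀ f X Y → rank Y ℕ.< f → X ≤ Y → mobiusF f X Y ≡ -1^ rank X * (-1^ rank Y * decrChains X Y)
  mobius-decrChains (suc f) X Y rY<f X≤Y = by-cases (X ≡ᶠ Y) refl
    where
    open ≡-Reasoning
    strict-sum = (∑[ Z ] (if (X ≤ᵇ Z) ∧ (Z <ᵇ Y) then mobiusF f X Z else 0ℤ))
    summand : ∀ Z → (if (X ≤ᵇ Z) ∧ (Z <ᵇ Y) then mobiusF f X Z else 0ℤ)
                    ≡ -1^ rank X * (⟦ Z <ᵇ Y ⟧ * (-1^ rank Z * decrChains X Z))
    summand Z with X ≤? Z
    ... | no X≰Z = sym (trans (cong (λ d → -1^ rank X * (⟦ Z <ᵇ Y ⟧ * (-1^ rank Z * d))) (decrChains-≰ X≰Z))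
                         (solve 3 (λ a b c → a :* (b :* (c :* con 0ℤ)) := con 0ℤ) refl (-1^ rank X) ⟦ Z <ᵇ Y ⟧ (-1^ rank Z)))
    ... | yes X≤Z with Z <ᵇ Y in Z<Y
    ...   | false = sym (ℤP.*-zeroʳ (-1^ rank X))
    ...   | true  = trans (mobius-decrChains f X Z (ℕP.≤-trans (<ᵇ-rank (true⇒T Z<Y)) (ℕP.≤-pred rY<f)) X≤Z)
                          (cong (-1^ rank X *_) (sym (ℤP.*-identityˡ _)))
    by-cases : ∀ b → (X ≡ᶠ Y) ≡ b →
      (if b then 1ℤ else (if X ≤ᵇ Y then - strict-sum else 0ℤ)) ≡ -1^ rank X * (-1^ rank Y * decrChains X Y)
    by-cases true  X≡ᶠY with T-≡ᶠ (true⇒T X≡ᶠY)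
    ... | refl = sym (trans (cong (λ d → -1^ rank X * (-1^ rank X * d)) (decrChains-refl X))
                            (trans (cong (-1^ rank X *_) (ℤP.*-identityʳ (-1^ rank X))) (-1^-square (rank X))))
    by-cases false X≢ᶠY rewrite ≤ᵇ-true X≤Y = begin
        - strict-sum
      ≡⟨ cong -_ (trans (∑-cong (allFin m) summand) (∑-*ˡ (allFin m) (-1^ rank X) _)) ⟩
        - (-1^ rank X * (∑[ Z ] ⟦ Z <ᵇ Y ⟧ * (-1^ rank Z * decrChains X Z)))
      ≡⟨ cong (λ t → - (-1^ rank X * t)) (∑-below-decrChains X≢Y) ⟩
        - (-1^ rank X * - (-1^ rank Y * decrChains X Y))
      ≡⟨ solve 2 (λ a b → :- (a :* (:- b)) := a :* b) refl (-1^ rank X) (-1^ rank Y * decrChains X Y) ⟩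
        -1^ rank X * (-1^ rank Y * decrChains X Y)
      ∎
      where
      X≢Y : X ≢ Y
      X≢Y refl with trans (sym (≡ᶠ-refl X)) X≢ᶠY
      ... | ()

  ∣μ∣≡decrChains : ∀ {X Y} → X ≤ Y → ℤ.+ ∣ μ X Y ∣ ≡ decrChains X Y
  ∣μ∣≡decrChains {X} {Y} X≤Y = begin
      ℤ.+ ∣ μ X Y ∣
    ≡⟨ cong (λ t → ℤ.+ ∣ t ∣) (mobius-decrChains m X Y (ℕP.≤-<-trans (rank≤n Y) n<m) X≤Y) ⟩
      ℤ.+ ∣ -1^ rank X * (-1^ rank Y * decrChains X Y) ∣
    ≡⟨ cong ℤ.+_ (trans (∣-1^*∣ (rank X) _) (∣-1^*∣ (rank Y) _)) ⟩
      ℤ.+ ∣ decrChains X Y ∣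
    ≡⟨ ℤP.0≤i⇒+∣i∣≡i (0≤decrChains X Y) ⟩
      decrChains X Y
    ∎
    where open ≡-Reasoning

  PoinI-*ₚ : ∀ X Y (q : Poly) k → (PoinI X Y *ₚ q) k ≡
    (∑[ Z ] (⟦ (X ≤ᵇ Z) ∧ (Z ≤ᵇ Y) ⟧ * decrChains X Z) * (y^ (rank Z ∸ rank X) · q) k)
  PoinI-*ₚ X Y q k = begin
      ∑ (upTo (suc k)) (λ i → PoinI X Y i * q (k ∸ i))
    ≡⟨ ∑-cong (upTo (suc k)) (λ i → cong (_* q (k ∸ i)) (∑-cong (allFin m) (coefficient i))) ⟩
      ∑ (upTo (suc k)) (λ i → (∑[ Z ] a Z * ⟦ (rank Z ∸ rank X) ≡ᵇ i ⟧) * q (k ∸ i))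
    ≡⟨ ∑-∑-* (allFin m) (upTo (suc k)) a (λ Z i → ⟦ (rank Z ∸ rank X) ≡ᵇ i ⟧) (λ i → q (k ∸ i)) ⟩
      (∑[ Z ] a Z * ∑ (upTo (suc k)) (λ i → ⟦ (rank Z ∸ rank X) ≡ᵇ i ⟧ * q (k ∸ i)))
    ≡⟨ ∑-cong (allFin m) (λ Z → cong (a Z *_) (*ₚ-monomial (rank Z ∸ rank X) k q)) ⟩
      (∑[ Z ] a Z * (y^ (rank Z ∸ rank X) · q) k)
    ∎
    where
    open ≡-Reasoning
    a : Fin m → ℤ
    a Z = ⟦ (X ≤ᵇ Z) ∧ (Z ≤ᵇ Y) ⟧ * decrChains X Z
    coefficient : ∀ i Z → (if (X ≤ᵇ Z) ∧ (Z ≤ᵇ Y) ∧ ((rank Z ∸ rank X) ≡ᵇ i) then ℤ.+ ∣ μ X Z ∣ else 0ℤ)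
                          ≡ a Z * ⟦ (rank Z ∸ rank X) ≡ᵇ i ⟧
    coefficient i Z with X ≤? Z
    ... | no _ = refl
    ... | yes X≤Z with Z ≤ᵇ Y
    ...   | false = refl
    ...   | true with (rank Z ∸ rank X) ≡ᵇ i
    ...     | false = sym (ℤP.*-zeroʳ (1ℤ * decrChains X Z))
    ...     | true  = trans (∣μ∣≡decrChains X≤Z)
                            (sym (trans (ℤP.*-identityʳ (1ℤ * decrChains X Z)) (ℤP.*-identityˡ (decrChains X Z))))

  chainStep : Fin m → Fin m → Bool
  chainStep X Y = (X <ᵇ Y) ∧ (Y <ᵇ 𝟙)

  chainAbove : Fin m → List (Fin m) → Bool
  chainAbove X C = strictIncr (X ∷ C) ∧ avoids 𝟙 C

  chainAbove-∷ : ∀ X Y C → chainAbove X (Y ∷ C) ≡ chainStep X Y ∧ chainAbove Y C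
  chainAbove-∷ X Y C rewrite ≤ᵇ-true (𝟙-max Y) with X <ᵇ Y | Y ≡ᶠ 𝟙
  ... | true  | false = refl
  ... | true  | true  = BoolP.∧-zeroʳ (strictIncr (Y ∷ C))
  ... | false | _     = refl

  strictIncr-ranks : ∀ Y C → T (strictIncr (Y ∷ C)) → All (λ Z → rank Y ℕ.< rank Z) C
  strictIncr-ranks Y []      _ = []
  strictIncr-ranks Y (Z ∷ C) t = rY<rZ ∷ weaken (strictIncr-ranks Z C (T-∧-snd {Y <ᵇ Z} t))
    where
    rY<rZ = <ᵇ-rank (T-∧-fst t)
    weaken : ∀ {C} → All (λ V → rank Z ℕ.< rank V) C → All (λ V → rank Y ℕ.< rank V) C
    weaken = All-map (ℕP.<-trans rY<rZ)

  chainSumF : ℕ → Fin m → (List (Fin m) → ℤ) → ℤ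
  chainSumF zero    X G = 0ℤ
  chainSumF (suc B) X G = G [] + (∑[ Y ] ⟦ chainStep X Y ⟧ * chainSumF B Y (G ∘ (Y ∷_)))

  -- chains above X have at most n ∸ rank X elements
  chainSum : Fin m → (List (Fin m) → ℤ) → ℤ
  chainSum X = chainSumF (suc (n ∸ rank X)) X

  ∑-chainAbove : ∀ B X G →
    ∑ (upTo B) (λ L → ∑ (listsOfLen L) (λ C → ⟦ chainAbove X C ⟧ * G C)) ≡ chainSumF B X G
  ∑-chainAbove zero    X G = refl
  ∑-chainAbove (suc B) X G = begin
      (⟦ true ⟧ * G [] + 0ℤ) + ∑ (applyUpTo suc B) (λ L → ∑ (listsOfLen L) (λ C → ⟦ chainAbove X C ⟧ * G C))
    ≡⟨ cong₂ _+_ (trans (ℤP.+-identityʳ (1ℤ * G [])) (ℤP.*-identityˡ (G [])))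
                 (∑-applyUpTo-suc B (λ L → ∑ (listsOfLen L) (λ C → ⟦ chainAbove X C ⟧ * G C))) ⟩
      G [] + ∑ (upTo B) (λ L → ∑ (listsOfLen (suc L)) (λ C → ⟦ chainAbove X C ⟧ * G C))
    ≡⟨ cong (G [] +_) (∑-cong (upTo B) (λ L → trans (listsOfLen-suc P L _) (∑-cong (allFin m) (first L)))) ⟩
      G [] + ∑ (upTo B) (λ L → (∑[ Y ] c Y * ∑ (listsOfLen L) (λ C → ⟦ chainAbove Y C ⟧ * G (Y ∷ C))))
    ≡⟨ cong (G [] +_) (trans (∑-comm (upTo B) (allFin m) _) (∑-cong (allFin m) (λ Y → ∑-*ˡ (upTo B) (c Y) _))) ⟩
      G [] + (∑[ Y ] c Y * ∑ (upTo B) (λ L → ∑ (listsOfLen L) (λ C → ⟦ chainAbove Y C ⟧ * G (Y ∷ C))))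
    ≡⟨ cong (G [] +_) (∑-cong (allFin m) (λ Y → cong (c Y *_) (∑-chainAbove B Y (G ∘ (Y ∷_))))) ⟩
      chainSumF (suc B) X G
    ∎
    where
    open ≡-Reasoning
    c : Fin m → ℤ
    c Y = ⟦ chainStep X Y ⟧
    first : ∀ L Y → ∑ (listsOfLen L) (λ C → ⟦ chainAbove X (Y ∷ C) ⟧ * G (Y ∷ C))
                    ≡ c Y * ∑ (listsOfLen L) (λ C → ⟦ chainAbove Y C ⟧ * G (Y ∷ C))
    first L Y = trans (∑-cong (listsOfLen L) (λ C → begin
        ⟦ chainAbove X (Y ∷ C) ⟧ * G (Y ∷ C)
      ≡⟨ cong (λ b → ⟦ b ⟧ * G (Y ∷ C)) (chainAbove-∷ X Y C) ⟩
        ⟦ chainStep X Y ∧ chainAbove Y C ⟧ * G (Y ∷ C)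
      ≡⟨ trans (cong (_* G (Y ∷ C)) (⟦∧⟧ (chainStep X Y) (chainAbove Y C))) (ℤP.*-assoc (c Y) _ _) ⟩
        c Y * (⟦ chainAbove Y C ⟧ * G (Y ∷ C))
      ∎)) (∑-*ˡ (listsOfLen L) (c Y) _)

  chainSumF-cong : ∀ B X {G H : List (Fin m) → ℤ} → (∀ C → T (chainAbove X C) → G C ≡ H C) →
    chainSumF B X G ≡ chainSumF B X H
  chainSumF-cong zero    X G≗H = refl
  chainSumF-cong (suc B) X G≗H = cong₂ _+_ (G≗H [] tt) (∑-cong (allFin m) (λ Y →
    ⟦⟧-*-cong (chainStep X Y) (λ t → chainSumF-cong B Y (λ C c →
      G≗H (Y ∷ C) (subst T (sym (chainAbove-∷ X Y C)) (T-∧-intro t c))))))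

  chainSumF-zero : ∀ B X → chainSumF B X (λ _ → 0ℤ) ≡ 0ℤ
  chainSumF-zero zero    X = refl
  chainSumF-zero (suc B) X = trans (ℤP.+-identityˡ _) (trans (∑-cong (allFin m) (λ Y →
    ⟦⟧-*-vanish (chainStep X Y) (λ _ → chainSumF-zero B Y))) (∑-zero (allFin m)))

  chainSumF-*ˡ : ∀ B X a (G : List (Fin m) → ℤ) → chainSumF B X (λ C → a * G C) ≡ a * chainSumF B X G
  chainSumF-*ˡ zero    X a G = sym (ℤP.*-zeroʳ a)
  chainSumF-*ˡ (suc B) X a G = begin
      a * G [] + (∑[ Y ] c Y * chainSumF B Y (λ C → a * G (Y ∷ C)))
    ≡⟨ cong (a * G [] +_) (trans (∑-cong (allFin m) (λ Y → trans (cong (c Y *_) (chainSumF-*ˡ B Y a (G ∘ (Y ∷_))))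
         (solve 3 (λ c a s → c :* (a :* s) := a :* (c :* s)) refl (c Y) a (chainSumF B Y (G ∘ (Y ∷_))))))
         (∑-*ˡ (allFin m) a _)) ⟩
      a * G [] + a * (∑[ Y ] c Y * chainSumF B Y (G ∘ (Y ∷_)))
    ≡⟨ sym (ℤP.*-distribˡ-+ a (G []) _) ⟩
      a * chainSumF (suc B) X G
    ∎
    where
    open ≡-Reasoning
    c : Fin m → ℤ
    c Y = ⟦ chainStep X Y ⟧

  chainSumF-+ : ∀ B X (G H : List (Fin m) → ℤ) →
    chainSumF B X (λ C → G C + H C) ≡ chainSumF B X G + chainSumF B X H
  chainSumF-+ zero    X G H = refl
  chainSumF-+ (suc B) X G H = begin
      (G [] + H []) + (∑[ Y ] c Y * chainSumF B Y (λ C → G (Y ∷ C) + H (Y ∷ C)))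
    ≡⟨ cong ((G [] + H []) +_) (trans (∑-cong (allFin m) (λ Y →
         trans (cong (c Y *_) (chainSumF-+ B Y (G ∘ (Y ∷_)) (H ∘ (Y ∷_)))) (ℤP.*-distribˡ-+ (c Y) _ _)))
         (∑-distrib-+ (allFin m) _ _)) ⟩
      (G [] + H []) + ((∑[ Y ] c Y * chainSumF B Y (G ∘ (Y ∷_))) + (∑[ Y ] c Y * chainSumF B Y (H ∘ (Y ∷_))))
    ≡⟨ solve 4 (λ a b c d → (a :+ b) :+ (c :+ d) := (a :+ c) :+ (b :+ d)) refl (G []) (H []) _ _ ⟩
      chainSumF (suc B) X G + chainSumF (suc B) X H
    ∎
    where
    open ≡-Reasoning
    c : Fin m → ℤ
    c Y = ⟦ chainStep X Y ⟧

  chainSumF-∑ : ∀ B X {A : Set} (xs : List A) (a : A → ℤ) (H : A → List (Fin m) → ℤ) →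
    chainSumF B X (λ C → ∑ xs (λ z → a z * H z C)) ≡ ∑ xs (λ z → a z * chainSumF B X (H z))
  chainSumF-∑ B X []       a H = chainSumF-zero B X
  chainSumF-∑ B X (z ∷ xs) a H =
    trans (chainSumF-+ B X (λ C → a z * H z C) (λ C → ∑ xs (λ z → a z * H z C)))
          (cong₂ _+_ (chainSumF-*ˡ B X (a z) (H z)) (chainSumF-∑ B X xs a H))

  chainSumF-y^ : ∀ B X e k (H : ℕ → List (Fin m) → ℤ) →
    chainSumF B X (λ C → (y^ e · (λ i → H i C)) k) ≡ (y^ e · (λ i → chainSumF B X (H i))) k
  chainSumF-y^ B X zero    k       H = refl
  chainSumF-y^ B X (suc e) zero    H = chainSumF-zero B X
  chainSumF-y^ B X (suc e) (suc k) H = chainSumF-y^ B X e k H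

  chainSumF-suc : ∀ B X G → suc (n ∸ rank X) ℕ.≤ B → chainSumF B X G ≡ chainSumF (suc B) X G
  chainSumF-suc (suc B) X G (s≤s fuel) = cong (G [] +_) (∑-cong (allFin m) (λ Y →
    ⟦⟧-*-cong (chainStep X Y) (λ t → chainSumF-suc B Y (G ∘ (Y ∷_))
      (ℕP.≤-trans (ℕP.∸-monoʳ-< (<ᵇ-rank (T-∧-fst t)) (rank≤n Y)) fuel))))

  chainSumF-stable : ∀ B X G → suc (n ∸ rank X) ℕ.≤ B → chainSumF B X G ≡ chainSum X G
  chainSumF-stable (suc B) X G fuel with ℕP.m≤n⇒m<n∨m≡n fuel
  ... | inj₂ B≡   = cong (λ b → chainSumF b X G) (sym B≡)
  ... | inj₁ (s≤s fuel′) = trans (sym (chainSumF-suc B X G fuel′)) (chainSumF-stable B X G fuel′)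

  chainSum-unfold : ∀ X G →
    chainSum X G ≡ G [] + (∑[ Y ] ⟦ chainStep X Y ⟧ * chainSum Y (G ∘ (Y ∷_)))
  chainSum-unfold X G = cong (G [] +_) (∑-cong (allFin m) (λ Y →
    ⟦⟧-*-cong (chainStep X Y) (λ t → chainSumF-stable (n ∸ rank X) Y (G ∘ (Y ∷_))
      (ℕP.∸-monoʳ-< (<ᵇ-rank (T-∧-fst t)) (rank≤n Y)))))

  -- A walk up the poset

  -- In ascent W l and descent W l the walk has reached W by a step labelled l.
  mutual
    walk : Fin m → Word → Poly
    walk X v k = ⟦ X ≡ᶠ 𝟙 ⟧ * 1ᴺ v k
      + (∑[ W ] ⟦ X ⋖ᵇ W ⟧ * ((y^ 1 · descent W (lab X W) v) k + ascent W (lab X W) v k))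

    restart : Fin m → Word → Poly
    restart Y []      k = if Y ≡ᶠ 𝟙 then 1ᴺ [] k else 0ℤ
    restart Y (h ∷ v) k = if Y ≡ᶠ 𝟙 then 0ℤ else coef-b h * walk Y v k

    ascent : Fin m → ℕ → Word → Poly
    ascent W l []      k = restart W [] k
    ascent W l (h ∷ v) k = restart W (h ∷ v) k
      + coef-a-b h * (∑[ V ] ⟦ incrStep W l V ⟧ * ascent V (lab W V) v k)

    descent : Fin m → ℕ → Word → Poly
    descent W l []      k = restart W [] k
    descent W l (h ∷ v) k = restart W (h ∷ v) k
      + coef-a-b h * (∑[ V ] ⟦ W ⋖ᵇ V ⟧ *
          (⟦ lab W V ℕ.<ᵇ l ⟧ * (y^ 1 · descent V (lab W V) v) k + ascent V (lab W V) v k))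

  ∑-above-𝟙 : (c : Fin m → Bool) (f : Fin m → ℤ) → (∀ V → T (c V) → T (𝟙 ⋖ᵇ V)) →
    (∑[ V ] ⟦ c V ⟧ * f V) ≡ 0ℤ
  ∑-above-𝟙 c f c⇒⋖ = trans (∑-cong (allFin m) (λ V → ⟦⟧-*-vanish (c V)
                               (λ t → ⊥-elim (subst T (⋖ᵇ-from-𝟙 V) (c⇒⋖ V t)))))
                            (∑-zero (allFin m))

  walk-≢𝟙 : ∀ {W} → W ≢ 𝟙 → ∀ v k → walk W v k ≡
    (∑[ V ] ⟦ W ⋖ᵇ V ⟧ * ((y^ 1 · descent V (lab W V) v) k + ascent V (lab W V) v k))
  walk-≢𝟙 {W} W≢𝟙 v k = trans (cong (λ b → ⟦ b ⟧ * 1ᴺ v k + steps) (≡ᶠ-false W≢𝟙)) (ℤP.+-identityˡ steps)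
    where steps = (∑[ V ] ⟦ W ⋖ᵇ V ⟧ * ((y^ 1 · descent V (lab W V) v) k + ascent V (lab W V) v k))

  restart-≢𝟙 : ∀ {W} → W ≢ 𝟙 → ∀ h v k → restart W (h ∷ v) k ≡ coef-b h * walk W v k
  restart-≢𝟙 W≢𝟙 h v k rewrite ≡ᶠ-false W≢𝟙 = refl

  ascent-𝟙 : ∀ l h v k → ascent 𝟙 l (h ∷ v) k ≡ 0ℤ
  ascent-𝟙 l h v k rewrite ≡ᶠ-refl 𝟙 =
    trans (ℤP.+-identityˡ _)
          (trans (cong (coef-a-b h *_) (∑-above-𝟙 _ _ (λ V → T-∧-fst))) (ℤP.*-zeroʳ (coef-a-b h)))

  descent-𝟙 : ∀ l h v k → descent 𝟙 l (h ∷ v) k ≡ 0ℤ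
  descent-𝟙 l h v k rewrite ≡ᶠ-refl 𝟙 =
    trans (ℤP.+-identityˡ _)
          (trans (cong (coef-a-b h *_) (∑-above-𝟙 _ _ (λ V t → t))) (ℤP.*-zeroʳ (coef-a-b h)))

  0≤1ᴺ : ∀ v k → 0ℤ ℤ.≤ 1ᴺ v k
  0≤1ᴺ []      zero    = +≤+ z≤n
  0≤1ᴺ []      (suc k) = +≤+ z≤n
  0≤1ᴺ (_ ∷ _) k       = +≤+ z≤n

  0≤y^ : ∀ e {p : Poly} → (∀ i → 0ℤ ℤ.≤ p i) → ∀ k → 0ℤ ℤ.≤ (y^ e · p) k
  0≤y^ zero    0≤p k       = 0≤p k
  0≤y^ (suc e) 0≤p zero    = +≤+ z≤n
  0≤y^ (suc e) 0≤p (suc k) = 0≤y^ e 0≤p k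

  -- The signs of a − b are absorbed by the b-coefficient of the restart at the same element.
  mutual
    0≤walk : ∀ X v k → 0ℤ ℤ.≤ walk X v k
    0≤walk X v k = 0≤-+ (0≤-* (0≤⟦⟧ (X ≡ᶠ 𝟙)) (0≤1ᴺ v k)) (0≤-∑ (allFin m) _ (λ W →
      0≤-* (0≤⟦⟧ (X ⋖ᵇ W)) (0≤-+ (0≤y^ 1 (λ i → 0≤descent W (lab X W) v i) k) (0≤ascent W (lab X W) v k))))

    0≤restart : ∀ Y v k → 0ℤ ℤ.≤ restart Y v k
    0≤restart Y []      k = 0≤if (Y ≡ᶠ 𝟙) (0≤1ᴺ [] k) (+≤+ z≤n)
    0≤restart Y (h ∷ v) k = 0≤if (Y ≡ᶠ 𝟙) (+≤+ z≤n) (0≤-* (0≤coef-b h) (0≤walk Y v k))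

    0≤ascent : ∀ W l v k → 0ℤ ℤ.≤ ascent W l v k
    0≤ascent W l []      k = 0≤restart W [] k
    0≤ascent W l (h ∷ v) k = by-cases (W FinP.≟ 𝟙)
      where
      by-cases : Dec (W ≡ 𝟙) → 0ℤ ℤ.≤ ascent W l (h ∷ v) k
      by-cases (yes refl) = subst (0ℤ ℤ.≤_) (sym (ascent-𝟙 l h v k)) ℤP.≤-refl
      by-cases (no W≢𝟙)  = subst (0ℤ ℤ.≤_) (sym regroup) (0≤-∑ (allFin m) _ (λ V →
            0≤-* (0≤⟦⟧ (W ⋖ᵇ V)) (0≤-+ (0≤-* (0≤coef-b h) (0≤y^ 1 (λ i → 0≤descent V (lab W V) v i) k))
                                       (0≤-* (0≤coef-b+coef-a-b h (not (lab W V ℕ.<ᵇ l))) (0≤ascent V (lab W V) v k)))))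
        where
        regroup : ascent W l (h ∷ v) k ≡ (∑[ V ] ⟦ W ⋖ᵇ V ⟧ *
                    (coef-b h * (y^ 1 · descent V (lab W V) v) k
                     + (coef-b h + coef-a-b h * ⟦ not (lab W V ℕ.<ᵇ l) ⟧) * ascent V (lab W V) v k))
        regroup = begin
            restart W (h ∷ v) k + coef-a-b h * (∑[ V ] ⟦ incrStep W l V ⟧ * ascent V (lab W V) v k)
          ≡⟨ cong₂ _+_ (trans (restart-≢𝟙 W≢𝟙 h v k) (trans (cong (coef-b h *_) (walk-≢𝟙 W≢𝟙 v k))
                                                               (sym (∑-*ˡ (allFin m) (coef-b h)
                                                                       (λ V → ⟦ W ⋖ᵇ V ⟧ * (d V + a V))))))
                       (sym (∑-*ˡ (allFin m) (coef-a-b h) (λ V → ⟦ incrStep W l V ⟧ * a V))) ⟩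
            (∑[ V ] coef-b h * (⟦ W ⋖ᵇ V ⟧ * (d V + a V)))
              + (∑[ V ] coef-a-b h * (⟦ incrStep W l V ⟧ * a V))
          ≡⟨ sym (∑-distrib-+ (allFin m) _ _) ⟩
            (∑[ V ] coef-b h * (⟦ W ⋖ᵇ V ⟧ * (d V + a V))
                               + coef-a-b h * (⟦ incrStep W l V ⟧ * a V))
          ≡⟨ ∑-cong (allFin m) (λ V → trans
               (cong (λ t → coef-b h * (⟦ W ⋖ᵇ V ⟧ * (d V + a V)) + coef-a-b h * (t * a V)) (⟦∧⟧ (W ⋖ᵇ V) _))
               (solve 6 (λ b e c nl d a → b :* (c :* (d :+ a)) :+ e :* ((c :* nl) :* a)
                                          := c :* (b :* d :+ (b :+ e :* nl) :* a))
                  refl (coef-b h) (coef-a-b h) ⟦ W ⋖ᵇ V ⟧ ⟦ not (lab W V ℕ.<ᵇ l) ⟧ (d V) (a V))) ⟩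
            (∑[ V ] ⟦ W ⋖ᵇ V ⟧ * (coef-b h * d V + (coef-b h + coef-a-b h * ⟦ not (lab W V ℕ.<ᵇ l) ⟧) * a V))
          ∎
          where
          open ≡-Reasoning
          d a : Fin m → ℤ
          d V = (y^ 1 · descent V (lab W V) v) k
          a V = ascent V (lab W V) v k

    0≤descent : ∀ W l v k → 0ℤ ℤ.≤ descent W l v k
    0≤descent W l []      k = 0≤restart W [] k
    0≤descent W l (h ∷ v) k = by-cases (W FinP.≟ 𝟙)
      where
      by-cases : Dec (W ≡ 𝟙) → 0ℤ ℤ.≤ descent W l (h ∷ v) k
      by-cases (yes refl) = subst (0ℤ ℤ.≤_) (sym (descent-𝟙 l h v k)) ℤP.≤-refl
      by-cases (no W≢𝟙)  = subst (0ℤ ℤ.≤_) (sym regroup) (0≤-∑ (allFin m) _ (λ V →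
            0≤-* (0≤⟦⟧ (W ⋖ᵇ V)) (0≤-+ (0≤-* (0≤coef-b+coef-a-b h (lab W V ℕ.<ᵇ l))
                    (0≤y^ 1 (λ i → 0≤descent V (lab W V) v i) k))
                                       (0≤-* (0≤coef-b+coef-a-b h true) (0≤ascent V (lab W V) v k)))))
        where
        regroup : descent W l (h ∷ v) k ≡ (∑[ V ] ⟦ W ⋖ᵇ V ⟧ *
                    ((coef-b h + coef-a-b h * ⟦ lab W V ℕ.<ᵇ l ⟧) * (y^ 1 · descent V (lab W V) v) k
                     + (coef-b h + coef-a-b h * ⟦ true ⟧) * ascent V (lab W V) v k))
        regroup = begin
            restart W (h ∷ v) k + coef-a-b h * (∑[ V ] ⟦ W ⋖ᵇ V ⟧ * (⟦ lab W V ℕ.<ᵇ l ⟧ * d V + a V))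
          ≡⟨ cong₂ _+_ (trans (restart-≢𝟙 W≢𝟙 h v k) (trans (cong (coef-b h *_) (walk-≢𝟙 W≢𝟙 v k))
                                                               (sym (∑-*ˡ (allFin m) (coef-b h)
                                                                       (λ V → ⟦ W ⋖ᵇ V ⟧ * (d V + a V))))))
                       (sym (∑-*ˡ (allFin m) (coef-a-b h) (λ V → ⟦ W ⋖ᵇ V ⟧ * (⟦ lab W V ℕ.<ᵇ l ⟧ * d V + a V)))) ⟩
            (∑[ V ] coef-b h * (⟦ W ⋖ᵇ V ⟧ * (d V + a V)))
              + (∑[ V ] coef-a-b h * (⟦ W ⋖ᵇ V ⟧ * (⟦ lab W V ℕ.<ᵇ l ⟧ * d V + a V)))
          ≡⟨ sym (∑-distrib-+ (allFin m) _ _) ⟩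
            (∑[ V ] coef-b h * (⟦ W ⋖ᵇ V ⟧ * (d V + a V))
                               + coef-a-b h * (⟦ W ⋖ᵇ V ⟧ * (⟦ lab W V ℕ.<ᵇ l ⟧ * d V + a V)))
          ≡⟨ ∑-cong (allFin m) (λ V →
               solve 6 (λ b e c lt d a → b :* (c :* (d :+ a)) :+ e :* (c :* (lt :* d :+ a))
                                         := c :* ((b :+ e :* lt) :* d :+ (b :+ e :* con 1ℤ) :* a))
                 refl (coef-b h) (coef-a-b h) ⟦ W ⋖ᵇ V ⟧ ⟦ lab W V ℕ.<ᵇ l ⟧ (d V) (a V)) ⟩
            (∑[ V ] ⟦ W ⋖ᵇ V ⟧ * ((coef-b h + coef-a-b h * ⟦ lab W V ℕ.<ᵇ l ⟧) * d V + (coef-b h + coef-a-b h * 1ℤ) * a V))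
          ∎
          where
          open ≡-Reasoning
          d a : Fin m → ℤ
          d V = (y^ 1 · descent V (lab W V) v) k
          a V = ascent V (lab W V) v k

  climb : ℕ → ℕ → Fin m → Word → Poly
  climb j e Y v k = (⟨a-b⟩^ j · (λ u → (y^ e · restart Y u) k)) v

  climb-y : ∀ j e Y v k → climb j (suc e) Y v k ≡ (y^ 1 · climb j e Y v) k
  climb-y j e Y v k =
    trans (⟨a-b⟩^-cong j (λ u → y^-suc e (restart Y u) k) v)
          (⟨a-b⟩^-y^ j 1 (λ u → y^ e · restart Y u) v k)

  ∑-climb-⋖ᵇ : ∀ {W V} → T (W ⋖ᵇ V) → (g : Fin m → ℤ) → (∀ Y → ¬ V ≤ Y → g Y ≡ 0ℤ) → ∀ e v k →
    (∑[ Y ] g Y * climb (rank Y ∸ rank W) e Y v k)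
    ≡ (∑[ Y ] g Y * climb (suc (rank Y ∸ rank V)) e Y v k)
  ∑-climb-⋖ᵇ {W} {V} t g g-vanish e v k = ∑-cong (allFin m) λ Y → by-cases Y (V ≤? Y)
    where
    by-cases : ∀ Y → Dec (V ≤ Y) → g Y * climb (rank Y ∸ rank W) e Y v k ≡ g Y * climb (suc (rank Y ∸ rank V)) e Y v k
    by-cases Y (yes V≤Y) = cong (λ j → g Y * climb j e Y v k) (⋖ᵇ-rank∸ t V≤Y)
    by-cases Y (no V≰Y)  = trans (cong (_* climb (rank Y ∸ rank W) e Y v k) (g-vanish Y V≰Y))
                                 (sym (cong (_* climb (suc (rank Y ∸ rank V)) e Y v k) (g-vanish Y V≰Y)))

  ∑-incrChains-climb-[] : ∀ {W V} → T (W ⋖ᵇ V) → ∀ l k →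
    (∑[ Y ] incrChains V Y l * climb (rank Y ∸ rank W) 0 Y [] k) ≡ 0ℤ
  ∑-incrChains-climb-[] t l k =
    trans (∑-climb-⋖ᵇ t (λ Y → incrChains _ Y l) (λ Y → incrChains-≰ l) 0 [] k)
          (trans (∑-cong (allFin m) (λ Y → ℤP.*-zeroʳ (incrChains _ Y l))) (∑-zero (allFin m)))

  ∑-incrChains-climb-∷ : ∀ {W V} → T (W ⋖ᵇ V) → ∀ l h v k →
    (∑[ Y ] incrChains V Y l * climb (rank Y ∸ rank W) 0 Y (h ∷ v) k)
    ≡ coef-a-b h * (∑[ Y ] incrChains V Y l * climb (rank Y ∸ rank V) 0 Y v k)
  ∑-incrChains-climb-∷ {V = V} t l h v k =
    trans (∑-climb-⋖ᵇ t (λ Y → incrChains V Y l) (λ Y → incrChains-≰ l) 0 (h ∷ v) k)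
          (trans (∑-cong (allFin m) (λ Y → solve 3 (λ i e x → i :* (e :* x) := e :* (i :* x)) refl
                                                 (incrChains V Y l) (coef-a-b h) (climb (rank Y ∸ rank V) 0 Y v k)))
                 (∑-*ˡ (allFin m) (coef-a-b h) (λ Y → incrChains V Y l * climb (rank Y ∸ rank V) 0 Y v k)))

  ascent-unfold : ∀ v W l k → ascent W l v k ≡ (∑[ Y ] incrChains W Y l * climb (rank Y ∸ rank W) 0 Y v k)
  ascent-unfold v W l k = sym (begin
      (∑[ Y ] incrChains W Y l * A Y)
    ≡⟨ ∑-cong (allFin m) (λ Y → cong (_* A Y) (incrChains-rec W Y l)) ⟩
      (∑[ Y ] (⟦ W ≡ᶠ Y ⟧ + (∑[ V ] c V * incrChains V Y (lab W V))) * A Y)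
    ≡⟨ ∑-δ+∑ W c (λ V Y → incrChains V Y (lab W V)) A ⟩
      A W + (∑[ V ] c V * (∑[ Y ] incrChains V Y (lab W V) * A Y))
    ≡⟨ cong (_+ (∑[ V ] c V * (∑[ Y ] incrChains V Y (lab W V) * A Y)))
            (cong (λ j → climb j 0 W v k) (ℕP.n∸n≡0 (rank W))) ⟩
      restart W v k + (∑[ V ] c V * (∑[ Y ] incrChains V Y (lab W V) * A Y))
    ≡⟨ next-letter v ⟩
      ascent W l v k
    ∎)
    where
    open ≡-Reasoning
    A : Fin m → ℤ
    A Y = climb (rank Y ∸ rank W) 0 Y v k
    c : Fin m → ℤ
    c V = ⟦ incrStep W l V ⟧
    next-letter : ∀ v → restart W v k + (∑[ V ] c V * (∑[ Y ] incrChains V Y (lab W V) * climb (rank Y ∸ rank W) 0 Y v k))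
                        ≡ ascent W l v k
    next-letter [] = trans (cong (restart W [] k +_) (trans (∑-cong (allFin m) (λ V →
                       ⟦⟧-*-vanish (incrStep W l V) (λ t → ∑-incrChains-climb-[] (T-∧-fst t) (lab W V) k)))
                       (∑-zero (allFin m))))
                     (ℤP.+-identityʳ _)
    next-letter (h ∷ v) = cong (restart W (h ∷ v) k +_) (begin
        (∑[ V ] c V * (∑[ Y ] incrChains V Y (lab W V) * climb (rank Y ∸ rank W) 0 Y (h ∷ v) k))
      ≡⟨ ∑-cong (allFin m) (λ V → ⟦⟧-*-cong (incrStep W l V) (λ t →
           trans (∑-incrChains-climb-∷ (T-∧-fst t) (lab W V) h v k)
                 (cong (coef-a-b h *_) (sym (ascent-unfold v V (lab W V) k))))) ⟩
        (∑[ V ] c V * (coef-a-b h * ascent V (lab W V) v k))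
      ≡⟨ trans (∑-cong (allFin m) (λ V → solve 3 (λ c e x → c :* (e :* x) := e :* (c :* x)) refl
                                            (c V) (coef-a-b h) (ascent V (lab W V) v k)))
               (∑-*ˡ (allFin m) (coef-a-b h) (λ V → c V * ascent V (lab W V) v k)) ⟩
        coef-a-b h * (∑[ V ] c V * ascent V (lab W V) v k)
      ∎)

  -- walks from W that descend to Z and then ascend to some Y ≥ Z
  turnAt : Fin m → Fin m → Word → Poly
  turnAt W Z v k = (∑[ Y ] ⟦ Z ≤ᵇ Y ⟧ * climb (rank Y ∸ rank W) (rank Z ∸ rank W) Y v k)

  turnAt-⋖ᵇ : ∀ {W V Z} → T (W ⋖ᵇ V) → V ≤ Z → ∀ v k →
    turnAt W Z v k ≡ (∑[ Y ] ⟦ Z ≤ᵇ Y ⟧ * climb (suc (rank Y ∸ rank V)) (suc (rank Z ∸ rank V)) Y v k)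
  turnAt-⋖ᵇ {W} {V} {Z} t V≤Z v k =
    trans (cong (λ e → (∑[ Y ] ⟦ Z ≤ᵇ Y ⟧ * climb (rank Y ∸ rank W) e Y v k)) (⋖ᵇ-rank∸ t V≤Z))
          (∑-climb-⋖ᵇ t (λ Y → ⟦ Z ≤ᵇ Y ⟧) (λ Y V≰Y → cong ⟦_⟧ (≤ᵇ-false (λ Z≤Y → V≰Y (PO.trans V≤Z Z≤Y))))
                      (suc (rank Z ∸ rank V)) v k)

  turnAt-⋖ᵇ-[] : ∀ {W V Z} → T (W ⋖ᵇ V) → V ≤ Z → ∀ k → turnAt W Z [] k ≡ 0ℤ
  turnAt-⋖ᵇ-[] {Z = Z} t V≤Z k =
    trans (turnAt-⋖ᵇ t V≤Z [] k) (trans (∑-cong (allFin m) (λ Y → ℤP.*-zeroʳ ⟦ Z ≤ᵇ Y ⟧)) (∑-zero (allFin m)))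

  turnAt-⋖ᵇ-∷ : ∀ {W V Z} → T (W ⋖ᵇ V) → V ≤ Z → ∀ h v k →
    turnAt W Z (h ∷ v) k ≡ coef-a-b h * (y^ 1 · turnAt V Z v) k
  turnAt-⋖ᵇ-∷ {W} {V} {Z} t V≤Z h v k = begin
      turnAt W Z (h ∷ v) k
    ≡⟨ turnAt-⋖ᵇ t V≤Z (h ∷ v) k ⟩
      (∑[ Y ] ⟦ Z ≤ᵇ Y ⟧ * (coef-a-b h * climb (rank Y ∸ rank V) (suc (rank Z ∸ rank V)) Y v k))
    ≡⟨ ∑-cong (allFin m) (λ Y → trans
          (cong (λ x → ⟦ Z ≤ᵇ Y ⟧ * (coef-a-b h * x)) (climb-y (rank Y ∸ rank V) (rank Z ∸ rank V) Y v k))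
         (solve 3 (λ c e x → c :* (e :* x) := e :* (c :* x)) refl ⟦ Z ≤ᵇ Y ⟧ (coef-a-b h) (y-climb Y))) ⟩
      (∑[ Y ] coef-a-b h * (⟦ Z ≤ᵇ Y ⟧ * y-climb Y))
    ≡⟨ ∑-*ˡ (allFin m) (coef-a-b h) (λ Y → ⟦ Z ≤ᵇ Y ⟧ * y-climb Y) ⟩
      coef-a-b h * (∑[ Y ] ⟦ Z ≤ᵇ Y ⟧ * y-climb Y)
    ≡⟨ cong (coef-a-b h *_) (sym (y^-∑ (allFin m) (λ Y → ⟦ Z ≤ᵇ Y ⟧)
            (λ Y → climb (rank Y ∸ rank V) (rank Z ∸ rank V) Y v) k)) ⟩
      coef-a-b h * (y^ 1 · turnAt V Z v) k
    ∎
    where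
    open ≡-Reasoning
    y-climb : Fin m → ℤ
    y-climb Y = (y^ 1 · climb (rank Y ∸ rank V) (rank Z ∸ rank V) Y v) k

  turnAt-self : ∀ W v k → turnAt W W v k ≡ ascent W 0 v k
  turnAt-self W v k = begin
      (∑[ Y ] ⟦ W ≤ᵇ Y ⟧ * climb (rank Y ∸ rank W) (rank W ∸ rank W) Y v k)
    ≡⟨ ∑-cong (allFin m) (λ Y → cong₂ (λ x e → x * climb (rank Y ∸ rank W) e Y v k)
                                        (sym (incrChains-unique W Y)) (ℕP.n∸n≡0 (rank W))) ⟩
      (∑[ Y ] incrChains W Y 0 * climb (rank Y ∸ rank W) 0 Y v k)
    ≡⟨ sym (ascent-unfold v W 0 k) ⟩
      ascent W 0 v k
    ∎
    where open ≡-Reasoning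

  ∑-decrChainsBelow-turnAt-[] : ∀ {W V} → T (W ⋖ᵇ V) → ∀ l k →
    (∑[ Z ] decrChainsBelow V Z l * turnAt W Z [] k) ≡ 0ℤ
  ∑-decrChainsBelow-turnAt-[] {W} {V} t l k = trans (∑-cong (allFin m) (λ Z → by-cases Z (V ≤? Z))) (∑-zero (allFin m))
    where
    by-cases : ∀ Z → Dec (V ≤ Z) → decrChainsBelow V Z l * turnAt W Z [] k ≡ 0ℤ
    by-cases Z (yes V≤Z) = trans (cong (decrChainsBelow V Z l *_) (turnAt-⋖ᵇ-[] t V≤Z k))
        (ℤP.*-zeroʳ (decrChainsBelow V Z l))
    by-cases Z (no V≰Z)  = cong (_* turnAt W Z [] k) (decrChainsBelowF-≰ (n ∸ rank V) l V≰Z)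

  ∑-decrChainsBelow-turnAt-∷ : ∀ {W V} → T (W ⋖ᵇ V) → ∀ l h v k →
    (∑[ Z ] decrChainsBelow V Z l * turnAt W Z (h ∷ v) k)
    ≡ coef-a-b h * (y^ 1 · (λ i → ∑[ Z ] decrChainsBelow V Z l * turnAt V Z v i)) k
  ∑-decrChainsBelow-turnAt-∷ {W} {V} t l h v k = begin
      (∑[ Z ] decrChainsBelow V Z l * turnAt W Z (h ∷ v) k)
    ≡⟨ ∑-cong (allFin m) (λ Z → by-cases Z (V ≤? Z)) ⟩
      (∑[ Z ] coef-a-b h * (decrChainsBelow V Z l * (y^ 1 · turnAt V Z v) k))
    ≡⟨ ∑-*ˡ (allFin m) (coef-a-b h) (λ Z → decrChainsBelow V Z l * (y^ 1 · turnAt V Z v) k) ⟩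
      coef-a-b h * (∑[ Z ] decrChainsBelow V Z l * (y^ 1 · turnAt V Z v) k)
    ≡⟨ cong (coef-a-b h *_) (sym (y^-∑ (allFin m) (λ Z → decrChainsBelow V Z l) (λ Z → turnAt V Z v) k)) ⟩
      coef-a-b h * (y^ 1 · (λ i → ∑[ Z ] decrChainsBelow V Z l * turnAt V Z v i)) k
    ∎
    where
    open ≡-Reasoning
    by-cases : ∀ Z → Dec (V ≤ Z) → decrChainsBelow V Z l * turnAt W Z (h ∷ v) k
                                     ≡ coef-a-b h * (decrChainsBelow V Z l * (y^ 1 · turnAt V Z v) k)
    by-cases Z (yes V≤Z) =
      trans (cong (decrChainsBelow V Z l *_) (turnAt-⋖ᵇ-∷ t V≤Z h v k))
            (solve 3 (λ d e x → d :* (e :* x) := e :* (d :* x)) refl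
               (decrChainsBelow V Z l) (coef-a-b h) ((y^ 1 · turnAt V Z v) k))
    by-cases Z (no V≰Z) rewrite decrChainsBelowF-≰ (n ∸ rank V) l V≰Z = sym (ℤP.*-zeroʳ (coef-a-b h))

  descent-∷ : ∀ W l h v k → descent W l (h ∷ v) k ≡
    ascent W 0 (h ∷ v) k + (∑[ V ] ⟦ decrStep W l V ⟧ * (coef-a-b h * (y^ 1 · descent V (lab W V) v) k))
  descent-∷ W l h v k = sym (begin
      (restart W (h ∷ v) k + coef-a-b h * (∑[ V ] ⟦ incrStep W 0 V ⟧ * a V)) + (∑[ V ] c V * (coef-a-b h * d V))
    ≡⟨ ℤP.+-assoc (restart W (h ∷ v) k) _ _ ⟩
      restart W (h ∷ v) k + (coef-a-b h * (∑[ V ] ⟦ incrStep W 0 V ⟧ * a V) + (∑[ V ] c V * (coef-a-b h * d V)))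
    ≡⟨ cong (restart W (h ∷ v) k +_) (begin
         coef-a-b h * (∑[ V ] ⟦ incrStep W 0 V ⟧ * a V) + (∑[ V ] c V * (coef-a-b h * d V))
       ≡⟨ cong (_+ (∑[ V ] c V * (coef-a-b h * d V))) (sym (∑-*ˡ (allFin m) (coef-a-b h) _)) ⟩
         (∑[ V ] coef-a-b h * (⟦ incrStep W 0 V ⟧ * a V)) + (∑[ V ] c V * (coef-a-b h * d V))
       ≡⟨ sym (∑-distrib-+ (allFin m) _ _) ⟩
         (∑[ V ] coef-a-b h * (⟦ incrStep W 0 V ⟧ * a V) + c V * (coef-a-b h * d V))
       ≡⟨ ∑-cong (allFin m) (λ V → trans
            (cong₂ (λ x y → coef-a-b h * (x * a V) + y * (coef-a-b h * d V))
                   (cong ⟦_⟧ (BoolP.∧-identityʳ (W ⋖ᵇ V))) (⟦∧⟧ (W ⋖ᵇ V) (lab W V ℕ.<ᵇ l)))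
            (solve 5 (λ e w lt a d → e :* (w :* a) :+ (w :* lt) :* (e :* d) := e :* (w :* (lt :* d :+ a)))
               refl (coef-a-b h) ⟦ W ⋖ᵇ V ⟧ ⟦ lab W V ℕ.<ᵇ l ⟧ (a V) (d V))) ⟩
         (∑[ V ] coef-a-b h * (⟦ W ⋖ᵇ V ⟧ * (⟦ lab W V ℕ.<ᵇ l ⟧ * d V + a V)))
       ≡⟨ ∑-*ˡ (allFin m) (coef-a-b h) _ ⟩
         coef-a-b h * (∑[ V ] ⟦ W ⋖ᵇ V ⟧ * (⟦ lab W V ℕ.<ᵇ l ⟧ * d V + a V))
       ∎) ⟩
      descent W l (h ∷ v) k
    ∎)
    where
    open ≡-Reasoning
    c d a : Fin m → ℤ
    c V = ⟦ decrStep W l V ⟧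
    d V = (y^ 1 · descent V (lab W V) v) k
    a V = ascent V (lab W V) v k

  descent-unfold : ∀ v W l k → descent W l v k ≡ (∑[ Z ] decrChainsBelow W Z l * turnAt W Z v k)
  descent-unfold v W l k = sym (begin
      (∑[ Z ] decrChainsBelow W Z l * turnAt W Z v k)
    ≡⟨ ∑-cong (allFin m) (λ Z → cong (_* turnAt W Z v k) (decrChainsBelow-unfold W Z l)) ⟩
      (∑[ Z ] (⟦ W ≡ᶠ Z ⟧ + (∑[ V ] c V * decrChainsBelow V Z (lab W V))) * turnAt W Z v k)
    ≡⟨ ∑-δ+∑ W c (λ V Z → decrChainsBelow V Z (lab W V)) (λ Z → turnAt W Z v k) ⟩
      turnAt W W v k + (∑[ V ] c V * (∑[ Z ] decrChainsBelow V Z (lab W V) * turnAt W Z v k))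
    ≡⟨ cong (_+ (∑[ V ] c V * (∑[ Z ] decrChainsBelow V Z (lab W V) * turnAt W Z v k))) (turnAt-self W v k) ⟩
      ascent W 0 v k + (∑[ V ] c V * (∑[ Z ] decrChainsBelow V Z (lab W V) * turnAt W Z v k))
    ≡⟨ next-letter v ⟩
      descent W l v k
    ∎)
    where
    open ≡-Reasoning
    c : Fin m → ℤ
    c V = ⟦ decrStep W l V ⟧
    next-letter : ∀ v → ascent W 0 v k + (∑[ V ] c V * (∑[ Z ] decrChainsBelow V Z (lab W V) * turnAt W Z v k))
                        ≡ descent W l v k
    next-letter [] = trans (cong (restart W [] k +_) (trans (∑-cong (allFin m) (λ V →
                       ⟦⟧-*-vanish (decrStep W l V) (λ t → ∑-decrChainsBelow-turnAt-[] (T-∧-fst t) (lab W V) k)))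
                       (∑-zero (allFin m))))
                     (ℤP.+-identityʳ _)
    next-letter (h ∷ v) = trans (cong (ascent W 0 (h ∷ v) k +_) (∑-cong (allFin m) (λ V →
                            ⟦⟧-*-cong (decrStep W l V) (λ t →
                              trans (∑-decrChainsBelow-turnAt-∷ (T-∧-fst t) (lab W V) h v k)
                                    (cong (coef-a-b h *_) (y^-cong 1 (λ i → sym (descent-unfold v V (lab W V) i)) k))))))
                          (sym (descent-∷ W l h v k))

  ∑-first-steps : ∀ X Y → (∑[ W ] ⟦ X ⋖ᵇ W ⟧ * incrChains W Y (lab X W)) ≡ ⟦ X <ᵇ Y ⟧
  ∑-first-steps X Y = begin
      steps
    ≡⟨ solve 2 (λ s e → s := (e :+ s) :+ (:- e)) refl steps ⟦ X ≡ᶠ Y ⟧ ⟩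
      (⟦ X ≡ᶠ Y ⟧ + steps) + - ⟦ X ≡ᶠ Y ⟧
    ≡⟨ cong (_+ - ⟦ X ≡ᶠ Y ⟧) (begin
         ⟦ X ≡ᶠ Y ⟧ + steps
       ≡⟨ cong (⟦ X ≡ᶠ Y ⟧ +_) (∑-cong (allFin m) (λ W →
            cong (λ b → ⟦ b ⟧ * incrChains W Y (lab X W)) (sym (BoolP.∧-identityʳ (X ⋖ᵇ W))))) ⟩
         ⟦ X ≡ᶠ Y ⟧ + (∑[ W ] ⟦ incrStep X 0 W ⟧ * incrChains W Y (lab X W))
       ≡⟨ sym (incrChains-rec X Y 0) ⟩
         incrChains X Y 0
       ≡⟨ trans (incrChains-unique X Y) (≤ᵇ-split X Y) ⟩
         ⟦ X <ᵇ Y ⟧ + ⟦ X ≡ᶠ Y ⟧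
       ∎) ⟩
      (⟦ X <ᵇ Y ⟧ + ⟦ X ≡ᶠ Y ⟧) + - ⟦ X ≡ᶠ Y ⟧
    ≡⟨ solve 2 (λ a e → (a :+ e) :+ (:- e) := a) refl ⟦ X <ᵇ Y ⟧ ⟦ X ≡ᶠ Y ⟧ ⟩
      ⟦ X <ᵇ Y ⟧
    ∎
    where
    open ≡-Reasoning
    steps = (∑[ W ] ⟦ X ⋖ᵇ W ⟧ * incrChains W Y (lab X W))

  climbVia : Fin m → Fin m → Fin m → Word → Poly
  climbVia X Z Y = climb (rank Y ∸ suc (rank X)) (rank Z ∸ rank X) Y

  -- walks from X whose descending run ends at Z, restarting at Y
  walkViaTo : Fin m → Fin m → Fin m → Word → Poly
  walkViaTo X Z Y v k = ⟦ (Z ≤ᵇ Y) ∧ not (X ≡ᶠ Y) ⟧ * climbVia X Z Y v k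

  walkVia : Fin m → Fin m → Word → Poly
  walkVia X Z v k = (∑[ Y ] walkViaTo X Z Y v k)

  walkVia-self : ∀ X v k → walkVia X X v k ≡ (∑[ W ] ⟦ X ⋖ᵇ W ⟧ * ascent W (lab X W) v k)
  walkVia-self X v k = begin
      (∑[ Y ] ⟦ X <ᵇ Y ⟧ * climb (rank Y ∸ suc (rank X)) (rank X ∸ rank X) Y v k)
    ≡⟨ ∑-cong (allFin m) (λ Y → cong₂ (λ x e → x * climb (rank Y ∸ suc (rank X)) e Y v k)
                                        (sym (∑-first-steps X Y)) (ℕP.n∸n≡0 (rank X))) ⟩
      (∑[ Y ] (∑[ W ] ⟦ X ⋖ᵇ W ⟧ * incrChains W Y (lab X W)) * climb (rank Y ∸ suc (rank X)) 0 Y v k)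
    ≡⟨ ∑-∑-* (allFin m) (allFin m) (λ W → ⟦ X ⋖ᵇ W ⟧) (λ W Y → incrChains W Y (lab X W))
              (λ Y → climb (rank Y ∸ suc (rank X)) 0 Y v k) ⟩
      (∑[ W ] ⟦ X ⋖ᵇ W ⟧ * (∑[ Y ] incrChains W Y (lab X W) * climb (rank Y ∸ suc (rank X)) 0 Y v k))
    ≡⟨ ∑-cong (allFin m) (λ W → ⟦⟧-*-cong (X ⋖ᵇ W) (λ t →
         trans (∑-cong (allFin m) (λ Y → cong (λ r → incrChains W Y (lab X W) * climb (rank Y ∸ r) 0 Y v k)
                                              (sym (⋖ᵇ⇒rank t))))
               (sym (ascent-unfold v W (lab X W) k)))) ⟩
      (∑[ W ] ⟦ X ⋖ᵇ W ⟧ * ascent W (lab X W) v k)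
    ∎
    where open ≡-Reasoning

  walkVia-⋖ᵇ : ∀ {X W Z} → T (X ⋖ᵇ W) → W ≤ Z → ∀ v k → (y^ 1 · turnAt W Z v) k ≡ walkVia X Z v k
  walkVia-⋖ᵇ {X} {W} {Z} t W≤Z v k =
    trans (y^-∑ (allFin m) (λ Y → ⟦ Z ≤ᵇ Y ⟧) (λ Y → climb (rank Y ∸ rank W) (rank Z ∸ rank W) Y v) k)
          (∑-cong (allFin m) summand)
    where
    summand : ∀ Y → ⟦ Z ≤ᵇ Y ⟧ * (y^ 1 · climb (rank Y ∸ rank W) (rank Z ∸ rank W) Y v) k
                    ≡ ⟦ (Z ≤ᵇ Y) ∧ not (X ≡ᶠ Y) ⟧ * climb (rank Y ∸ suc (rank X)) (rank Z ∸ rank X) Y v k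
    summand Y with Z ≤? Y
    ... | no _    = refl
    ... | yes Z≤Y rewrite ≡ᶠ-false {X} {Y} (λ { refl → ⋖ᵇ⇒≢ t (PO.antisym (⋖ᵇ⇒≤ t) (PO.trans W≤Z Z≤Y)) }) =
      cong (1ℤ *_) (trans (sym (climb-y (rank Y ∸ rank W) (rank Z ∸ rank W) Y v k))
                          (cong₂ (λ r e → climb (rank Y ∸ r) e Y v k) (⋖ᵇ⇒rank t) (sym (⋖ᵇ-rank∸ t W≤Z))))

  walk-unfold : ∀ X v k → walk X v k ≡ ⟦ X ≡ᶠ 𝟙 ⟧ * 1ᴺ v k + (∑[ Z ] decrChains X Z * walkVia X Z v k)
  walk-unfold X v k = cong (⟦ X ≡ᶠ 𝟙 ⟧ * 1ᴺ v k +_) (sym (begin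
      (∑[ Z ] decrChains X Z * walkVia X Z v k)
    ≡⟨ ∑-δ+∑ X (λ W → ⟦ X ⋖ᵇ W ⟧) (λ W Z → decrChainsBelow W Z (lab X W)) (λ Z → walkVia X Z v k) ⟩
      walkVia X X v k + (∑[ W ] ⟦ X ⋖ᵇ W ⟧ * (∑[ Z ] decrChainsBelow W Z (lab X W) * walkVia X Z v k))
    ≡⟨ cong₂ _+_ (walkVia-self X v k) (∑-cong (allFin m) (λ W → ⟦⟧-*-cong (X ⋖ᵇ W) (descents W))) ⟩
      (∑[ W ] ⟦ X ⋖ᵇ W ⟧ * a W) + (∑[ W ] ⟦ X ⋖ᵇ W ⟧ * d W)
    ≡⟨ sym (∑-distrib-+ (allFin m) _ _) ⟩
      (∑[ W ] ⟦ X ⋖ᵇ W ⟧ * a W + ⟦ X ⋖ᵇ W ⟧ * d W)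
    ≡⟨ ∑-cong (allFin m) (λ W → solve 3 (λ c a d → c :* a :+ c :* d := c :* (d :+ a)) refl ⟦ X ⋖ᵇ W ⟧ (a W) (d W)) ⟩
      (∑[ W ] ⟦ X ⋖ᵇ W ⟧ * (d W + a W))
    ∎))
    where
    open ≡-Reasoning
    d a : Fin m → ℤ
    d W = (y^ 1 · descent W (lab X W) v) k
    a W = ascent W (lab X W) v k
    descents : ∀ W → T (X ⋖ᵇ W) → (∑[ Z ] decrChainsBelow W Z (lab X W) * walkVia X Z v k) ≡ d W
    descents W t = begin
        (∑[ Z ] decrChainsBelow W Z (lab X W) * walkVia X Z v k)
      ≡⟨ ∑-cong (allFin m) (λ Z → by-cases Z (W ≤? Z)) ⟩
        (∑[ Z ] decrChainsBelow W Z (lab X W) * (y^ 1 · turnAt W Z v) k)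
      ≡⟨ sym (y^-∑ (allFin m) (λ Z → decrChainsBelow W Z (lab X W)) (λ Z → turnAt W Z v) k) ⟩
        (y^ 1 · (λ i → (∑[ Z ] decrChainsBelow W Z (lab X W) * turnAt W Z v i))) k
      ≡⟨ y^-cong 1 (λ i → sym (descent-unfold v W (lab X W) i)) k ⟩
        d W
      ∎
      where
      by-cases : ∀ Z → Dec (W ≤ Z) → decrChainsBelow W Z (lab X W) * walkVia X Z v k
                                       ≡ decrChainsBelow W Z (lab X W) * (y^ 1 · turnAt W Z v) k
      by-cases Z (yes W≤Z) = cong (decrChainsBelow W Z (lab X W) *_) (sym (walkVia-⋖ᵇ t W≤Z v k))
      by-cases Z (no W≰Z)  = trans (cong (_* walkVia X Z v k) (decrChainsBelowF-≰ (n ∸ rank W) (lab X W) W≰Z))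
                                   (sym (cong (_* (y^ 1 · turnAt W Z v) k) (decrChainsBelowF-≰ (n ∸ rank W) (lab X W) W≰Z)))

  inRank-above : ∀ i C → All (λ Z → i ℕ.< rank Z) C → inRank i C ≡ false
  inRank-above i []      []          = refl
  inRank-above i (Z ∷ C) (i<rZ ∷ rs) =
    cong₂ _∨_ (¬T⇒false (λ t → ℕP.<-irrefl (sym (ℕP.≡ᵇ⇒≡ _ _ t)) i<rZ)) (inRank-above i C rs)

  wtCoef-above : ∀ t Y C v → rank Y ℕ.< t → wtCoef t (Y ∷ C) v ≡ wtCoef t C v
  wtCoef-above t Y C []      rY<t = refl
  wtCoef-above t Y C (h ∷ v) rY<t =
    cong₂ (λ b x → ⟦ t ℕ.<ᵇ n ⟧ * (letterCoef b h * x))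
          (cong (_∨ inRank t C) (¬T⇒false (λ e → ℕP.<-irrefl (ℕP.≡ᵇ⇒≡ _ _ e) rY<t)))
          (wtCoef-above (suc t) Y C v (ℕP.m<n⇒m<1+n rY<t))

  wtCoef-[] : ∀ s v → wtCoef s [] v ≡ (⟨a-b⟩^ (n ∸ s) · (λ u → 1ᴺ u 0)) v
  wtCoef-[] s v with n ℕP.≤? s
  wtCoef-[] s []      | yes n≤s rewrite T⇒true (ℕP.≤⇒≤ᵇ n≤s) | ℕP.m≤n⇒m∸n≡0 n≤s = refl
  wtCoef-[] s (h ∷ v) | yes n≤s rewrite ¬T⇒false (λ t → ℕP.<⇒≱ (ℕP.<ᵇ⇒< s n t) n≤s) | ℕP.m≤n⇒m∸n≡0 n≤s = refl
  wtCoef-[] s []      | no  n≰s rewrite ¬T⇒false (λ t → n≰s (ℕP.≤ᵇ⇒≤ n s t)) | ∸-suc n s (ℕP.≰⇒> n≰s) = refl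
  wtCoef-[] s (h ∷ v) | no  n≰s rewrite T⇒true (ℕP.<⇒<ᵇ (ℕP.≰⇒> n≰s)) | ∸-suc n s (ℕP.≰⇒> n≰s) =
    trans (ℤP.*-identityˡ _) (cong (coef-a-b h *_) (wtCoef-[] (suc s) v))

  wtCoef-∷ : ∀ s Y C v → s ℕ.≤ rank Y → rank Y ℕ.< n → All (λ Z → rank Y ℕ.< rank Z) C →
    wtCoef s (Y ∷ C) v ≡ (⟨a-b⟩^ (rank Y ∸ s) · headCoef coef-b (wtCoef (suc (rank Y)) C)) v
  wtCoef-∷ s Y C v s≤rY rY<n above with ℕP.m≤n⇒m<n∨m≡n s≤rY
  wtCoef-∷ s Y C []      s≤rY rY<n above | inj₁ s<rY
    rewrite ¬T⇒false (λ t → ℕP.<⇒≱ (ℕP.<-trans s<rY rY<n) (ℕP.≤ᵇ⇒≤ n s t)) | ∸-suc (rank Y) s s<rY = refl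
  wtCoef-∷ s Y C (h ∷ v) s≤rY rY<n above | inj₁ s<rY
    rewrite T⇒true (ℕP.<⇒<ᵇ (ℕP.<-trans s<rY rY<n)) | ∸-suc (rank Y) s s<rY
          | inRank-above s (Y ∷ C) (s<rY ∷ All-map (ℕP.<-trans s<rY) above) =
    trans (ℤP.*-identityˡ _) (cong (coef-a-b h *_) (wtCoef-∷ (suc s) Y C v s<rY rY<n above))
  wtCoef-∷ s Y C []      s≤rY rY<n above | inj₂ refl
    rewrite ¬T⇒false (λ t → ℕP.<⇒≱ rY<n (ℕP.≤ᵇ⇒≤ n (rank Y) t)) | ℕP.n∸n≡0 (rank Y) = refl
  wtCoef-∷ s Y C (h ∷ v) s≤rY rY<n above | inj₂ refl
    rewrite T⇒true (ℕP.<⇒<ᵇ rY<n) | ℕP.n∸n≡0 (rank Y) | T⇒true (ℕP.≡⇒≡ᵇ (rank Y) (rank Y) refl) =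
    trans (ℤP.*-identityˡ _) (cong (coef-b h *_) (wtCoef-above (suc (rank Y)) Y C v (ℕP.n<1+n (rank Y))))

  -- Chain sums equal walks

  chainTerm : Fin m → Word → ℕ → List (Fin m) → ℤ
  chainTerm X v k C = PoinC (X ∷ C) k * wtCoef (suc (rank X)) C v

  restart-𝟙 : ∀ u k → restart 𝟙 u k ≡ 1ᴺ u k
  restart-𝟙 []      k rewrite ≡ᶠ-refl 𝟙 = refl
  restart-𝟙 (h ∷ u) k rewrite ≡ᶠ-refl 𝟙 = refl

  y^-1ᴺ : ∀ e u k → (y^ e · 1ᴺ u) k ≡ ⟦ e ≡ᵇ k ⟧ * 1ᴺ u 0
  y^-1ᴺ e []      k = trans (y^-1ₚ e k) (sym (ℤP.*-identityʳ ⟦ e ≡ᵇ k ⟧))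
  y^-1ᴺ e (h ∷ u) k = trans (y^-zero e k) (sym (ℤP.*-zeroʳ ⟦ e ≡ᵇ k ⟧))

  climb-𝟙 : ∀ j e v k → climb j e 𝟙 v k ≡ ⟦ e ≡ᵇ k ⟧ * (⟨a-b⟩^ j · (λ u → 1ᴺ u 0)) v
  climb-𝟙 j e v k =
    trans (⟨a-b⟩^-cong j (λ u → trans (y^-cong e (restart-𝟙 u) k) (y^-1ᴺ e u k)) v)
          (sym (⟨a-b⟩^-*ˡ j ⟦ e ≡ᵇ k ⟧ (λ u → 1ᴺ u 0) v))

  ⟦≤ᵇ≤ᵇ𝟙⟧-decrChains : ∀ X Z → ⟦ (X ≤ᵇ Z) ∧ (Z ≤ᵇ 𝟙) ⟧ * decrChains X Z ≡ decrChains X Z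
  ⟦≤ᵇ≤ᵇ𝟙⟧-decrChains X Z with X ≤? Z
  ... | no X≰Z  = sym (decrChains-≰ X≰Z)
  ... | yes X≤Z rewrite ≤ᵇ-true (𝟙-max Z) = ℤP.*-identityˡ (decrChains X Z)

  walkViaTo-𝟙 : ∀ {X} → X ≢ 𝟙 → ∀ Z v k →
    walkViaTo X Z 𝟙 v k ≡ ⟦ (rank Z ∸ rank X) ≡ᵇ k ⟧ * (⟨a-b⟩^ (n ∸ suc (rank X)) · (λ u → 1ᴺ u 0)) v
  walkViaTo-𝟙 {X} X≢𝟙 Z v k = begin
      ⟦ (Z ≤ᵇ 𝟙) ∧ not (X ≡ᶠ 𝟙) ⟧ * climb (rank 𝟙 ∸ suc (rank X)) (rank Z ∸ rank X) 𝟙 v k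
    ≡⟨ cong₂ (λ b r → ⟦ b ⟧ * climb (r ∸ suc (rank X)) (rank Z ∸ rank X) 𝟙 v k)
             (cong₂ _∧_ (≤ᵇ-true (𝟙-max Z)) (cong not (≡ᶠ-false X≢𝟙))) rank-𝟙 ⟩
      1ℤ * climb (n ∸ suc (rank X)) (rank Z ∸ rank X) 𝟙 v k
    ≡⟨ trans (ℤP.*-identityˡ _) (climb-𝟙 (n ∸ suc (rank X)) (rank Z ∸ rank X) v k) ⟩
      ⟦ (rank Z ∸ rank X) ≡ᵇ k ⟧ * (⟨a-b⟩^ (n ∸ suc (rank X)) · (λ u → 1ᴺ u 0)) v
    ∎
    where open ≡-Reasoning

  walkViaTo-self : ∀ X Z v k → walkViaTo X Z X v k ≡ 0ℤ
  walkViaTo-self X Z v k =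
    cong (λ b → ⟦ b ⟧ * climb (rank X ∸ suc (rank X)) (rank Z ∸ rank X) X v k)
         (trans (cong (λ b → (Z ≤ᵇ X) ∧ not b) (≡ᶠ-refl X)) (BoolP.∧-zeroʳ (Z ≤ᵇ X)))

  chainTerm-[]-∑ : ∀ X v k → chainTerm X v k []
    ≡ (∑[ Z ] decrChains X Z * ⟦ (rank Z ∸ rank X) ≡ᵇ k ⟧) * (⟨a-b⟩^ (n ∸ suc (rank X)) · (λ u → 1ᴺ u 0)) v
  chainTerm-[]-∑ X v k =
    cong₂ _*_ (trans (PoinI-*ₚ X 𝟙 1ₚ k) (∑-cong (allFin m) (λ Z →
                cong₂ _*_ (⟦≤ᵇ≤ᵇ𝟙⟧-decrChains X Z) (y^-1ₚ (rank Z ∸ rank X) k))))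
              (wtCoef-[] (suc (rank X)) v)

  chainTerm-𝟙-[] : ∀ v k → chainTerm 𝟙 v k [] ≡ 1ᴺ v k
  chainTerm-𝟙-[] v k = begin
      chainTerm 𝟙 v k []
    ≡⟨ chainTerm-[]-∑ 𝟙 v k ⟩
      (∑[ Z ] decrChains 𝟙 Z * ⟦ (rank Z ∸ rank 𝟙) ≡ᵇ k ⟧) * N
    ≡⟨ cong (_* N) (∑-allFin-point 𝟙 _ (λ Z Z≢𝟙 →
         cong (_* ⟦ (rank Z ∸ rank 𝟙) ≡ᵇ k ⟧) (decrChains-≰ (λ 𝟙≤Z → Z≢𝟙 (PO.antisym (𝟙-max Z) 𝟙≤Z))))) ⟩
      decrChains 𝟙 𝟙 * ⟦ (rank 𝟙 ∸ rank 𝟙) ≡ᵇ k ⟧ * N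
    ≡⟨ cong₂ (λ d e → d * ⟦ e ≡ᵇ k ⟧ * N) (decrChains-refl 𝟙) (ℕP.n∸n≡0 (rank 𝟙)) ⟩
      1ℤ * ⟦ 0 ≡ᵇ k ⟧ * N
    ≡⟨ cong (λ j → 1ℤ * ⟦ 0 ≡ᵇ k ⟧ * (⟨a-b⟩^ j · (λ u → 1ᴺ u 0)) v)
            (trans (cong (λ r → n ∸ suc r) rank-𝟙) (ℕP.m≤n⇒m∸n≡0 (ℕP.n≤1+n n))) ⟩
      1ℤ * ⟦ 0 ≡ᵇ k ⟧ * 1ᴺ v 0
    ≡⟨ unit v k ⟩
      1ᴺ v k
    ∎
    where
    open ≡-Reasoning
    N = (⟨a-b⟩^ (n ∸ suc (rank 𝟙)) · (λ u → 1ᴺ u 0)) v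
    unit : ∀ v k → 1ℤ * ⟦ 0 ≡ᵇ k ⟧ * 1ᴺ v 0 ≡ 1ᴺ v k
    unit []      zero    = refl
    unit []      (suc k) = refl
    unit (_ ∷ _) zero    = refl
    unit (_ ∷ _) (suc k) = refl

  chainTerm-[] : ∀ X v k →
    chainTerm X v k [] ≡ ⟦ X ≡ᶠ 𝟙 ⟧ * 1ᴺ v k + (∑[ Z ] decrChains X Z * walkViaTo X Z 𝟙 v k)
  chainTerm-[] X v k = by-cases (X FinP.≟ 𝟙)
    where
    open ≡-Reasoning
    via𝟙 = (∑[ Z ] decrChains X Z * walkViaTo X Z 𝟙 v k)
    by-cases : Dec (X ≡ 𝟙) → chainTerm X v k [] ≡ ⟦ X ≡ᶠ 𝟙 ⟧ * 1ᴺ v k + via𝟙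
    by-cases (yes refl) = begin
        chainTerm 𝟙 v k []
      ≡⟨ chainTerm-𝟙-[] v k ⟩
        1ᴺ v k
      ≡⟨ sym (trans (cong₂ _+_ (cong (λ b → ⟦ b ⟧ * 1ᴺ v k) (≡ᶠ-refl 𝟙))
                               (trans (∑-cong (allFin m) (λ Z → trans (cong (decrChains 𝟙 Z *_) (walkViaTo-self 𝟙 Z v k))
                                                                      (ℤP.*-zeroʳ (decrChains 𝟙 Z))))
                                      (∑-zero (allFin m))))
                    (trans (ℤP.+-identityʳ _) (ℤP.*-identityˡ (1ᴺ v k)))) ⟩
        ⟦ 𝟙 ≡ᶠ 𝟙 ⟧ * 1ᴺ v k + via𝟙
      ∎
    by-cases (no X≢𝟙) = begin
        chainTerm X v k []
      ≡⟨ chainTerm-[]-∑ X v k ⟩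
        (∑[ Z ] decrChains X Z * ⟦ (rank Z ∸ rank X) ≡ᵇ k ⟧) * N
      ≡⟨ sym (∑-*ʳ (allFin m) N _) ⟩
        (∑[ Z ] decrChains X Z * ⟦ (rank Z ∸ rank X) ≡ᵇ k ⟧ * N)
      ≡⟨ ∑-cong (allFin m) (λ Z → trans (ℤP.*-assoc (decrChains X Z) _ N)
                                        (cong (decrChains X Z *_) (sym (walkViaTo-𝟙 X≢𝟙 Z v k)))) ⟩
        via𝟙
      ≡⟨ sym (trans (cong (λ b → ⟦ b ⟧ * 1ᴺ v k + via𝟙) (≡ᶠ-false X≢𝟙)) (ℤP.+-identityˡ via𝟙)) ⟩
        ⟦ X ≡ᶠ 𝟙 ⟧ * 1ᴺ v k + via𝟙
      ∎
      where N = (⟨a-b⟩^ (n ∸ suc (rank X)) · (λ u → 1ᴺ u 0)) v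

  chainSumF-⟨a-b⟩^ : ∀ B X j (H : Word → List (Fin m) → ℤ) v →
    chainSumF B X (λ C → (⟨a-b⟩^ j · (λ u → H u C)) v) ≡ (⟨a-b⟩^ j · (λ u → chainSumF B X (H u))) v
  chainSumF-⟨a-b⟩^ B X zero    H v       = refl
  chainSumF-⟨a-b⟩^ B X (suc j) H []      = chainSumF-zero B X
  chainSumF-⟨a-b⟩^ B X (suc j) H (h ∷ v) =
    trans (chainSumF-*ˡ B X (coef-a-b h) (λ C → (⟨a-b⟩^ j · (λ u → H u C)) v))
          (cong (coef-a-b h *_) (chainSumF-⟨a-b⟩^ B X j H v))

  chainSum-restart : ∀ {Y} → Y ≢ 𝟙 → (∀ v k → chainSum Y (chainTerm Y v k) ≡ walk Y v k) → ∀ e u k →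
    chainSum Y (λ C → (y^ e · PoinC (Y ∷ C)) k * headCoef coef-b (wtCoef (suc (rank Y)) C) u) ≡ (y^ e · restart Y u) k
  chainSum-restart {Y} Y≢𝟙 IH e [] k rewrite ≡ᶠ-false Y≢𝟙 =
    trans (chainSumF-cong B Y (λ C _ → ℤP.*-zeroʳ ((y^ e · PoinC (Y ∷ C)) k)))
          (trans (chainSumF-zero B Y) (sym (y^-zero e k)))
    where B = suc (n ∸ rank Y)
  chainSum-restart {Y} Y≢𝟙 IH e (h ∷ u) k = begin
      chainSum Y (λ C → (y^ e · PoinC (Y ∷ C)) k * (coef-b h * wtCoef (suc (rank Y)) C u))
    ≡⟨ chainSumF-cong B Y (λ C _ → trans (y^-*ʳ e (coef-b h * wtCoef (suc (rank Y)) C u) (PoinC (Y ∷ C)) k)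
         (y^-cong e (λ i → solve 3 (λ p c w → p :* (c :* w) := c :* (p :* w)) refl
                               (PoinC (Y ∷ C) i) (coef-b h) (wtCoef (suc (rank Y)) C u)) k)) ⟩
      chainSum Y (λ C → (y^ e · (λ i → coef-b h * chainTerm Y u i C)) k)
    ≡⟨ chainSumF-y^ B Y e k (λ i C → coef-b h * chainTerm Y u i C) ⟩
      (y^ e · (λ i → chainSum Y (λ C → coef-b h * chainTerm Y u i C))) k
    ≡⟨ y^-cong e (λ i → trans (chainSumF-*ˡ B Y (coef-b h) (chainTerm Y u i))
                             (trans (cong (coef-b h *_) (IH u i)) (sym (restart-≢𝟙 Y≢𝟙 h u i)))) k ⟩
      (y^ e · restart Y (h ∷ u)) k
    ∎
    where
    open ≡-Reasoning
    B = suc (n ∸ rank Y)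

  chainSum-from : ∀ {X Y} → T (chainStep X Y) → (∀ v k → chainSum Y (chainTerm Y v k) ≡ walk Y v k) → ∀ v k →
    chainSum Y (λ C → chainTerm X v k (Y ∷ C))
    ≡ (∑[ Z ] (⟦ (X ≤ᵇ Z) ∧ (Z ≤ᵇ Y) ⟧ * decrChains X Z) * climbVia X Z Y v k)
  chainSum-from {X} {Y} X<Y<𝟙 IH v k = begin
      chainSum Y (λ C → chainTerm X v k (Y ∷ C))
    ≡⟨ chainSumF-cong B Y split-first ⟩
      chainSum Y (λ C → (∑[ Z ] A Z * (⟨a-b⟩^ j · (λ u → (y^ e Z · PoinC (Y ∷ C)) k * rest C u)) v))
    ≡⟨ chainSumF-∑ B Y (allFin m) A (λ Z C → (⟨a-b⟩^ j · (λ u → (y^ e Z · PoinC (Y ∷ C)) k * rest C u)) v) ⟩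
      (∑[ Z ] A Z * chainSum Y (λ C → (⟨a-b⟩^ j · (λ u → (y^ e Z · PoinC (Y ∷ C)) k * rest C u)) v))
    ≡⟨ ∑-cong (allFin m) (λ Z → cong (A Z *_) (trans
         (chainSumF-⟨a-b⟩^ B Y j (λ u C → (y^ e Z · PoinC (Y ∷ C)) k * rest C u) v)
         (⟨a-b⟩^-cong j (λ u → chainSum-restart (proj₂ Y<𝟙) IH (e Z) u k) v))) ⟩
      (∑[ Z ] A Z * climb j (e Z) Y v k)
    ∎
    where
    open ≡-Reasoning
    B = suc (n ∸ rank Y)
    X<Y = T-<ᵇ (T-∧-fst X<Y<𝟙)
    Y<𝟙 = T-<ᵇ (T-∧-snd {X <ᵇ Y} X<Y<𝟙)
    j = rank Y ∸ suc (rank X)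
    e : Fin m → ℕ
    e Z = rank Z ∸ rank X
    A : Fin m → ℤ
    A Z = ⟦ (X ≤ᵇ Z) ∧ (Z ≤ᵇ Y) ⟧ * decrChains X Z
    rest : List (Fin m) → Word → ℤ
    rest C = headCoef coef-b (wtCoef (suc (rank Y)) C)
    split-first : ∀ C → T (chainAbove Y C) → chainTerm X v k (Y ∷ C)
      ≡ (∑[ Z ] A Z * (⟨a-b⟩^ j · (λ u → (y^ e Z · PoinC (Y ∷ C)) k * rest C u)) v)
    split-first C chain = begin
        (PoinI X Y *ₚ PoinC (Y ∷ C)) k * wtCoef (suc (rank X)) (Y ∷ C) v
      ≡⟨ cong₂ _*_ (PoinI-*ₚ X Y (PoinC (Y ∷ C)) k)
           (wtCoef-∷ (suc (rank X)) Y C v (rank-strict (proj₁ X<Y) (proj₂ X<Y))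
                     (subst (rank Y ℕ.<_) rank-𝟙 (rank-strict (proj₁ Y<𝟙) (proj₂ Y<𝟙)))
                     (strictIncr-ranks Y C (T-∧-fst chain))) ⟩
        (∑[ Z ] A Z * (y^ e Z · PoinC (Y ∷ C)) k) * (⟨a-b⟩^ j · rest C) v
      ≡⟨ sym (∑-*ʳ (allFin m) ((⟨a-b⟩^ j · rest C) v) (λ Z → A Z * (y^ e Z · PoinC (Y ∷ C)) k)) ⟩
        (∑[ Z ] A Z * (y^ e Z · PoinC (Y ∷ C)) k * (⟨a-b⟩^ j · rest C) v)
      ≡⟨ ∑-cong (allFin m) (λ Z → trans (ℤP.*-assoc (A Z) _ _)
           (cong (A Z *_) (⟨a-b⟩^-*ˡ j ((y^ e Z · PoinC (Y ∷ C)) k) (rest C) v))) ⟩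
        (∑[ Z ] A Z * (⟨a-b⟩^ j · (λ u → (y^ e Z · PoinC (Y ∷ C)) k * rest C u)) v)
      ∎

  chain-indicator : ∀ X Y Z → X ≤ Z →
    chainStep X Y ∧ ((X ≤ᵇ Z) ∧ (Z ≤ᵇ Y)) ≡ not (Y ≡ᶠ 𝟙) ∧ ((Z ≤ᵇ Y) ∧ not (X ≡ᶠ Y))
  chain-indicator X Y Z X≤Z = T-ext to from
    where
    to : T (chainStep X Y ∧ ((X ≤ᵇ Z) ∧ (Z ≤ᵇ Y))) → T (not (Y ≡ᶠ 𝟙) ∧ ((Z ≤ᵇ Y) ∧ not (X ≡ᶠ Y)))
    to t = T-∧-intro (T-∧-snd {Y ≤ᵇ 𝟙} (T-∧-snd {X <ᵇ Y} chain))
                     (T-∧-intro (T-∧-snd {X ≤ᵇ Z} (T-∧-snd {chainStep X Y} t))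
                                (T-∧-snd {X ≤ᵇ Y} (T-∧-fst chain)))
      where chain = T-∧-fst t
    from : T (not (Y ≡ᶠ 𝟙) ∧ ((Z ≤ᵇ Y) ∧ not (X ≡ᶠ Y))) → T (chainStep X Y ∧ ((X ≤ᵇ Z) ∧ (Z ≤ᵇ Y)))
    from t = T-∧-intro (T-∧-intro (T-∧-intro (true⇒T (≤ᵇ-true (PO.trans X≤Z (T-≤ᵇ Z≤ᵇY)))) X≢ᵇY)
                                  (T-∧-intro (true⇒T (≤ᵇ-true (𝟙-max Y))) (T-∧-fst t)))
                       (T-∧-intro (true⇒T (≤ᵇ-true X≤Z)) Z≤ᵇY)
      where
      Z≤ᵇY = T-∧-fst (T-∧-snd {not (Y ≡ᶠ 𝟙)} t)
      X≢ᵇY = T-∧-snd {Z ≤ᵇ Y} (T-∧-snd {not (Y ≡ᶠ 𝟙)} t)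

  ∑-chains-through : ∀ X v k →
    (∑[ Y ] ⟦ chainStep X Y ⟧ * (∑[ Z ] (⟦ (X ≤ᵇ Z) ∧ (Z ≤ᵇ Y) ⟧ * decrChains X Z) * climbVia X Z Y v k))
    ≡ (∑[ Z ] decrChains X Z * (∑[ Y ] ⟦ not (Y ≡ᶠ 𝟙) ⟧ * walkViaTo X Z Y v k))
  ∑-chains-through X v k = begin
      (∑[ Y ] c Y * (∑[ Z ] A Y Z * climbVia X Z Y v k))
    ≡⟨ ∑-cong (allFin m) (λ Y → trans (sym (∑-*ˡ (allFin m) (c Y) (λ Z → A Y Z * climbVia X Z Y v k)))
                                      (∑-cong (allFin m) (pointwise Y))) ⟩
      (∑[ Y ] (∑[ Z ] decrChains X Z * (⟦ not (Y ≡ᶠ 𝟙) ⟧ * walkViaTo X Z Y v k)))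
    ≡⟨ ∑-comm (allFin m) (allFin m) _ ⟩
      (∑[ Z ] (∑[ Y ] decrChains X Z * (⟦ not (Y ≡ᶠ 𝟙) ⟧ * walkViaTo X Z Y v k)))
    ≡⟨ ∑-cong (allFin m) (λ Z → ∑-*ˡ (allFin m) (decrChains X Z) (λ Y → ⟦ not (Y ≡ᶠ 𝟙) ⟧ * walkViaTo X Z Y v k)) ⟩
      (∑[ Z ] decrChains X Z * (∑[ Y ] ⟦ not (Y ≡ᶠ 𝟙) ⟧ * walkViaTo X Z Y v k))
    ∎
    where
    open ≡-Reasoning
    c : Fin m → ℤ
    c Y = ⟦ chainStep X Y ⟧
    A : Fin m → Fin m → ℤ
    A Y Z = ⟦ (X ≤ᵇ Z) ∧ (Z ≤ᵇ Y) ⟧ * decrChains X Z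
    pointwise : ∀ Y Z → c Y * (A Y Z * climbVia X Z Y v k) ≡ decrChains X Z * (⟦ not (Y ≡ᶠ 𝟙) ⟧ * walkViaTo X Z Y v k)
    pointwise Y Z with X ≤? Z
    ... | no X≰Z  = trans (ℤP.*-zeroʳ (c Y))
                          (sym (cong (_* (⟦ not (Y ≡ᶠ 𝟙) ⟧ * walkViaTo X Z Y v k)) (decrChains-≰ X≰Z)))
    ... | yes X≤Z = begin
        c Y * (⟦ true ∧ (Z ≤ᵇ Y) ⟧ * decrChains X Z * climbVia X Z Y v k)
      ≡⟨ solve 4 (λ c a d x → c :* (a :* d :* x) := (c :* a) :* (d :* x)) refl
           (c Y) ⟦ Z ≤ᵇ Y ⟧ (decrChains X Z) (climbVia X Z Y v k) ⟩
        c Y * ⟦ true ∧ (Z ≤ᵇ Y) ⟧ * (decrChains X Z * climbVia X Z Y v k)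
      ≡⟨ cong (_* (decrChains X Z * climbVia X Z Y v k)) (sym (⟦∧⟧ (chainStep X Y) (true ∧ (Z ≤ᵇ Y)))) ⟩
        ⟦ chainStep X Y ∧ (true ∧ (Z ≤ᵇ Y)) ⟧ * (decrChains X Z * climbVia X Z Y v k)
      ≡⟨ cong (λ b → ⟦ chainStep X Y ∧ (b ∧ (Z ≤ᵇ Y)) ⟧ * (decrChains X Z * climbVia X Z Y v k))
              (sym (≤ᵇ-true X≤Z)) ⟩
        ⟦ chainStep X Y ∧ ((X ≤ᵇ Z) ∧ (Z ≤ᵇ Y)) ⟧ * (decrChains X Z * climbVia X Z Y v k)
      ≡⟨ cong (λ b → ⟦ b ⟧ * (decrChains X Z * climbVia X Z Y v k)) (chain-indicator X Y Z X≤Z) ⟩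
        ⟦ not (Y ≡ᶠ 𝟙) ∧ ((Z ≤ᵇ Y) ∧ not (X ≡ᶠ Y)) ⟧ * (decrChains X Z * climbVia X Z Y v k)
      ≡⟨ cong (_* (decrChains X Z * climbVia X Z Y v k)) (⟦∧⟧ (not (Y ≡ᶠ 𝟙)) _) ⟩
        ⟦ not (Y ≡ᶠ 𝟙) ⟧ * ⟦ (Z ≤ᵇ Y) ∧ not (X ≡ᶠ Y) ⟧ * (decrChains X Z * climbVia X Z Y v k)
      ≡⟨ solve 4 (λ a b d x → (a :* b) :* (d :* x) := d :* (a :* (b :* x))) refl
           ⟦ not (Y ≡ᶠ 𝟙) ⟧ ⟦ (Z ≤ᵇ Y) ∧ not (X ≡ᶠ Y) ⟧ (decrChains X Z) (climbVia X Z Y v k) ⟩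
        decrChains X Z * (⟦ not (Y ≡ᶠ 𝟙) ⟧ * walkViaTo X Z Y v k)
      ∎

  chainSum≡walk : ∀ X v k → chainSum X (chainTerm X v k) ≡ walk X v k
  chainSum≡walk = upward-induction _ step
    where
    step : ∀ X → (∀ Y → X ≤ Y → X ≢ Y → ∀ v k → chainSum Y (chainTerm Y v k) ≡ walk Y v k) →
           ∀ v k → chainSum X (chainTerm X v k) ≡ walk X v k
    step X IH v k = begin
        chainSum X (chainTerm X v k)
      ≡⟨ chainSum-unfold X (chainTerm X v k) ⟩
        chainTerm X v k [] + (∑[ Y ] ⟦ chainStep X Y ⟧ * chainSum Y (λ C → chainTerm X v k (Y ∷ C)))
      ≡⟨ cong₂ _+_ (chainTerm-[] X v k) (trans (∑-cong (allFin m) (λ Y → ⟦⟧-*-cong (chainStep X Y) (λ t →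
           let (X≤Y , X≢Y) = T-<ᵇ (T-∧-fst t) in chainSum-from t (IH Y X≤Y X≢Y) v k)))
                                                 (∑-chains-through X v k)) ⟩
        (⟦ X ≡ᶠ 𝟙 ⟧ * 1ᴺ v k + (∑[ Z ] decrChains X Z * walkViaTo X Z 𝟙 v k)) + (∑[ Z ] decrChains X Z * rest Z)
      ≡⟨ ℤP.+-assoc (⟦ X ≡ᶠ 𝟙 ⟧ * 1ᴺ v k) _ _ ⟩
        ⟦ X ≡ᶠ 𝟙 ⟧ * 1ᴺ v k + ((∑[ Z ] decrChains X Z * walkViaTo X Z 𝟙 v k) + (∑[ Z ] decrChains X Z * rest Z))
      ≡⟨ cong (⟦ X ≡ᶠ 𝟙 ⟧ * 1ᴺ v k +_) (trans (sym (∑-distrib-+ (allFin m) _ _)) (∑-cong (allFin m) (λ Z →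
           trans (sym (ℤP.*-distribˡ-+ (decrChains X Z) _ _))
                 (cong (decrChains X Z *_) (sym (∑-split-at 𝟙 (λ Y → walkViaTo X Z Y v k))))))) ⟩
        ⟦ X ≡ᶠ 𝟙 ⟧ * 1ᴺ v k + (∑[ Z ] decrChains X Z * walkVia X Z v k)
      ≡⟨ sym (walk-unfold X v k) ⟩
        walk X v k
      ∎
      where
      open ≡-Reasoning
      rest : Fin m → ℤ
      rest Z = (∑[ Y ] ⟦ not (Y ≡ᶠ 𝟙) ⟧ * walkViaTo X Z Y v k)

  strictIncr⇒avoids : ∀ X C → T (strictIncr (X ∷ C)) → T (avoids X C)
  strictIncr⇒avoids X C t = go C (strictIncr-ranks X C t)
    where
    go : ∀ C → All (λ Z → rank X ℕ.< rank Z) C → T (avoids X C)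
    go []      []         = tt
    go (Z ∷ C) (r< ∷ rs) =
      T-∧-intro (true⇒T (cong not (≡ᶠ-false (λ Z≡X → ℕP.<-irrefl (cong rank (sym Z≡X)) r<)))) (go C rs)

  rhs-condition : ∀ C → (strictIncr C ∧ avoids 𝟘 C ∧ avoids 𝟙 C) ≡ chainAbove 𝟘 C
  rhs-condition []      = refl
  rhs-condition (Y ∷ C) = T-ext to from
    where
    to : T (strictIncr (Y ∷ C) ∧ avoids 𝟘 (Y ∷ C) ∧ avoids 𝟙 (Y ∷ C)) → T (chainAbove 𝟘 (Y ∷ C))
    to t = T-∧-intro (T-∧-intro (true⇒T (<ᵇ-true (𝟘-min Y) 𝟘≢Y)) (T-∧-fst t)) (T-∧-snd {avoids 𝟘 (Y ∷ C)} avoid)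
      where
      avoid = T-∧-snd {strictIncr (Y ∷ C)} t
      Y≢ᵇ𝟘 : T (not (Y ≡ᶠ 𝟘))
      Y≢ᵇ𝟘 = T-∧-fst {not (Y ≡ᶠ 𝟘)} (T-∧-fst {avoids 𝟘 (Y ∷ C)} avoid)
      𝟘≢Y : 𝟘 ≢ Y
      𝟘≢Y 𝟘≡Y = T-not⇒¬T Y≢ᵇ𝟘 (subst (λ Z → T (Y ≡ᶠ Z)) (sym 𝟘≡Y) (true⇒T (≡ᶠ-refl Y)))
    from : T (chainAbove 𝟘 (Y ∷ C)) → T (strictIncr (Y ∷ C) ∧ avoids 𝟘 (Y ∷ C) ∧ avoids 𝟙 (Y ∷ C))
    from t = T-∧-intro (T-∧-snd {𝟘 <ᵇ Y} (T-∧-fst t))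
                       (T-∧-intro (strictIncr⇒avoids 𝟘 (Y ∷ C) (T-∧-fst t)) (T-∧-snd {strictIncr (𝟘 ∷ Y ∷ C)} t))

  rhs≡chainSum : ∀ w k → rhs w k ≡ chainSum 𝟘 (chainTerm 𝟘 w k)
  rhs≡chainSum w k = begin
      rhs w k
    ≡⟨ sumᴺ-map (λ C → if strictIncr C ∧ avoids 𝟘 C ∧ avoids 𝟙 C then PoinC (𝟘 ∷ C) ·ᴺ wt⁻ C else 0ᴺ) allLists w k ⟩
      ∑ allLists (λ C → (if strictIncr C ∧ avoids 𝟘 C ∧ avoids 𝟙 C then PoinC (𝟘 ∷ C) ·ᴺ wt⁻ C else 0ᴺ) w k)
    ≡⟨ ∑-cong allLists term ⟩
      ∑ allLists (λ C → ⟦ chainAbove 𝟘 C ⟧ * chainTerm 𝟘 w k C)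
    ≡⟨ ∑-concatMap listsOfLen (upTo (suc m)) (λ C → ⟦ chainAbove 𝟘 C ⟧ * chainTerm 𝟘 w k C) ⟩
      ∑ (upTo (suc m)) (λ L → ∑ (listsOfLen L) (λ C → ⟦ chainAbove 𝟘 C ⟧ * chainTerm 𝟘 w k C))
    ≡⟨ ∑-chainAbove (suc m) 𝟘 (chainTerm 𝟘 w k) ⟩
      chainSumF (suc m) 𝟘 (chainTerm 𝟘 w k)
    ≡⟨ chainSumF-stable (suc m) 𝟘 (chainTerm 𝟘 w k) (s≤s (ℕP.≤-trans (ℕP.m∸n≤m n (rank 𝟘)) (ℕP.<⇒≤ n<m))) ⟩
      chainSum 𝟘 (chainTerm 𝟘 w k)
    ∎
    where
    open ≡-Reasoning
    term : ∀ C → (if strictIncr C ∧ avoids 𝟘 C ∧ avoids 𝟙 C then PoinC (𝟘 ∷ C) ·ᴺ wt⁻ C else 0ᴺ) w k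
                 ≡ ⟦ chainAbove 𝟘 C ⟧ * chainTerm 𝟘 w k C
    term C = trans (ifᴺ-then-0ᴺ (strictIncr C ∧ avoids 𝟘 C ∧ avoids 𝟙 C) (PoinC (𝟘 ∷ C) ·ᴺ wt⁻ C) w k)
      (cong₂ _*_ (cong ⟦_⟧ (rhs-condition C))
                 (trans (*ₚ-constʳ (PoinC (𝟘 ∷ C)) (wt⁻ C w) (wtCoef 1 C w) k (wt⁻-coef C w))
                        (cong (λ r → PoinC (𝟘 ∷ C) k * wtCoef (suc r) C w) (sym rank-𝟘))))

  0≤rhs : ∀ w k → 0ℤ ℤ.≤ rhs w k
  0≤rhs w k = subst (0ℤ ℤ.≤_) (sym (trans (rhs≡chainSum w k) (chainSum≡walk 𝟘 w k))) (0≤walk 𝟘 w k)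

  ∑-allLists : ∀ (F : List (Fin m) → ℤ) →
    ∑ allLists F ≡ F [] + ∑ (upTo m) (λ L → (∑[ Y ] ∑ (listsOfLen L) (λ C → F (Y ∷ C))))
  ∑-allLists F = begin
      ∑ allLists F
    ≡⟨ ∑-concatMap listsOfLen (upTo (suc m)) F ⟩
      (F [] + 0ℤ) + ∑ (applyUpTo suc m) (λ L → ∑ (listsOfLen L) F)
    ≡⟨ cong₂ _+_ (ℤP.+-identityʳ (F [])) (∑-applyUpTo-suc m (λ L → ∑ (listsOfLen L) F)) ⟩
      F [] + ∑ (upTo m) (λ L → ∑ (listsOfLen (suc L)) F)
    ≡⟨ cong (F [] +_) (∑-cong (upTo m) (λ L → listsOfLen-suc P L F)) ⟩
      F [] + ∑ (upTo m) (λ L → (∑[ Y ] ∑ (listsOfLen L) (λ C → F (Y ∷ C))))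
    ∎
    where open ≡-Reasoning

  exΨ-coef : ∀ u k → exΨ u k ≡ ∑ allLists (λ C → ⟦ strictIncr C ∧ avoids 𝟙 C ⟧ * (PoinC C k * wtCoef 0 C u))
  exΨ-coef u k = trans (sumᴺ-map (λ C → if strictIncr C ∧ avoids 𝟙 C then PoinC C ·ᴺ wt C else 0ᴺ) allLists u k)
    (∑-cong allLists (λ C → trans (ifᴺ-then-0ᴺ (strictIncr C ∧ avoids 𝟙 C) (PoinC C ·ᴺ wt C) u k)
      (cong (⟦ strictIncr C ∧ avoids 𝟙 C ⟧ *_) (*ₚ-constʳ (PoinC C) (wt C u) (wtCoef 0 C u) k (wt-coef C u)))))

  ι-exΨ-letters : ∀ w k → exΨ (𝐚 ∷ w) k + exΨ (𝐛 ∷ w) k ≡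
    ∑ allLists (λ C → ⟦ strictIncr C ∧ avoids 𝟙 C ⟧ * (PoinC C k * (⟦ 0 ℕ.<ᵇ n ⟧ * (⟦ inRank 0 C ⟧ * wtCoef 1 C w))))
  ι-exΨ-letters w k = begin
      exΨ (𝐚 ∷ w) k + exΨ (𝐛 ∷ w) k
    ≡⟨ cong₂ _+_ (exΨ-coef (𝐚 ∷ w) k) (exΨ-coef (𝐛 ∷ w) k) ⟩
      ∑ allLists (λ C → c C * (PoinC C k * wtCoef 0 C (𝐚 ∷ w))) + ∑ allLists (λ C → c C * (PoinC C k * wtCoef 0 C (𝐛 ∷ w)))
    ≡⟨ sym (∑-distrib-+ allLists (λ C → c C * (PoinC C k * wtCoef 0 C (𝐚 ∷ w)))
          (λ C → c C * (PoinC C k * wtCoef 0 C (𝐛 ∷ w)))) ⟩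
      ∑ allLists (λ C → c C * (PoinC C k * wtCoef 0 C (𝐚 ∷ w)) + c C * (PoinC C k * wtCoef 0 C (𝐛 ∷ w)))
    ≡⟨ ∑-cong allLists (λ C → trans
         (solve 6 (λ g p z a b x → g :* (p :* (z :* (a :* x))) :+ g :* (p :* (z :* (b :* x)))
                                   := g :* (p :* (z :* ((a :+ b) :* x))))
            refl (c C) (PoinC C k) ⟦ 0 ℕ.<ᵇ n ⟧ (letterCoef (inRank 0 C) 𝐚) (letterCoef (inRank 0 C) 𝐛) (wtCoef 1 C w))
         (cong (λ t → c C * (PoinC C k * (⟦ 0 ℕ.<ᵇ n ⟧ * (t * wtCoef 1 C w)))) (letterCoef-sum (inRank 0 C)))) ⟩
      ∑ allLists (λ C → c C * (PoinC C k * (⟦ 0 ℕ.<ᵇ n ⟧ * (⟦ inRank 0 C ⟧ * wtCoef 1 C w))))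
    ∎
    where
    open ≡-Reasoning
    c : List (Fin m) → ℤ
    c C = ⟦ strictIncr C ∧ avoids 𝟙 C ⟧

  𝟘≢𝟙 : 0 ℕ.< n → 𝟘 ≢ 𝟙
  𝟘≢𝟙 0<n 𝟘≡𝟙 = ℕP.<-irrefl (trans (sym rank-𝟘) (trans (cong rank 𝟘≡𝟙) rank-𝟙)) 0<n

  chain-through-rank-0 : 0 ℕ.< n → ∀ w k Y C →
    ⟦ strictIncr (Y ∷ C) ∧ avoids 𝟙 (Y ∷ C) ⟧ * (PoinC (Y ∷ C) k * (⟦ inRank 0 (Y ∷ C) ⟧ * wtCoef 1 (Y ∷ C) w))
    ≡ ⟦ Y ≡ᶠ 𝟘 ⟧ * (⟦ chainAbove 𝟘 C ⟧ * chainTerm 𝟘 w k C)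
  chain-through-rank-0 0<n w k Y C = by-cases (Y FinP.≟ 𝟘)
    where
    open ≡-Reasoning
    by-cases : Dec (Y ≡ 𝟘) →
      ⟦ strictIncr (Y ∷ C) ∧ avoids 𝟙 (Y ∷ C) ⟧ * (PoinC (Y ∷ C) k * (⟦ inRank 0 (Y ∷ C) ⟧ * wtCoef 1 (Y ∷ C) w))
      ≡ ⟦ Y ≡ᶠ 𝟘 ⟧ * (⟦ chainAbove 𝟘 C ⟧ * chainTerm 𝟘 w k C)
    by-cases (yes refl) = begin
        ⟦ strictIncr (𝟘 ∷ C) ∧ (not (𝟘 ≡ᶠ 𝟙) ∧ avoids 𝟙 C) ⟧
          * (PoinC (𝟘 ∷ C) k * (⟦ (rank 𝟘 ≡ᵇ 0) ∨ inRank 0 C ⟧ * wtCoef 1 (𝟘 ∷ C) w))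
      ≡⟨ cong₂ (λ a r → ⟦ strictIncr (𝟘 ∷ C) ∧ (not a ∧ avoids 𝟙 C) ⟧
                          * (PoinC (𝟘 ∷ C) k * (⟦ (r ≡ᵇ 0) ∨ inRank 0 C ⟧ * wtCoef 1 (𝟘 ∷ C) w)))
               (≡ᶠ-false (𝟘≢𝟙 0<n)) rank-𝟘 ⟩
        ⟦ chainAbove 𝟘 C ⟧ * (PoinC (𝟘 ∷ C) k * (1ℤ * wtCoef 1 (𝟘 ∷ C) w))
      ≡⟨ cong (λ x → ⟦ chainAbove 𝟘 C ⟧ * (PoinC (𝟘 ∷ C) k * x))
              (trans (ℤP.*-identityˡ _) (trans (wtCoef-above 1 𝟘 C w (subst (ℕ._< 1) (sym rank-𝟘) (s≤s z≤n)))
                                                (cong (λ r → wtCoef (suc r) C w) (sym rank-𝟘)))) ⟩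
        ⟦ chainAbove 𝟘 C ⟧ * chainTerm 𝟘 w k C
      ≡⟨ sym (trans (cong (λ b → ⟦ b ⟧ * (⟦ chainAbove 𝟘 C ⟧ * chainTerm 𝟘 w k C)) (≡ᶠ-refl 𝟘)) (ℤP.*-identityˡ _)) ⟩
        ⟦ 𝟘 ≡ᶠ 𝟘 ⟧ * (⟦ chainAbove 𝟘 C ⟧ * chainTerm 𝟘 w k C)
      ∎
    by-cases (no Y≢𝟘) rewrite ≡ᶠ-false Y≢𝟘 = ⟦⟧-*-vanish (strictIncr (Y ∷ C) ∧ avoids 𝟙 (Y ∷ C)) (λ t →
      trans (cong (λ b → PoinC (Y ∷ C) k * (⟦ b ⟧ * wtCoef 1 (Y ∷ C) w))
                  (inRank-above 0 (Y ∷ C) (0<rY ∷ All-map (ℕP.<-trans 0<rY) (strictIncr-ranks Y C (T-∧-fst t)))))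
            (ℤP.*-zeroʳ (PoinC (Y ∷ C) k)))
      where
      0<rY : 0 ℕ.< rank Y
      0<rY = ℕP.n≢0⇒n>0 (λ rY≡0 → Y≢𝟘 (rank≡0 rY≡0))

  ι-exΨ-pos : 0 ℕ.< n → ∀ w k → ι exΨ w k ≡ chainSum 𝟘 (chainTerm 𝟘 w k)
  ι-exΨ-pos 0<n w k = begin
      ι exΨ w k
    ≡⟨ cong₂ _+_ (ι-exΨ-letters w k) (no-empty-word w) ⟩
      ∑ allLists (λ C → c C * (PoinC C k * (⟦ 0 ℕ.<ᵇ n ⟧ * (⟦ inRank 0 C ⟧ * wtCoef 1 C w)))) + 0ℤ
    ≡⟨ trans (ℤP.+-identityʳ _) (∑-cong allLists (λ C → cong (λ x → c C * (PoinC C k * x))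
         (trans (cong (λ b → ⟦ b ⟧ * (⟦ inRank 0 C ⟧ * wtCoef 1 C w)) (T⇒true (ℕP.<⇒<ᵇ 0<n))) (ℤP.*-identityˡ _)))) ⟩
      ∑ allLists G
    ≡⟨ ∑-allLists G ⟩
      G [] + ∑ (upTo m) (λ L → (∑[ Y ] ∑ (listsOfLen L) (λ C → G (Y ∷ C))))
    ≡⟨ cong₂ _+_ (trans (ℤP.*-identityˡ (1ₚ k * 0ℤ)) (ℤP.*-zeroʳ (1ₚ k))) (∑-cong (upTo m) (λ L → begin
         (∑[ Y ] ∑ (listsOfLen L) (λ C → G (Y ∷ C)))
       ≡⟨ ∑-cong (allFin m) (λ Y → trans (∑-cong (listsOfLen L) (chain-through-rank-0 0<n w k Y))
                                         (∑-*ˡ (listsOfLen L) ⟦ Y ≡ᶠ 𝟘 ⟧ _)) ⟩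
         (∑[ Y ] ⟦ Y ≡ᶠ 𝟘 ⟧ * ∑ (listsOfLen L) (λ C → ⟦ chainAbove 𝟘 C ⟧ * chainTerm 𝟘 w k C))
       ≡⟨ ∑-delta 𝟘 (λ _ → ∑ (listsOfLen L) (λ C → ⟦ chainAbove 𝟘 C ⟧ * chainTerm 𝟘 w k C)) ⟩
         ∑ (listsOfLen L) (λ C → ⟦ chainAbove 𝟘 C ⟧ * chainTerm 𝟘 w k C)
       ∎)) ⟩
      0ℤ + ∑ (upTo m) (λ L → ∑ (listsOfLen L) (λ C → ⟦ chainAbove 𝟘 C ⟧ * chainTerm 𝟘 w k C))
    ≡⟨ trans (ℤP.+-identityˡ _) (∑-chainAbove m 𝟘 (chainTerm 𝟘 w k)) ⟩
      chainSumF m 𝟘 (chainTerm 𝟘 w k)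
    ≡⟨ chainSumF-stable m 𝟘 (chainTerm 𝟘 w k) (subst (λ r → suc (n ∸ r) ℕ.≤ m) (sym rank-𝟘) n<m) ⟩
      chainSum 𝟘 (chainTerm 𝟘 w k)
    ∎
    where
    open ≡-Reasoning
    c : List (Fin m) → ℤ
    c C = ⟦ strictIncr C ∧ avoids 𝟙 C ⟧
    G : List (Fin m) → ℤ
    G C = c C * (PoinC C k * (⟦ inRank 0 C ⟧ * wtCoef 1 C w))
    no-empty-word : ∀ w → (if [] ==W w then exΨ [] else 0ₚ) k ≡ 0ℤ
    no-empty-word (_ ∷ _) = refl
    no-empty-word []      = trans (exΨ-coef [] k) (trans (∑-cong allLists (λ C →
      trans (cong (λ b → c C * (PoinC C k * ⟦ b ⟧)) (¬T⇒false (λ t → ℕP.<⇒≱ 0<n (ℕP.≤ᵇ⇒≤ n 0 t))))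
            (trans (cong (c C *_) (ℤP.*-zeroʳ (PoinC C k))) (ℤP.*-zeroʳ (c C))))) (∑-zero allLists))

  walk-𝟙 : ∀ v k → walk 𝟙 v k ≡ 1ᴺ v k
  walk-𝟙 v k rewrite ≡ᶠ-refl 𝟙 =
    trans (cong (1ℤ * 1ᴺ v k +_) (∑-above-𝟙 (𝟙 ⋖ᵇ_) _ (λ _ t → t)))
          (trans (ℤP.+-identityʳ _) (ℤP.*-identityˡ (1ᴺ v k)))

  ι-exΨ-rank0 : n ≡ 0 → ∀ w k → ι exΨ w k ≡ 1ᴺ w k
  ι-exΨ-rank0 n≡0 w k = trans (cong₂ _+_ (trans (ι-exΨ-letters w k) no-letters) (only-empty-chain w)) (ℤP.+-identityˡ _)
    where
    c : List (Fin m) → ℤ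
    c C = ⟦ strictIncr C ∧ avoids 𝟙 C ⟧
    no-letters : ∑ allLists (λ C → c C * (PoinC C k * (⟦ 0 ℕ.<ᵇ n ⟧ * (⟦ inRank 0 C ⟧ * wtCoef 1 C w)))) ≡ 0ℤ
    no-letters = trans (∑-cong allLists (λ C →
      trans (cong (λ b → c C * (PoinC C k * (⟦ b ⟧ * (⟦ inRank 0 C ⟧ * wtCoef 1 C w)))) (cong (0 ℕ.<ᵇ_) n≡0))
            (trans (cong (c C *_) (ℤP.*-zeroʳ (PoinC C k))) (ℤP.*-zeroʳ (c C))))) (∑-zero allLists)
    everything-is-𝟙 : ∀ Y → Y ≡ 𝟙
    everything-is-𝟙 Y = PO.antisym (𝟙-max Y) (subst (_≤ Y) (sym (rank≡0 (trans rank-𝟙 n≡0))) (𝟘-min Y))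
    only-empty-chain : ∀ w → (if [] ==W w then exΨ [] else 0ₚ) k ≡ 1ᴺ w k
    only-empty-chain (_ ∷ _) = refl
    only-empty-chain []      = begin
        exΨ [] k
      ≡⟨ exΨ-coef [] k ⟩
        ∑ allLists (λ C → c C * (PoinC C k * ⟦ n ℕ.≤ᵇ 0 ⟧))
      ≡⟨ ∑-cong allLists (λ C → cong (λ b → c C * (PoinC C k * ⟦ b ⟧)) (cong (ℕ._≤ᵇ 0) n≡0)) ⟩
        ∑ allLists (λ C → c C * (PoinC C k * 1ℤ))
      ≡⟨ ∑-allLists (λ C → c C * (PoinC C k * 1ℤ)) ⟩
        1ℤ * (1ₚ k * 1ℤ) + ∑ (upTo m) (λ L → (∑[ Y ] ∑ (listsOfLen L) (λ C → c (Y ∷ C) * (PoinC (Y ∷ C) k * 1ℤ))))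
      ≡⟨ cong₂ _+_ (trans (ℤP.*-identityˡ _) (ℤP.*-identityʳ (1ₚ k)))
           (trans (∑-cong (upTo m) (λ L → trans (∑-cong (allFin m) (λ Y → trans (∑-cong (listsOfLen L) (λ C →
              cong (λ b → ⟦ b ⟧ * (PoinC (Y ∷ C) k * 1ℤ))
                   (trans (cong (λ b → strictIncr (Y ∷ C) ∧ (not b ∧ avoids 𝟙 C))
                                (trans (cong (Y ≡ᶠ_) (sym (everything-is-𝟙 Y))) (≡ᶠ-refl Y)))
                          (BoolP.∧-zeroʳ (strictIncr (Y ∷ C))))))
              (∑-zero (listsOfLen L)))) (∑-zero (allFin m)))) (∑-zero (upTo m))) ⟩
        1ₚ k + 0ℤ
      ≡⟨ ℤP.+-identityʳ (1ₚ k) ⟩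
        1ᴺ [] k
      ∎
      where open ≡-Reasoning

  ι-exΨ≡rhs : ∀ w k → ι exΨ w k ≡ rhs w k
  ι-exΨ≡rhs w k with n ℕP.≟ 0
  ... | yes n≡0 = trans (ι-exΨ-rank0 n≡0 w k) (sym (trans (rhs≡chainSum w k) (trans (chainSum≡walk 𝟘 w k) 𝟘-walk)))
    where
    𝟘-walk : walk 𝟘 w k ≡ 1ᴺ w k
    𝟘-walk = trans (cong (λ X → walk X w k) (sym (rank≡0 (trans rank-𝟙 n≡0)))) (walk-𝟙 w k)
  ... | no n≢0  = trans (ι-exΨ-pos (ℕP.n≢0⇒n>0 n≢0) w k) (sym (rhs≡chainSum w k))

open import Data.Integer using (+_; _≤_)

corollary2p15 : {m n : ℕ} (P : GradedPoset m n) → RLabeling P →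
    (∀ (w : Word) (k : ℕ) → ι (Index.exΨ P) w k ≡ Index.rhs P w k) ×
    (∀ (w : Word) (k : ℕ) → + 0 ≤ Index.rhs P w k)
corollary2p15 P R = ι-exΨ≡rhs P R , 0≤rhs P R
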